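{- Let $p,q\geq 4$. The torus $G=C_p\,\square\,C_q$ admits an acyclic $T$-odd orientation for every subset $T\subseteq V(G)$ satisfying $\mathcal{P}$, $\mathcal{S}$ and $\overline{\mathcal{S}}$.
   Context: Graphs are finite and simple; $d(v)$ is degree; $C_n$ is the cycle on $n$ vertices and $\square$ the Cartesian product. An orientation is $T$-odd if every vertex $v$ has odd in-degree iff $v\in T$; acyclic means no directed cycle. $Source(T)=V(G)\setminus T$, $Sink(T)=\{v\in T: d(v)\text{ odd}\}\cup\{v\notin T: d(v)\text{ even}\}$. $(\mathcal{P})$: $|E(G)|+|T|$ even. $(\mathcal{S})$: $Source(T)\neq\emptyset$ and if $|Source(T)|=1$ then $|V(G)|=1$ or $Source(T)\neq Sink(T)$. $(\overline{\mathcal{S}})$: $Sink(T)\neq\emptyset$ and if $|Sink(T)|=1$ then $|V(G)|=1$ or $Sink(T)\neq Source(T)$. -}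

module Defs where

open import Data.Nat using (ℕ; zero; suc; _+_; _*_; _%_; _≤_)
open import Data.Nat.DivMod using (m%n<n)
open import Data.Fin using (Fin; toℕ; fromℕ<) renaming (_≟_ to _≟F_)
open import Data.Bool using (Bool; true; false; if_then_else_; _∧_; _∨_; not)
open import Data.Product using (Σ; ∃; _×_; _,_; proj₁; proj₂)
open import Data.Product.Properties using (≡-dec)
open import Data.Sum using (_⊎_)
open import Relation.Nullary using (¬_; does)
open import Relation.Binary.PropositionalEquality using (_≡_)
open import Relation.Binary.Construct.Closure.Transitive using (TransClosure)

sumFin : (n : ℕ) → (Fin n → ℕ) → ℕ
sumFin zero    f = 0
sumFin (suc n) f = f Fin.zero + sumFin n (λ i → f (Fin.suc i))

cyc : {n : ℕ} → Fin n → Fin n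
cyc {suc n} i = fromℕ< (m%n<n (suc (toℕ i)) (suc n))

-- Edges: indexed by (v , b); b = false is the edge (i,j)–(i+1,j),
--        b = true  is the edge (i,j)–(i,j+1).  For p,q ≥ 3 these are
--        exactly the 2pq distinct edges of the simple graph C_p □ C_q.

V : ℕ → ℕ → Set
V p q = Fin p × Fin q

E : ℕ → ℕ → Set
E p q = V p q × Bool

_≟V_ : {p q : ℕ} → (u v : V p q) → Relation.Nullary.Dec (u ≡ v)
_≟V_ = ≡-dec _≟F_ _≟F_

eqV : {p q : ℕ} → V p q → V p q → Bool
eqV u v = does (u ≟V v)

end₁ : {p q : ℕ} → E p q → V p q
end₁ (v , _) = v

end₂ : {p q : ℕ} → E p q → V p q
end₂ ((i , j) , false) = (cyc i , j)
end₂ ((i , j) , true)  = (i , cyc j)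

sumV : {p q : ℕ} → (V p q → ℕ) → ℕ
sumV {p} {q} f = sumFin p (λ i → sumFin q (λ j → f (i , j)))

sumE : {p q : ℕ} → (E p q → ℕ) → ℕ
sumE f = sumV (λ v → f (v , false) + f (v , true))

ind : Bool → ℕ
ind true  = 1
ind false = 0

numV : (p q : ℕ) → ℕ
numV p q = sumV {p} {q} (λ _ → 1)

numE : (p q : ℕ) → ℕ
numE p q = sumE {p} {q} (λ _ → 1)

deg : {p q : ℕ} → V p q → ℕ
deg v = sumE (λ e → ind (eqV (end₁ e) v) + ind (eqV (end₂ e) v))

Orientation : ℕ → ℕ → Set
Orientation p q = E p q → Bool

tail head : {p q : ℕ} → Orientation p q → E p q → V p q
tail o e = if o e then end₁ e else end₂ e
head o e = if o e then end₂ e else end₁ e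

indeg : {p q : ℕ} → Orientation p q → V p q → ℕ
indeg o v = sumE (λ e → ind (eqV (head o e) v))

Odd : ℕ → Set
Odd n = n % 2 ≡ 1

Even : ℕ → Set
Even n = n % 2 ≡ 0

Subset : ℕ → ℕ → Set
Subset p q = V p q → Bool

card : {p q : ℕ} → Subset p q → ℕ
card T = sumV (λ v → ind (T v))

TOdd : {p q : ℕ} → Orientation p q → Subset p q → Set
TOdd o T = ∀ v → (Odd (indeg o v) → T v ≡ true) × (T v ≡ true → Odd (indeg o v))

Arc : {p q : ℕ} → Orientation p q → V p q → V p q → Set
Arc o u v = ∃ λ e → tail o e ≡ u × head o e ≡ v

Acyclic : {p q : ℕ} → Orientation p q → Set
Acyclic o = ∀ v → ¬ TransClosure (Arc o) v v

isOddB : ℕ → Bool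
isOddB n = does (n % 2 Data.Nat.≟ 1)

Source : {p q : ℕ} → Subset p q → Subset p q
Source T v = not (T v)

Sink : {p q : ℕ} → Subset p q → Subset p q
Sink T v = (T v ∧ isOddB (deg v)) ∨ (not (T v) ∧ not (isOddB (deg v)))

SameSet : {p q : ℕ} → Subset p q → Subset p q → Set
SameSet A B = ∀ v → A v ≡ B v

Nonempty : {p q : ℕ} → Subset p q → Set
Nonempty A = ∃ λ v → A v ≡ true

CondP : (p q : ℕ) → Subset p q → Set
CondP p q T = Even (numE p q + card T)

CondS : (p q : ℕ) → Subset p q → Set
CondS p q T = Nonempty (Source T) ×
  (card (Source T) ≡ 1 → numV p q ≡ 1 ⊎ ¬ SameSet (Source T) (Sink T))

CondSbar : (p q : ℕ) → Subset p q → Set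
CondSbar p q T = Nonempty (Sink T) ×
  (card (Sink T) ≡ 1 → numV p q ≡ 1 ⊎ ¬ SameSet (Sink T) (Source T))

{-# OPTIONS --safe #-}
module Submission where

-- An orientation compatible with a linear order of the vertices is acyclic, and processing the
-- vertices in that order one may decide for each vertex v whether all edges to its later
-- neighbours leave v or enter v.  If v has an odd number of later neighbours, one of the two
-- choices gives v the in-degree parity prescribed by T; if v has no earlier neighbour and v ∉ T,
-- letting all its edges leave v works.  So it suffices to order the vertices so that every vertex
-- but one, z, is of one of these two kinds; z then has the right parity by the handshake lemma
-- and (P).  The torus is 4-regular, so Sink(T) = Source(T) = V ∖ T and (S) says |V ∖ T| ≥ 2.
-- If p or q is even, an explicit order whose only vertex without earlier neighbours is a given
-- vertex outside T does the job.  If p and q are odd, |V ∖ T| is odd, hence at least 3; the torus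
-- being triangle-free, two of three vertices outside T are non-adjacent, and an explicit order in
-- which exactly these two have no earlier neighbours is built around the row of one and the
-- column of the other.  The orders compare lexicographically keys attached to the cells of the
-- p × q grid, translated so that the chosen vertices land on prescribed cells.

open import Defs
open import Data.Nat using (ℕ; zero; suc; _+_; _*_; _∸_; _%_; _≤_; _<_; s≤s; z≤n; s≤s⁻¹; _≡ᵇ_; _<ᵇ_; NonZero)
open import Data.Nat.Properties
open import Algebra.Properties.CommutativeSemigroup +-commutativeSemigroup using (interchange)
open import Data.Nat.DivMod using (m%n<n; n%n≡0; m<n⇒m%n≡m; [m+n]%n≡m%n; m%n%n≡m%n; %-distribˡ-+)
open import Data.Fin using (Fin; toℕ; fromℕ<; fromℕ; inject₁) renaming (zero to fz; suc to fs; _≟_ to _≟F_)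
open import Data.Fin.Properties using (toℕ-injective; toℕ-fromℕ<; toℕ-fromℕ; toℕ-inject₁; toℕ<n; any?)
open import Data.Bool using (Bool; true; false; if_then_else_; _∧_; _∨_; not; _xor_)
import Data.Bool as Bool
open import Data.Bool.Properties
  using (T-≡; ¬-not; not-involutive; not-distribˡ-xor; xor-same; xor-assoc; xor-comm; ∧-zeroʳ; ∧-identityʳ)
open import Data.List using (List; []; _∷_; _++_)
open import Data.Product using (Σ; ∃; _×_; _,_; proj₁; proj₂)
open import Data.Sum using (_⊎_; inj₁; inj₂)
import Data.Sum as Sum
open import Data.Unit using (⊤; tt)
open import Data.Empty using (⊥; ⊥-elim)
open import Function using (flip)
open import Function.Bundles using (Equivalence)
open import Relation.Nullary using (¬_; does; yes; no; Dec)
open import Relation.Nullary.Decidable using (dec-true; dec-false)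
open import Relation.Binary.PropositionalEquality
open import Relation.Binary.Definitions using (tri<; tri≈; tri>)
open import Relation.Binary.Construct.Closure.Transitive using (TransClosure; [_]) renaming (_∷_ to _∷⁺_)

-- Finite sums, parity and Boolean comparisons

sumFin-cong : ∀ n {f g : Fin n → ℕ} → (∀ i → f i ≡ g i) → sumFin n f ≡ sumFin n g
sumFin-cong zero    eq = refl
sumFin-cong (suc n) eq = cong₂ _+_ (eq fz) (sumFin-cong n (λ i → eq (fs i)))

sumFin-+ : ∀ n (f g : Fin n → ℕ) → sumFin n (λ i → f i + g i) ≡ sumFin n f + sumFin n g
sumFin-+ zero    f g = refl
sumFin-+ (suc n) f g = trans (cong (f fz + g fz +_) (sumFin-+ n (λ i → f (fs i)) (λ i → g (fs i))))
                             (interchange (f fz) (g fz) _ _)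

sumFin-const : ∀ n c → sumFin n (λ _ → c) ≡ n * c
sumFin-const zero    c = refl
sumFin-const (suc n) c = cong (c +_) (sumFin-const n c)

sumFin-zero : ∀ n → sumFin n (λ _ → 0) ≡ 0
sumFin-zero n = trans (sumFin-const n 0) (*-zeroʳ n)

sumFin-delta : ∀ n (k : Fin n) (g : Fin n → ℕ) →
  sumFin n (λ i → if does (i ≟F k) then g i else 0) ≡ g k
sumFin-delta (suc n) fz     g = trans (cong (g fz +_) (sumFin-zero n)) (+-identityʳ (g fz))
sumFin-delta (suc n) (fs k) g = sumFin-delta n k (λ i → g (fs i))

sumFin-swap : ∀ n m (f : Fin n → Fin m → ℕ) →
  sumFin n (λ i → sumFin m (f i)) ≡ sumFin m (λ j → sumFin n (λ i → f i j))
sumFin-swap zero    m f = sym (sumFin-zero m)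
sumFin-swap (suc n) m f = trans (cong (sumFin m (f fz) +_) (sumFin-swap n m (λ i → f (fs i))))
                                (sym (sumFin-+ m (f fz) _))

sumFin-mono : ∀ n {f g : Fin n → ℕ} → (∀ i → f i ≤ g i) → sumFin n f ≤ sumFin n g
sumFin-mono zero    le = z≤n
sumFin-mono (suc n) le = +-mono-≤ (le fz) (sumFin-mono n (λ i → le (fs i)))

sumV-cong : ∀ {p q} {f g : V p q → ℕ} → (∀ v → f v ≡ g v) → sumV f ≡ sumV g
sumV-cong {p} {q} eq = sumFin-cong p (λ i → sumFin-cong q (λ j → eq (i , j)))

sumV-+ : ∀ {p q} (f g : V p q → ℕ) → sumV (λ v → f v + g v) ≡ sumV f + sumV g
sumV-+ {p} {q} f g = trans (sumFin-cong p (λ i → sumFin-+ q _ _)) (sumFin-+ p _ _)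

sumV-const : ∀ p q c → sumV {p} {q} (λ _ → c) ≡ p * (q * c)
sumV-const p q c = trans (sumFin-cong p (λ i → sumFin-const q c)) (sumFin-const p (q * c))

sumV-swap : ∀ {p q} (f : V p q → V p q → ℕ) →
  sumV (λ u → sumV (f u)) ≡ sumV (λ v → sumV (λ u → f u v))
sumV-swap {p} {q} f =
  trans (sumFin-cong p (λ i → sumFin-swap q p (λ j k → sumFin q (λ l → f (i , j) (k , l)))))
  (trans (sumFin-swap p p (λ i k → sumFin q (λ j → sumFin q (λ l → f (i , j) (k , l)))))
         (sumFin-cong p (λ k → trans (sumFin-cong p (λ i → sumFin-swap q q (λ j l → f (i , j) (k , l))))
                                     (sumFin-swap p q (λ i l → sumFin q (λ j → f (i , j) (k , l)))))))

sumV-mono : ∀ {p q} {f g : V p q → ℕ} → (∀ v → f v ≤ g v) → sumV f ≤ sumV g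
sumV-mono {p} {q} le = sumFin-mono p (λ i → sumFin-mono q (λ j → le (i , j)))

eqV-refl : ∀ {p q} (v : V p q) → eqV v v ≡ true
eqV-refl v = dec-true (v ≟V v) refl

eqV⇒≡ : ∀ {p q} {u v : V p q} → eqV u v ≡ true → u ≡ v
eqV⇒≡ {u = u} {v} eq with u ≟V v
... | yes u≡v = u≡v

does-⇔ : ∀ {A B : Set} (a? : Dec A) (b? : Dec B) → (A → B) → (B → A) → does a? ≡ does b?
does-⇔ (yes a) b? to from = sym (dec-true b? (to a))
does-⇔ (no ¬a) b? to from = sym (dec-false b? (λ b → ¬a (from b)))

eqV-cong : ∀ {p q} {u v u′ v′ : V p q} → (u ≡ v → u′ ≡ v′) → (u′ ≡ v′ → u ≡ v) → eqV u v ≡ eqV u′ v′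
eqV-cong {u = u} {v} {u′} {v′} = does-⇔ (u ≟V v) (u′ ≟V v′)

eqV-sym : ∀ {p q} (u v : V p q) → eqV u v ≡ eqV v u
eqV-sym u v = eqV-cong {u = u} {v} {v} {u} sym sym

sumV-delta : ∀ {p q} (v : V p q) (g : V p q → ℕ) → sumV (λ u → if eqV u v then g u else 0) ≡ g v
sumV-delta {p} {q} (k , l) g =
  trans (sumFin-cong p row) (sumFin-delta p k (λ i → g (i , l)))
  where
  row : ∀ i → sumFin q (λ j → if eqV (i , j) (k , l) then g (i , j) else 0)
            ≡ (if does (i ≟F k) then g (i , l) else 0)
  row i with i ≟F k
  ... | yes refl = sumFin-delta q l (λ j → g (i , j))
  ... | no  _    = sumFin-zero q

sumV-split : ∀ {p q} (z : V p q) (g : V p q → ℕ) → sumV g ≡ g z + sumV (λ v → if eqV v z then 0 else g v)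
sumV-split z g = trans (sumV-cong (λ v → split (eqV v z) (g v)))
                       (trans (sumV-+ (λ v → if eqV v z then g v else 0) (λ v → if eqV v z then 0 else g v))
                              (cong (_+ sumV (λ v → if eqV v z then 0 else g v)) (sumV-delta z g)))
  where
  split : ∀ b n → n ≡ (if b then n else 0) + (if b then 0 else n)
  split true  n = sym (+-identityʳ n)
  split false n = refl

sumV-strict : ∀ {p q} {f g : V p q → ℕ} (u : V p q) → (∀ v → f v ≤ g v) → f u < g u → sumV f < sumV g
sumV-strict {f = f} {g} u le lt =
  subst₂ _<_ (sym (sumV-split u f)) (sym (sumV-split u g)) (+-mono-<-≤ lt (sumV-mono off-u))
  where
  off-u : ∀ v → (if eqV v u then 0 else f v) ≤ (if eqV v u then 0 else g v)
  off-u v with eqV v u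
  ... | true  = z≤n
  ... | false = le v

sumV-ind-eqV : ∀ {p q} (v : V p q) → sumV (λ u → ind (eqV u v)) ≡ 1
sumV-ind-eqV v = trans (sumV-cong (λ u → ind-if (eqV u v))) (sumV-delta v (λ _ → 1))
  where
  ind-if : ∀ b → ind b ≡ (if b then 1 else 0)
  ind-if true  = refl
  ind-if false = refl

ind-mono : ∀ {b c} → (b ≡ true → c ≡ true) → ind b ≤ ind c
ind-mono {true}  b⇒c rewrite b⇒c refl = ≤-refl
ind-mono {false} b⇒c = z≤n

ind≤1 : ∀ b → ind b ≤ 1
ind≤1 true  = ≤-refl
ind≤1 false = z≤n

<ᵇ-true : ∀ {m n} → m < n → (m <ᵇ n) ≡ true
<ᵇ-true m<n = Equivalence.to T-≡ (<⇒<ᵇ m<n)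

<ᵇ-false : ∀ {m n} → ¬ m < n → (m <ᵇ n) ≡ false
<ᵇ-false {m} {n} m≮n with m <ᵇ n in eq
... | false = refl
... | true  = ⊥-elim (m≮n (<ᵇ⇒< m n (Equivalence.from T-≡ eq)))

<ᵇ-irrefl : ∀ n → (n <ᵇ n) ≡ false
<ᵇ-irrefl n = <ᵇ-false (<-irrefl (refl {x = n}))

<ᵇ-sound : ∀ {m n} → (m <ᵇ n) ≡ true → m < n
<ᵇ-sound {m} {n} eq = <ᵇ⇒< m n (Equivalence.from T-≡ eq)

≡ᵇ-true : ∀ {m n} → m ≡ n → (m ≡ᵇ n) ≡ true
≡ᵇ-true {m} {n} m≡n = Equivalence.to T-≡ (≡⇒≡ᵇ m n m≡n)

≡ᵇ-refl : ∀ n → (n ≡ᵇ n) ≡ true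
≡ᵇ-refl n = ≡ᵇ-true {n} refl

≡ᵇ-false : ∀ {m n} → m ≢ n → (m ≡ᵇ n) ≡ false
≡ᵇ-false {m} {n} m≢n with m ≡ᵇ n in eq
... | false = refl
... | true  = ⊥-elim (m≢n (≡ᵇ⇒≡ m n (Equivalence.from T-≡ eq)))

≡ᵇ-sound : ∀ {m n} → (m ≡ᵇ n) ≡ true → m ≡ n
≡ᵇ-sound {m} {n} eq = ≡ᵇ⇒≡ m n (Equivalence.from T-≡ eq)

not-<ᵇ : ∀ {m n} → m ≢ n → not (m <ᵇ n) ≡ (n <ᵇ m)
not-<ᵇ {m} {n} m≢n with <-cmp m n
... | tri< m<n _ _ = trans (cong not (<ᵇ-true m<n)) (sym (<ᵇ-false (<-asym m<n)))
... | tri≈ _ m≡n _ = ⊥-elim (m≢n m≡n)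
... | tri> _ _ n<m = trans (cong not (<ᵇ-false (<-asym n<m))) (sym (<ᵇ-true n<m))

parity : ℕ → Bool
parity zero    = false
parity (suc n) = not (parity n)

parity-+ : ∀ m n → parity (m + n) ≡ parity m xor parity n
parity-+ zero    n = refl
parity-+ (suc m) n = trans (cong not (parity-+ m n)) (not-distribˡ-xor (parity m) (parity n))

parity-ind : ∀ b → parity (ind b) ≡ b
parity-ind true  = refl
parity-ind false = refl

%2≡ind-parity : ∀ n → n % 2 ≡ ind (parity n)
%2≡ind-parity zero          = refl
%2≡ind-parity (suc zero)    = refl
%2≡ind-parity (suc (suc n)) = trans (%2≡ind-parity n) (cong ind (sym (not-involutive (parity n))))

Odd⇒parity : ∀ {n} → Odd n → parity n ≡ true
Odd⇒parity {n} odd with parity n | trans (sym (%2≡ind-parity n)) odd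
... | true | _ = refl

parity⇒Odd : ∀ {n} → parity n ≡ true → Odd n
parity⇒Odd {n} eq = trans (%2≡ind-parity n) (cong ind eq)

Even⇒parity : ∀ {n} → Even n → parity n ≡ false
Even⇒parity {n} even with parity n | trans (sym (%2≡ind-parity n)) even
... | false | _ = refl

parity-sumFin-cong : ∀ n {f g : Fin n → ℕ} → (∀ i → parity (f i) ≡ parity (g i)) →
  parity (sumFin n f) ≡ parity (sumFin n g)
parity-sumFin-cong zero    eq = refl
parity-sumFin-cong (suc n) {f} {g} eq =
  trans (parity-+ (f fz) _)
        (trans (cong₂ _xor_ (eq fz) (parity-sumFin-cong n (λ i → eq (fs i)))) (sym (parity-+ (g fz) _)))

parity-sumV-cong : ∀ {p q} {f g : V p q → ℕ} → (∀ v → parity (f v) ≡ parity (g v)) →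
  parity (sumV f) ≡ parity (sumV g)
parity-sumV-cong {p} {q} eq = parity-sumFin-cong p (λ i → parity-sumFin-cong q (λ j → eq (i , j)))

xor-cancelʳ : ∀ a b c → a xor c ≡ b xor c → a ≡ b
xor-cancelʳ true  true  c eq = refl
xor-cancelʳ false false c eq = refl
xor-cancelʳ true  false true  ()
xor-cancelʳ true  false false ()
xor-cancelʳ false true  true  ()
xor-cancelʳ false true  false ()

-- The torus: neighbours, degrees and the handshake lemma

toℕ-cyc : ∀ {n} (i : Fin (suc n)) → toℕ (cyc i) ≡ suc (toℕ i) % suc n
toℕ-cyc {n} i = toℕ-fromℕ< (m%n<n (suc (toℕ i)) (suc n))

cyc⁻¹ : ∀ {n} → Fin n → Fin n
cyc⁻¹ {suc n} fz     = fromℕ n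
cyc⁻¹ {suc n} (fs i) = inject₁ i

cyc-cyc⁻¹ : ∀ {n} (i : Fin n) → cyc (cyc⁻¹ i) ≡ i
cyc-cyc⁻¹ {suc n} fz = toℕ-injective (begin
  toℕ (cyc (fromℕ n))     ≡⟨ toℕ-cyc (fromℕ n) ⟩
  suc (toℕ (fromℕ n)) % suc n ≡⟨ cong (λ x → suc x % suc n) (toℕ-fromℕ n) ⟩
  suc n % suc n           ≡⟨ n%n≡0 (suc n) ⟩
  0                       ∎)
  where open ≡-Reasoning
cyc-cyc⁻¹ {suc n} (fs i) = toℕ-injective (begin
  toℕ (cyc (inject₁ i))       ≡⟨ toℕ-cyc (inject₁ i) ⟩
  suc (toℕ (inject₁ i)) % suc n ≡⟨ cong (λ x → suc x % suc n) (toℕ-inject₁ i) ⟩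
  suc (toℕ i) % suc n         ≡⟨ m<n⇒m%n≡m (s≤s (toℕ<n i)) ⟩
  suc (toℕ i)                 ∎)
  where open ≡-Reasoning

toℕ-cyc⁻¹-zero : ∀ {n} (c : Fin (suc n)) → toℕ c ≡ 0 → toℕ (cyc⁻¹ c) ≡ n
toℕ-cyc⁻¹-zero fz _ = toℕ-fromℕ _

toℕ-cyc⁻¹-suc : ∀ {n} (c : Fin (suc n)) t → toℕ c ≡ suc t → toℕ (cyc⁻¹ c) ≡ t
toℕ-cyc⁻¹-suc (fs c) t eq = trans (toℕ-inject₁ c) (suc-injective eq)

cyc⁻¹-cyc : ∀ {n} (i : Fin n) → cyc⁻¹ (cyc i) ≡ i
cyc⁻¹-cyc {suc n} i with m≤n⇒m<n∨m≡n (s≤s⁻¹ (toℕ<n i))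
... | inj₁ i<n = toℕ-injective (toℕ-cyc⁻¹-suc (cyc i) (toℕ i) (trans (toℕ-cyc i) (m<n⇒m%n≡m (s≤s i<n))))
... | inj₂ i≡n = toℕ-injective (trans (toℕ-cyc⁻¹-zero (cyc i) cyc-i≡0) (sym i≡n))
  where
  cyc-i≡0 : toℕ (cyc i) ≡ 0
  cyc-i≡0 = trans (toℕ-cyc i) (trans (cong (λ x → suc x % suc n) i≡n) (n%n≡0 (suc n)))

upV dnV lfV rtV : ∀ {p q} → V p q → V p q
upV (i , j) = (cyc⁻¹ i , j)
dnV (i , j) = (cyc i , j)
lfV (i , j) = (i , cyc⁻¹ j)
rtV (i , j) = (i , cyc j)

dnV-upV : ∀ {p q} (v : V p q) → dnV (upV v) ≡ v
dnV-upV (i , j) = cong (_, j) (cyc-cyc⁻¹ i)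

rtV-lfV : ∀ {p q} (v : V p q) → rtV (lfV v) ≡ v
rtV-lfV (i , j) = cong (i ,_) (cyc-cyc⁻¹ j)

upV-dnV : ∀ {p q} (v : V p q) → upV (dnV v) ≡ v
upV-dnV (i , j) = cong (_, j) (cyc⁻¹-cyc i)

lfV-rtV : ∀ {p q} (v : V p q) → lfV (rtV v) ≡ v
lfV-rtV (i , j) = cong (i ,_) (cyc⁻¹-cyc j)

eqV-dnV : ∀ {p q} (u v : V p q) → eqV (dnV u) v ≡ eqV u (upV v)
eqV-dnV u v = eqV-cong (λ eq → trans (sym (upV-dnV u)) (cong upV eq)) (λ eq → trans (cong dnV eq) (dnV-upV v))

eqV-rtV : ∀ {p q} (u v : V p q) → eqV (rtV u) v ≡ eqV u (lfV v)
eqV-rtV u v = eqV-cong (λ eq → trans (sym (lfV-rtV u)) (cong lfV eq)) (λ eq → trans (cong rtV eq) (rtV-lfV v))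

sumV-head : ∀ {p q} (c : V p q → Bool) (s s⁻¹ : V p q → V p q) →
  (∀ u v → eqV (s u) v ≡ eqV u (s⁻¹ v)) → ∀ v →
  sumV (λ u → ind (eqV (if c u then s u else u) v)) ≡ ind (c (s⁻¹ v)) + ind (not (c v))
sumV-head c s s⁻¹ adj v =
  trans (sumV-cong split)
        (trans (sumV-+ (λ u → if eqV u (s⁻¹ v) then ind (c u) else 0) (λ u → if eqV u v then ind (not (c u)) else 0))
               (cong₂ _+_ (sumV-delta (s⁻¹ v) (λ u → ind (c u))) (sumV-delta v (λ u → ind (not (c u))))))
  where
  split : ∀ u → ind (eqV (if c u then s u else u) v)
              ≡ (if eqV u (s⁻¹ v) then ind (c u) else 0) + (if eqV u v then ind (not (c u)) else 0)
  split u with c u | eqV u (s⁻¹ v) in e | eqV u v in e′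
  ... | true  | true  | true  = cong ind (trans (adj u v) e)
  ... | true  | true  | false = cong ind (trans (adj u v) e)
  ... | true  | false | true  = cong ind (trans (adj u v) e)
  ... | true  | false | false = cong ind (trans (adj u v) e)
  ... | false | true  | true  = cong ind e′
  ... | false | true  | false = cong ind e′
  ... | false | false | true  = cong ind e′
  ... | false | false | false = cong ind e′

indeg-formula : ∀ {p q} (o : Orientation p q) (v : V p q) →
  indeg o v ≡ (ind (o (upV v , false)) + ind (not (o (v , false))))
             + (ind (o (lfV v , true)) + ind (not (o (v , true))))
indeg-formula o v =
  trans (sumV-+ (λ u → ind (eqV (head o (u , false)) v)) (λ u → ind (eqV (head o (u , true)) v)))
        (cong₂ _+_ (sumV-head (λ u → o (u , false)) dnV upV eqV-dnV v)
                   (sumV-head (λ u → o (u , true)) rtV lfV eqV-rtV v))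

deg≡4 : ∀ {p q} (v : V p q) → deg v ≡ 4
deg≡4 v = trans (sumV-+ (λ u → ind (eqV u v) + ind (eqV (dnV u) v)) (λ u → ind (eqV u v) + ind (eqV (rtV u) v)))
                (cong₂ _+_ (trans (sumV-+ (λ u → ind (eqV u v)) (λ u → ind (eqV (dnV u) v)))
                                  (cong₂ _+_ (sumV-ind-eqV v) (trans (sumV-cong (λ u → cong ind (eqV-dnV u v))) (sumV-ind-eqV (upV v)))))
                           (trans (sumV-+ (λ u → ind (eqV u v)) (λ u → ind (eqV (rtV u) v)))
                                  (cong₂ _+_ (sumV-ind-eqV v) (trans (sumV-cong (λ u → cong ind (eqV-rtV u v))) (sumV-ind-eqV (lfV v))))))

handshake : ∀ {p q} (o : Orientation p q) → sumV (indeg o) ≡ numE p q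
handshake o =
  trans (sumV-swap (λ v u → ind (eqV (head o (u , false)) v) + ind (eqV (head o (u , true)) v)))
        (sumV-cong (λ u → trans (sumV-+ (λ v → ind (eqV (head o (u , false)) v)) (λ v → ind (eqV (head o (u , true)) v)))
                                (cong₂ _+_ (one (u , false)) (one (u , true)))))
  where
  one : ∀ e → sumV (λ v → ind (eqV (head o e) v)) ≡ 1
  one e = trans (sumV-cong (λ v → cong ind (eqV-sym (head o e) v))) (sumV-ind-eqV (head o e))

handshake-parity : ∀ {p q} (o : Orientation p q) (T : Subset p q) (z : V p q) → CondP p q T →
  (∀ v → v ≢ z → parity (indeg o v) ≡ T v) → parity (indeg o z) ≡ T z
handshake-parity {p} {q} o T z even-ET others = xor-cancelʳ _ _ _ (begin
  parity (indeg o z) xor parity (rest (indeg o))        ≡⟨ sym (parity-+ (indeg o z) _) ⟩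
  parity (indeg o z + rest (indeg o))                   ≡⟨ cong parity (sym (sumV-split z (indeg o))) ⟩
  parity (sumV (indeg o))                               ≡⟨ cong parity (handshake o) ⟩
  parity (numE p q)                                     ≡⟨ parity-E≡parity-T ⟩
  parity (card T)                                       ≡⟨ cong parity (sumV-split z (λ v → ind (T v))) ⟩
  parity (ind (T z) + rest (λ v → ind (T v)))           ≡⟨ parity-+ (ind (T z)) _ ⟩
  parity (ind (T z)) xor parity (rest (λ v → ind (T v))) ≡⟨ cong₂ _xor_ (parity-ind (T z)) (sym rest-parity) ⟩
  T z xor parity (rest (indeg o))                       ∎)
  where
  open ≡-Reasoning
  rest : (V p q → ℕ) → ℕ
  rest g = sumV (λ v → if eqV v z then 0 else g v)
  rest-parity : parity (rest (indeg o)) ≡ parity (rest (λ v → ind (T v)))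
  rest-parity = parity-sumV-cong pointwise
    where
    pointwise : ∀ v → parity (if eqV v z then 0 else indeg o v) ≡ parity (if eqV v z then 0 else ind (T v))
    pointwise v with v ≟V z
    ... | yes _  = refl
    ... | no v≢z = trans (others v v≢z) (sym (parity-ind (T v)))
  parity-E≡parity-T : parity (numE p q) ≡ parity (card T)
  parity-E≡parity-T = xor-cancelʳ _ _ (parity (card T))
    (trans (sym (parity-+ (numE p q) (card T))) (trans (Even⇒parity {numE p q + card T} even-ET) (sym (xor-same (parity (card T))))))

-- Greedy orientations along a strict order

module GreedyOrientation {p q} (T : Subset p q) (_≺_ : V p q → V p q → Bool)
  (≺-irrefl : ∀ v → (v ≺ v) ≡ false)
  (≺-trans : ∀ {u v w} → (u ≺ v) ≡ true → (v ≺ w) ≡ true → (u ≺ w) ≡ true) where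

  ≺-asym : ∀ {u v} → (u ≺ v) ≡ true → (v ≺ u) ≡ false
  ≺-asym {u} {v} u≺v with v ≺ u in v≺u
  ... | false = refl
  ... | true  = trans (sym (≺-trans u≺v v≺u)) (≺-irrefl u)

  Comparable : V p q → V p q → Set
  Comparable u v = (u ≺ v) ≡ true ⊎ (v ≺ u) ≡ true

  around : V p q → (V p q → ℕ) → ℕ
  around v h = (h (upV v) + h (dnV v)) + (h (lfV v) + h (rtV v))

  around-+ : ∀ v (g h : V p q → ℕ) → around v (λ u → g u + h u) ≡ around v g + around v h
  around-+ v g h = trans (cong₂ _+_ (interchange (g (upV v)) _ _ _) (interchange (g (lfV v)) _ _ _))
                         (interchange (g (upV v) + g (dnV v)) _ _ _)

  around-cong : ∀ v {g h : V p q → ℕ} → (∀ u → g u ≡ h u) → around v g ≡ around v h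
  around-cong v eq = cong₂ _+_ (cong₂ _+_ (eq (upV v)) (eq (dnV v))) (cong₂ _+_ (eq (lfV v)) (eq (rtV v)))

  laterDegree : V p q → ℕ
  laterDegree v = around v (λ u → ind (v ≺ u))

  NoEarlierNeighbour : V p q → Set
  NoEarlierNeighbour v =
    (upV v ≺ v) ≡ false × (dnV v ≺ v) ≡ false × (lfV v ≺ v) ≡ false × (rtV v ≺ v) ≡ false

  Peelable : V p q → Set
  Peelable v = parity (laterDegree v) ≡ true ⊎ (NoEarlierNeighbour v × T v ≡ false)

  rank : V p q → ℕ
  rank v = sumV (λ w → ind (w ≺ v))

  rank-mono : ∀ {u v} → (u ≺ v) ≡ true → rank u < rank v
  rank-mono {u} {v} u≺v = sumV-strict u (λ w → ind-mono (λ w≺u → ≺-trans w≺u u≺v))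
    (subst₂ (λ a b → ind a < ind b) (sym (≺-irrefl u)) (sym u≺v) ≤-refl)

  rank<numV : ∀ v → rank v < numV p q
  rank<numV v = sumV-strict v (λ w → ind≤1 (w ≺ v)) (subst (λ b → ind b < 1) (sym (≺-irrefl v)) ≤-refl)

  earlierOutward : (V p q → Bool) → V p q → ℕ
  earlierOutward out v = around v (λ u → ind (u ≺ v ∧ out u))

  -- outward v: all edges from v to later neighbours leave v.  It is decided in rank order, each
  -- vertex choosing according to the parity of the edges it already receives from earlier ones;
  -- outwardBelowRank n holds the decisions for ranks below n.
  outwardBelowRank : ℕ → V p q → Bool
  outwardBelowRank zero    v = true
  outwardBelowRank (suc n) v =
    if rank v ≡ᵇ n then not (parity (earlierOutward (outwardBelowRank n) v) xor T v) else outwardBelowRank n v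

  outward : V p q → Bool
  outward v = outwardBelowRank (suc (rank v)) v

  outwardBelowRank-stable : ∀ n v → rank v < n → outwardBelowRank n v ≡ outward v
  outwardBelowRank-stable (suc n) v r<1+n with rank v ≟ n
  ... | yes refl = refl
  ... | no  r≢n  rewrite ≡ᵇ-false r≢n = outwardBelowRank-stable n v (≤∧≢⇒< (s≤s⁻¹ r<1+n) r≢n)

  outward-spec : ∀ v → outward v ≡ not (parity (earlierOutward outward v) xor T v)
  outward-spec v rewrite ≡ᵇ-refl (rank v) =
    cong (λ c → not (parity c xor T v)) (around-cong v stable-before-v)
    where
    stable-before-v : ∀ u → ind (u ≺ v ∧ outwardBelowRank (rank v) u) ≡ ind (u ≺ v ∧ outward u)
    stable-before-v u with u ≺ v in u≺v
    ... | false = refl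
    ... | true  = cong ind (outwardBelowRank-stable (rank v) u (rank-mono u≺v))

  -- Outward vertices in increasing rank, then inward ones in decreasing rank: every edge then
  -- points towards the larger position.
  position : V p q → ℕ
  position v = if outward v then rank v else (numV p q + numV p q) ∸ rank v

  numV<2numV∸rank : ∀ w → numV p q < (numV p q + numV p q) ∸ rank w
  numV<2numV∸rank w = subst (numV p q <_) (sym (+-∸-assoc (numV p q) (<⇒≤ (rank<numV w))))
                             (m<m+n (numV p q) (m<n⇒0<n∸m (rank<numV w)))

  position-order : ∀ {u v} → (u ≺ v) ≡ true →
    (outward u ≡ true → position u < position v) × (outward u ≡ false → position v < position u)
  position-order {u} {v} u≺v with outward u | outward v
  ... | true  | true  = (λ _ → rank-mono u≺v) , λ ()
  ... | true  | false = (λ _ → <-trans (rank<numV u) (numV<2numV∸rank v)) , λ ()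
  ... | false | true  = (λ ()) , (λ _ → <-trans (rank<numV v) (numV<2numV∸rank u))
  ... | false | false = (λ ()) , (λ _ → ∸-monoʳ-< (rank-mono u≺v) (≤-trans (<⇒≤ (rank<numV v)) (m≤m+n (numV p q) (numV p q))))

  position-≢ : ∀ {u v} → (u ≺ v) ≡ true → position u ≢ position v
  position-≢ {u} {v} u≺v eq = by-cases (outward u) refl
    where
    by-cases : ∀ b → outward u ≡ b → ⊥
    by-cases true  out = <-irrefl eq (proj₁ (position-order u≺v) out)
    by-cases false out = <-irrefl (sym eq) (proj₂ (position-order u≺v) out)

  position-injective : ∀ {u v} → Comparable u v → position u ≢ position v
  position-injective (inj₁ u≺v) = position-≢ u≺v
  position-injective (inj₂ v≺u) = λ eq → position-≢ v≺u (sym eq)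

  position-<ᵇ : ∀ {u v} → (u ≺ v) ≡ true → (position u <ᵇ position v) ≡ outward u
  position-<ᵇ {u} {v} u≺v = by-cases (outward u) refl
    where
    by-cases : ∀ b → outward u ≡ b → (position u <ᵇ position v) ≡ outward u
    by-cases true  out = trans (<ᵇ-true (proj₁ (position-order u≺v) out)) (sym out)
    by-cases false out = trans (<ᵇ-false (λ lt → <-asym lt (proj₂ (position-order u≺v) out))) (sym out)

  orientation : Orientation p q
  orientation e = position (end₁ e) <ᵇ position (end₂ e)

  edge-in : ∀ {u v} → Comparable u v →
    ind (position u <ᵇ position v) ≡ ind (u ≺ v ∧ outward u) + ind (v ≺ u ∧ not (outward v))
  edge-in {u} {v} (inj₁ u≺v) rewrite position-<ᵇ u≺v | u≺v | ≺-asym u≺v = sym (+-identityʳ _)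
  edge-in {u} {v} (inj₂ v≺u)
    rewrite sym (not-<ᵇ (position-injective (inj₁ v≺u))) | position-<ᵇ v≺u | v≺u | ≺-asym v≺u = refl

  module _ (cmp-dn : ∀ v → Comparable v (dnV v)) (cmp-rt : ∀ v → Comparable v (rtV v)) where

    comparable-sym : ∀ {u v} → Comparable u v → Comparable v u
    comparable-sym (inj₁ u≺v) = inj₂ u≺v
    comparable-sym (inj₂ v≺u) = inj₁ v≺u

    indeg-orientation : ∀ v → indeg orientation v ≡ earlierOutward outward v + (if outward v then 0 else laterDegree v)
    indeg-orientation v = begin
      indeg orientation v
        ≡⟨ indeg-formula orientation v ⟩
      (ind (orientation (upV v , false)) + ind (not (orientation (v , false))))
        + (ind (orientation (lfV v , true)) + ind (not (orientation (v , true))))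
        ≡⟨ cong₂ _+_ (cong₂ _+_ from-up from-dn) (cong₂ _+_ from-lf from-rt) ⟩
      around v (λ u → ind (u ≺ v ∧ outward u) + ind (v ≺ u ∧ not (outward v)))
        ≡⟨ around-+ v (λ u → ind (u ≺ v ∧ outward u)) (λ u → ind (v ≺ u ∧ not (outward v))) ⟩
      earlierOutward outward v + around v (λ u → ind (v ≺ u ∧ not (outward v)))
        ≡⟨ cong (earlierOutward outward v +_) later-in ⟩
      earlierOutward outward v + (if outward v then 0 else laterDegree v) ∎
      where
      open ≡-Reasoning
      from-up : ind (orientation (upV v , false)) ≡ ind (upV v ≺ v ∧ outward (upV v)) + ind (v ≺ upV v ∧ not (outward v))
      from-up = trans (cong (λ w → ind (position (upV v) <ᵇ position w)) (dnV-upV v))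
                      (edge-in (subst (Comparable (upV v)) (dnV-upV v) (cmp-dn (upV v))))
      from-lf : ind (orientation (lfV v , true)) ≡ ind (lfV v ≺ v ∧ outward (lfV v)) + ind (v ≺ lfV v ∧ not (outward v))
      from-lf = trans (cong (λ w → ind (position (lfV v) <ᵇ position w)) (rtV-lfV v))
                      (edge-in (subst (Comparable (lfV v)) (rtV-lfV v) (cmp-rt (lfV v))))
      from-dn : ind (not (orientation (v , false))) ≡ ind (dnV v ≺ v ∧ outward (dnV v)) + ind (v ≺ dnV v ∧ not (outward v))
      from-dn = trans (cong ind (not-<ᵇ (position-injective (cmp-dn v)))) (edge-in (comparable-sym (cmp-dn v)))
      from-rt : ind (not (orientation (v , true))) ≡ ind (rtV v ≺ v ∧ outward (rtV v)) + ind (v ≺ rtV v ∧ not (outward v))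
      from-rt = trans (cong ind (not-<ᵇ (position-injective (cmp-rt v)))) (edge-in (comparable-sym (cmp-rt v)))
      later-in : around v (λ u → ind (v ≺ u ∧ not (outward v))) ≡ (if outward v then 0 else laterDegree v)
      later-in with outward v
      ... | true  = around-cong v (λ u → cong ind (∧-zeroʳ (v ≺ u)))
      ... | false = around-cong v (λ u → cong ind (∧-identityʳ (v ≺ u)))

    parity-indeg : ∀ v → Peelable v → parity (indeg orientation v) ≡ T v
    parity-indeg v (inj₁ odd-later) = begin
      parity (indeg orientation v)                    ≡⟨ cong parity (indeg-orientation v) ⟩
      parity (earlierOutward outward v + later)       ≡⟨ parity-+ (earlierOutward outward v) later ⟩
      parity (earlierOutward outward v) xor parity later
        ≡⟨ cong (parity (earlierOutward outward v) xor_) parity-later ⟩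
      parity (earlierOutward outward v) xor not (outward v)
        ≡⟨ cong (λ b → parity (earlierOutward outward v) xor not b) (outward-spec v) ⟩
      parity (earlierOutward outward v) xor not (not (parity (earlierOutward outward v) xor T v))
        ≡⟨ cong (parity (earlierOutward outward v) xor_) (not-involutive _) ⟩
      parity (earlierOutward outward v) xor (parity (earlierOutward outward v) xor T v)
        ≡⟨ sym (xor-assoc (parity (earlierOutward outward v)) _ (T v)) ⟩
      (parity (earlierOutward outward v) xor parity (earlierOutward outward v)) xor T v
        ≡⟨ cong (_xor T v) (xor-same (parity (earlierOutward outward v))) ⟩
      T v                                             ∎
      where
      open ≡-Reasoning
      later : ℕ
      later = if outward v then 0 else laterDegree v
      parity-later : parity later ≡ not (outward v)
      parity-later with outward v
      ... | true  = refl
      ... | false = odd-later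
    parity-indeg v (inj₂ ((up , dn , lf , rt) , v∉T)) = begin
      parity (indeg orientation v)                                          ≡⟨ cong parity (indeg-orientation v) ⟩
      parity (earlierOutward outward v + (if outward v then 0 else laterDegree v))
        ≡⟨ cong (λ n → parity (n + (if outward v then 0 else laterDegree v))) none-outward ⟩
      parity (if outward v then 0 else laterDegree v)                      ≡⟨ cong (λ b → parity (if b then 0 else laterDegree v)) v-outward ⟩
      false                                                                 ≡⟨ sym v∉T ⟩
      T v                                                                   ∎
      where
      open ≡-Reasoning
      none-outward : earlierOutward outward v ≡ 0
      none-outward rewrite up | dn | lf | rt = refl
      v-outward : outward v ≡ true
      v-outward = trans (outward-spec v) (cong₂ (λ n t → not (parity n xor t)) none-outward v∉T)

    edge-comparable : ∀ e → Comparable (end₁ e) (end₂ e)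
    edge-comparable (v , false) = cmp-dn v
    edge-comparable (v , true)  = cmp-rt v

    arc-position : ∀ e → position (tail orientation e) < position (head orientation e)
    arc-position e with orientation e in forward
    ... | true  = <ᵇ-sound forward
    ... | false = ≤∧≢⇒< (≮⇒≥ (λ lt → true≢false (trans (sym (<ᵇ-true lt)) forward)))
                        (λ eq → position-injective (edge-comparable e) (sym eq))
      where
      true≢false : true ≢ false
      true≢false ()

    path-position : ∀ {u w} → TransClosure (Arc orientation) u w → position u < position w
    path-position [ e , refl , refl ]          = arc-position e
    path-position ((e , refl , refl) ∷⁺ path) = <-trans (arc-position e) (path-position path)

    acyclic : Acyclic orientation
    acyclic v cycle = <-irrefl refl (path-position cycle)

    greedy-orientation : (z : V p q) → CondP p q T → (∀ v → v ≢ z → Peelable v) →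
      ∃ λ (o : Orientation p q) → TOdd o T × Acyclic o
    greedy-orientation z even-ET peel = orientation , t-odd , acyclic
      where
      parity-ok : ∀ v → parity (indeg orientation v) ≡ T v
      parity-ok v with v ≟V z
      ... | yes refl = handshake-parity orientation T z even-ET (λ w w≢z → parity-indeg w (peel w w≢z))
      ... | no  v≢z  = parity-indeg v (peel v v≢z)
      t-odd : TOdd orientation T
      t-odd v = (λ odd → trans (sym (parity-ok v)) (Odd⇒parity {indeg orientation v} odd))
              , (λ v∈T → parity⇒Odd {indeg orientation v} (trans (parity-ok v) v∈T))

∧-left : ∀ {a b} → (a ∧ b) ≡ true → a ≡ true
∧-left {true} _ = refl

∧-right : ∀ {a b} → (a ∧ b) ≡ true → b ≡ true
∧-right {true} eq = eq

-- Lexicographic keys on a grid, transferred to the torus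

lex< : List ℕ → List ℕ → Bool
lex< []       []       = false
lex< []       (_ ∷ _)  = true
lex< (_ ∷ _)  []       = false
lex< (a ∷ as) (b ∷ bs) = (a <ᵇ b) ∨ ((a ≡ᵇ b) ∧ lex< as bs)

lex<-cons : ∀ a as bs → lex< (a ∷ as) (a ∷ bs) ≡ lex< as bs
lex<-cons a as bs rewrite <ᵇ-false (<-irrefl (refl {x = a})) | ≡ᵇ-refl a = refl

lex<-irrefl : ∀ k → lex< k k ≡ false
lex<-irrefl []       = refl
lex<-irrefl (a ∷ as) = trans (lex<-cons a as as) (lex<-irrefl as)

lex<-head : ∀ {a b} as bs → a < b → lex< (a ∷ as) (b ∷ bs) ≡ true
lex<-head as bs a<b rewrite <ᵇ-true a<b = refl

lex<-trans : ∀ k l m → lex< k l ≡ true → lex< l m ≡ true → lex< k m ≡ true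
lex<-trans []       []       _        ()  _
lex<-trans []       (_ ∷ _)  []       _   ()
lex<-trans []       (_ ∷ _)  (_ ∷ _)  _   _   = refl
lex<-trans (_ ∷ _)  []       _        ()  _
lex<-trans (_ ∷ _)  (_ ∷ _)  []       _   ()
lex<-trans (a ∷ as) (b ∷ bs) (c ∷ cs) k<l l<m with a <ᵇ b in a<b | b <ᵇ c in b<c
... | true  | true  = lex<-head as cs (<-trans (<ᵇ-sound {a} {b} a<b) (<ᵇ-sound b<c))
... | true  | false = lex<-head as cs (subst (a <_) (≡ᵇ-sound {b} {c} (∧-left l<m)) (<ᵇ-sound {a} {b} a<b))
... | false | true  = lex<-head as cs (subst (_< c) (sym (≡ᵇ-sound {a} {b} (∧-left k<l))) (<ᵇ-sound {b} {c} b<c))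
... | false | false with ≡ᵇ-sound {a} {b} (∧-left k<l) | ≡ᵇ-sound {b} {c} (∧-left l<m)
...   | refl | refl = trans (lex<-cons a as cs) (lex<-trans as bs cs (∧-right k<l) (∧-right l<m))

lex<-++ : ∀ ks {as bs} → lex< as bs ≡ true → lex< (ks ++ as) (ks ++ bs) ≡ true
lex<-++ []       as<bs = as<bs
lex<-++ (k ∷ ks) {as} {bs} as<bs = trans (lex<-cons k (ks ++ as) (ks ++ bs)) (lex<-++ ks as<bs)

lex<-last : ∀ ks {m n} → m < n → lex< (ks ++ m ∷ []) (ks ++ n ∷ []) ≡ true
lex<-last ks m<n = lex<-++ ks (lex<-head [] [] m<n)

prev : ℕ → ℕ → ℕ
prev P zero    = P ∸ 1
prev P (suc x) = x

next : ℕ → ℕ → ℕ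
next P x = if suc x ≡ᵇ P then 0 else suc x

next-< : ∀ {P x} → suc x < P → next P x ≡ suc x
next-< suc-x<P rewrite ≡ᵇ-false (<⇒≢ suc-x<P) = refl

next-last : ∀ {P x} → suc x ≡ P → next P x ≡ 0
next-last suc-x≡P rewrite ≡ᵇ-true suc-x≡P = refl

next≡suc% : ∀ {N x} .{{_ : NonZero N}} → x < N → next N x ≡ suc x % N
next≡suc% {N} x<N with m≤n⇒m<n∨m≡n x<N
... | inj₁ suc-x<N = trans (next-< suc-x<N) (sym (m<n⇒m%n≡m suc-x<N))
... | inj₂ suc-x≡N = trans (next-last suc-x≡N) (sym (trans (cong (_% N) suc-x≡N) (n%n≡0 N)))

prev-next : ∀ {N x} → x < N → prev N (next N x) ≡ x
prev-next {N} x<N with m≤n⇒m<n∨m≡n x<N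
... | inj₁ suc-x<N = cong (prev N) (next-< suc-x<N)
... | inj₂ suc-x≡N = trans (cong (prev N) (next-last suc-x≡N)) (cong (_∸ 1) (sym suc-x≡N))

[m%n+k]%n≡[m+k]%n : ∀ m k n .{{_ : NonZero n}} → ((m % n) + k) % n ≡ (m + k) % n
[m%n+k]%n≡[m+k]%n m k n = begin
  ((m % n) + k) % n          ≡⟨ %-distribˡ-+ (m % n) k n ⟩
  ((m % n % n) + k % n) % n  ≡⟨ cong (λ t → (t + k % n) % n) (m%n%n≡m%n m n) ⟩
  ((m % n) + k % n) % n      ≡⟨ sym (%-distribˡ-+ m k n) ⟩
  (m + k) % n                ∎
  where open ≡-Reasoning

offset : ∀ {n} → Fin (suc n) → Fin (suc n) → ℕ
offset {n} a i = (toℕ i + (suc n ∸ toℕ a)) % suc n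

offset< : ∀ {n} (a i : Fin (suc n)) → offset a i < suc n
offset< {n} a i = m%n<n (toℕ i + (suc n ∸ toℕ a)) (suc n)

toℕ≤n : ∀ {n} (a : Fin (suc n)) → toℕ a ≤ suc n
toℕ≤n a = <⇒≤ (toℕ<n a)

offset+origin : ∀ {n} (a i : Fin (suc n)) → (offset a i + toℕ a) % suc n ≡ toℕ i
offset+origin {n} a i = begin
  (offset a i + toℕ a) % suc n                  ≡⟨ [m%n+k]%n≡[m+k]%n (toℕ i + (suc n ∸ toℕ a)) (toℕ a) (suc n) ⟩
  (toℕ i + (suc n ∸ toℕ a) + toℕ a) % suc n     ≡⟨ cong (_% suc n) (+-assoc (toℕ i) _ (toℕ a)) ⟩
  (toℕ i + ((suc n ∸ toℕ a) + toℕ a)) % suc n   ≡⟨ cong (λ t → (toℕ i + t) % suc n) (m∸n+n≡m (toℕ≤n a)) ⟩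
  (toℕ i + suc n) % suc n                       ≡⟨ [m+n]%n≡m%n (toℕ i) (suc n) ⟩
  toℕ i % suc n                                 ≡⟨ m<n⇒m%n≡m (toℕ<n i) ⟩
  toℕ i                                         ∎
  where open ≡-Reasoning

offset-injective : ∀ {n} (a : Fin (suc n)) {i j : Fin (suc n)} → offset a i ≡ offset a j → i ≡ j
offset-injective {n} a {i} {j} eq = toℕ-injective (begin
  toℕ i                         ≡⟨ sym (offset+origin a i) ⟩
  (offset a i + toℕ a) % suc n  ≡⟨ cong (λ t → (t + toℕ a) % suc n) eq ⟩
  (offset a j + toℕ a) % suc n  ≡⟨ offset+origin a j ⟩
  toℕ j                         ∎)
  where open ≡-Reasoning

offset-self : ∀ {n} (a : Fin (suc n)) → offset a a ≡ 0
offset-self {n} a = trans (cong (_% suc n) (m+[n∸m]≡n (toℕ≤n a))) (n%n≡0 (suc n))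

offset-cyc : ∀ {n} (a i : Fin (suc n)) → offset a (cyc i) ≡ next (suc n) (offset a i)
offset-cyc {n} a i = begin
  offset a (cyc i)                              ≡⟨ cong (λ t → (t + (suc n ∸ toℕ a)) % suc n) (toℕ-cyc i) ⟩
  (suc (toℕ i) % suc n + (suc n ∸ toℕ a)) % suc n ≡⟨ [m%n+k]%n≡[m+k]%n (suc (toℕ i)) (suc n ∸ toℕ a) (suc n) ⟩
  suc (toℕ i + (suc n ∸ toℕ a)) % suc n          ≡⟨ cong (_% suc n) (+-comm 1 (toℕ i + (suc n ∸ toℕ a))) ⟩
  (toℕ i + (suc n ∸ toℕ a) + 1) % suc n          ≡⟨ sym ([m%n+k]%n≡[m+k]%n (toℕ i + (suc n ∸ toℕ a)) 1 (suc n)) ⟩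
  (offset a i + 1) % suc n                       ≡⟨ cong (_% suc n) (+-comm (offset a i) 1) ⟩
  suc (offset a i) % suc n                       ≡⟨ sym (next≡suc% (offset< a i)) ⟩
  next (suc n) (offset a i)                      ∎
  where open ≡-Reasoning

offset-cyc⁻¹ : ∀ {n} (a i : Fin (suc n)) → offset a (cyc⁻¹ i) ≡ prev (suc n) (offset a i)
offset-cyc⁻¹ {n} a i = sym (begin
  prev (suc n) (offset a i)                     ≡⟨ cong (λ j → prev (suc n) (offset a j)) (sym (cyc-cyc⁻¹ i)) ⟩
  prev (suc n) (offset a (cyc (cyc⁻¹ i)))       ≡⟨ cong (prev (suc n)) (offset-cyc a (cyc⁻¹ i)) ⟩
  prev (suc n) (next (suc n) (offset a (cyc⁻¹ i))) ≡⟨ prev-next (offset< a (cyc⁻¹ i)) ⟩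
  offset a (cyc⁻¹ i)                            ∎)
  where open ≡-Reasoning

fromOffset : ∀ {n} → Fin (suc n) → ℕ → Fin (suc n)
fromOffset {n} a x = fromℕ< (m%n<n (x + toℕ a) (suc n))

offset-fromOffset : ∀ {n} (a : Fin (suc n)) {x} → x < suc n → offset a (fromOffset a x) ≡ x
offset-fromOffset {n} a {x} x<n = begin
  offset a (fromOffset a x)                          ≡⟨ cong (λ t → (t + (suc n ∸ toℕ a)) % suc n) (toℕ-fromℕ< (m%n<n (x + toℕ a) (suc n))) ⟩
  ((x + toℕ a) % suc n + (suc n ∸ toℕ a)) % suc n    ≡⟨ [m%n+k]%n≡[m+k]%n (x + toℕ a) (suc n ∸ toℕ a) (suc n) ⟩
  (x + toℕ a + (suc n ∸ toℕ a)) % suc n              ≡⟨ cong (_% suc n) (+-assoc x (toℕ a) _) ⟩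
  (x + (toℕ a + (suc n ∸ toℕ a))) % suc n            ≡⟨ cong (λ t → (x + t) % suc n) (m+[n∸m]≡n (toℕ≤n a)) ⟩
  (x + suc n) % suc n                                ≡⟨ [m+n]%n≡m%n x (suc n) ⟩
  x % suc n                                          ≡⟨ m<n⇒m%n≡m x<n ⟩
  x                                                  ∎
  where open ≡-Reasoning

offset-zero : ∀ {n} (a i : Fin (suc n)) → offset a i ≡ 0 → i ≡ a
offset-zero a i i↦0 = offset-injective a (trans i↦0 (sym (offset-self a)))

offsets-injective : ∀ {p q} (a : V (suc p) (suc q)) {v w : V (suc p) (suc q)} →
  offset (proj₁ a) (proj₁ v) ≡ offset (proj₁ a) (proj₁ w) → offset (proj₂ a) (proj₂ v) ≡ offset (proj₂ a) (proj₂ w) → v ≡ w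
offsets-injective a eq₁ eq₂ = cong₂ _,_ (offset-injective (proj₁ a) eq₁) (offset-injective (proj₂ a) eq₂)

laterIndicator : ∀ {A B : Set} → A ⊎ B → ℕ
laterIndicator (inj₁ _) = 1
laterIndicator (inj₂ _) = 0

IsLater : ∀ {A B : Set} → A ⊎ B → Set
IsLater (inj₁ _) = ⊤
IsLater (inj₂ _) = ⊥

module Grid (P Q : ℕ) (K : ℕ → ℕ → List ℕ) where

  Later : ℕ → ℕ → ℕ → ℕ → Set
  Later x y x′ y′ = lex< (K x y) (K x′ y′) ≡ true

  Comparable : ℕ → ℕ → ℕ → ℕ → Set
  Comparable x y x′ y′ = Later x y x′ y′ ⊎ Later x′ y′ x y

  later-via : ∀ {x y x₁ y₁ x₂ y₂ k k′} → x₁ ≡ x₂ → y₁ ≡ y₂ → K x y ≡ k → K x₂ y₂ ≡ k′ →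
    lex< k k′ ≡ true → Later x y x₁ y₁
  later-via refl refl key key′ k<k′ = trans (cong₂ lex< key key′) k<k′

  earlier-via : ∀ {x y x₁ y₁ x₂ y₂ k k′} → x₁ ≡ x₂ → y₁ ≡ y₂ → K x y ≡ k → K x₂ y₂ ≡ k′ →
    lex< k′ k ≡ true → Later x₁ y₁ x y
  earlier-via refl refl key key′ k′<k = trans (cong₂ lex< key′ key) k′<k

  -- The comparisons of a cell with its four neighbours are given as proofs, so that the number of
  -- later neighbours, and its parity, can be computed from them without evaluating any key.
  record Star (x y : ℕ) : Set where
    constructor star
    field
      up    : Comparable x y (prev P x) y
      down  : Comparable x y (next P x) y
      left  : Comparable x y x (prev Q y)
      right : Comparable x y x (next Q y)

  laterCount : ∀ {x y} → Star x y → ℕ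
  laterCount (star u d l r) = (laterIndicator u + laterIndicator d) + (laterIndicator l + laterIndicator r)

  AllLater : ∀ {x y} → Star x y → Set
  AllLater (star u d l r) = IsLater u × IsLater d × IsLater l × IsLater r

  PeelableAt : ℕ → ℕ → (ℕ → ℕ → Set) → ℕ → ℕ → Set
  PeelableAt zx zy Minimal x y =
    Σ (Star x y) λ s → ¬ (x ≡ zx × y ≡ zy) → parity (laterCount s) ≡ true ⊎ (AllLater s × Minimal x y)

  PeelingOrder : ℕ → ℕ → (ℕ → ℕ → Set) → Set
  PeelingOrder zx zy Minimal = ∀ x y → x < P → y < Q → PeelableAt zx zy Minimal x y

transpose : ∀ {P Q K zx zy Minimal} → Grid.PeelingOrder P Q K zx zy Minimal →
  Grid.PeelingOrder Q P (flip K) zy zx (flip Minimal)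
transpose {P} {Q} {K} order y x y<Q x<P with order x y x<P y<Q
... | Grid.star u d l r , peel = Grid.star l r u d , λ not-z →
  Sum.map (trans (cong parity (+-comm (laterIndicator l + laterIndicator r) (laterIndicator u + laterIndicator d))))
          (λ { ((lu , ld , ll , lr) , minimal) → (ll , lr , lu , ld) , minimal })
          (peel (λ { (x≡zx , y≡zy) → not-z (y≡zy , x≡zx) }))

Result : (p q : ℕ) → Subset p q → Set
Result p q T = ∃ λ (o : Orientation p q) → TOdd o T × Acyclic o

module Chart {p′ q′ : ℕ} (T : Subset (suc p′) (suc q′)) (K : ℕ → ℕ → List ℕ) (a : V (suc p′) (suc q′)) where

  private
    p q : ℕ
    p = suc p′
    q = suc q′

  open Grid p q K

  X Y : V p q → ℕ
  X v = offset (proj₁ a) (proj₁ v)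
  Y v = offset (proj₂ a) (proj₂ v)

  key : V p q → List ℕ
  key v = K (X v) (Y v)

  _≺_ : V p q → V p q → Bool
  u ≺ v = lex< (key u) (key v)

  module Torus = GreedyOrientation T _≺_ (λ v → lex<-irrefl (key v)) (λ {u} {v} {w} → lex<-trans (key u) (key v) (key w))
  open Torus hiding (Comparable)

  key-upV : ∀ v → key (upV v) ≡ K (prev p (X v)) (Y v)
  key-upV (i , j) = cong (λ x → K x (Y (i , j))) (offset-cyc⁻¹ (proj₁ a) i)

  key-dnV : ∀ v → key (dnV v) ≡ K (next p (X v)) (Y v)
  key-dnV (i , j) = cong (λ x → K x (Y (i , j))) (offset-cyc (proj₁ a) i)

  key-lfV : ∀ v → key (lfV v) ≡ K (X v) (prev q (Y v))
  key-lfV (i , j) = cong (K (X (i , j))) (offset-cyc⁻¹ (proj₂ a) j)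

  key-rtV : ∀ v → key (rtV v) ≡ K (X v) (next q (Y v))
  key-rtV (i , j) = cong (K (X (i , j))) (offset-cyc (proj₂ a) j)

  comparable : ∀ v u {x′ y′} → key u ≡ K x′ y′ → Comparable (X v) (Y v) x′ y′ → Torus.Comparable v u
  comparable v u key-u (inj₁ later)   = inj₁ (trans (cong (lex< (key v)) key-u) later)
  comparable v u key-u (inj₂ earlier) = inj₂ (trans (cong (λ k → lex< k (key v)) key-u) earlier)

  indicator : ∀ v u {x′ y′} → key u ≡ K x′ y′ → (c : Comparable (X v) (Y v) x′ y′) → ind (v ≺ u) ≡ laterIndicator c
  indicator v u key-u (inj₁ later)   = cong ind (trans (cong (lex< (key v)) key-u) later)
  indicator v u key-u (inj₂ earlier) = cong ind (≺-asym {u} {v} (trans (cong (λ k → lex< k (key v)) key-u) earlier))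

  not-earlier : ∀ v u {x′ y′} → key u ≡ K x′ y′ → (c : Comparable (X v) (Y v) x′ y′) → IsLater c → (u ≺ v) ≡ false
  not-earlier v u key-u (inj₁ later) _ = ≺-asym {v} {u} (trans (cong (lex< (key v)) key-u) later)

  laterDegree≡laterCount : ∀ v (s : Star (X v) (Y v)) → laterDegree v ≡ laterCount s
  laterDegree≡laterCount v (star u d l r) =
    cong₂ _+_ (cong₂ _+_ (indicator v (upV v) (key-upV v) u) (indicator v (dnV v) (key-dnV v) d))
              (cong₂ _+_ (indicator v (lfV v) (key-lfV v) l) (indicator v (rtV v) (key-rtV v) r))

  all-later : ∀ v (s : Star (X v) (Y v)) → AllLater s → NoEarlierNeighbour v
  all-later v (star u d l r) (lu , ld , ll , lr) =
    not-earlier v (upV v) (key-upV v) u lu , not-earlier v (dnV v) (key-dnV v) d ld ,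
    not-earlier v (lfV v) (key-lfV v) l ll , not-earlier v (rtV v) (key-rtV v) r lr

  module _ {zx zy : ℕ} {Minimal : ℕ → ℕ → Set} (order : PeelingOrder zx zy Minimal)
           (zx<p : zx < p) (zy<q : zy < q) (minimal∉T : ∀ v → Minimal (X v) (Y v) → T v ≡ false) where

    peelable-at : ∀ v → PeelableAt zx zy Minimal (X v) (Y v)
    peelable-at v = order (X v) (Y v) (offset< (proj₁ a) (proj₁ v)) (offset< (proj₂ a) (proj₂ v))

    cmp-dn : ∀ v → Torus.Comparable v (dnV v)
    cmp-dn v = comparable v (dnV v) (key-dnV v) (Star.down (proj₁ (peelable-at v)))

    cmp-rt : ∀ v → Torus.Comparable v (rtV v)
    cmp-rt v = comparable v (rtV v) (key-rtV v) (Star.right (proj₁ (peelable-at v)))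

    z : V p q
    z = (fromOffset (proj₁ a) zx , fromOffset (proj₂ a) zy)

    peelable : ∀ v → v ≢ z → Peelable v
    peelable v v≢z with peelable-at v
    ... | s , peel with peel away-from-z
      where
      away-from-z : ¬ (X v ≡ zx × Y v ≡ zy)
      away-from-z (X≡zx , Y≡zy) = v≢z (cong₂ _,_
        (offset-injective (proj₁ a) (trans X≡zx (sym (offset-fromOffset (proj₁ a) zx<p))))
        (offset-injective (proj₂ a) (trans Y≡zy (sym (offset-fromOffset (proj₂ a) zy<q)))))
    ... | inj₁ odd                   = inj₁ (trans (cong parity (laterDegree≡laterCount v s)) odd)
    ... | inj₂ (later , minimal)     = inj₂ (all-later v s later , minimal∉T v minimal)

    orientation-from-grid : CondP p q T → Result p q T
    orientation-from-grid even-ET = greedy-orientation cmp-dn cmp-rt z even-ET peelable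

-- Explicit peeling orders on grids

double : ℕ → ℕ
double zero = 0
double (suc k) = suc (suc (double k))

data Bit : Set where
  b0 b1 : Bit

bitValue : Bit → ℕ
bitValue b0 = 0
bitValue b1 = 1

half : ℕ → ℕ
half zero = 0
half (suc zero) = 0
half (suc (suc n)) = suc (half n)

lowBit : ℕ → ℕ
lowBit zero = 0
lowBit (suc zero) = 1
lowBit (suc (suc n)) = lowBit n

half-bit+double : ∀ b k → half (bitValue b + double k) ≡ k
half-bit+double b0 zero = refl
half-bit+double b1 zero = refl
half-bit+double b0 (suc k) = cong suc (half-bit+double b0 k)
half-bit+double b1 (suc k) = cong suc (half-bit+double b1 k)

lowBit-bit+double : ∀ b k → lowBit (bitValue b + double k) ≡ bitValue b
lowBit-bit+double b0 zero = refl
lowBit-bit+double b1 zero = refl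
lowBit-bit+double b0 (suc k) = lowBit-bit+double b0 k
lowBit-bit+double b1 (suc k) = lowBit-bit+double b1 k

double-mono-≤ : ∀ {j k} → j ≤ k → double j ≤ double k
double-mono-≤ {zero} _ = z≤n
double-mono-≤ {suc j} {suc k} (s≤s l) = s≤s (s≤s (double-mono-≤ l))

bitValue≤1 : ∀ b → bitValue b ≤ 1
bitValue≤1 b0 = z≤n
bitValue≤1 b1 = s≤s z≤n

bit+double<double : ∀ b {t k} → t < k → bitValue b + double t < double k
bit+double<double b {t} {suc k} (s≤s t≤k) = ≤-trans (s≤s (+-monoˡ-≤ (double t) (bitValue≤1 b))) (s≤s (s≤s (double-mono-≤ t≤k)))

halve : ∀ y → Σ Bit (λ b → Σ ℕ (λ w → y ≡ bitValue b + double w))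
halve zero = b0 , 0 , refl
halve (suc zero) = b1 , 0 , refl
halve (suc (suc y)) with halve y
... | b0 , w , e = b0 , suc w , cong (λ t → suc (suc t)) e
... | b1 , w , e = b1 , suc w , cong (λ t → suc (suc t)) e

bit+double<double⇒< : ∀ b w k → bitValue b + double w < double k → w < k
bit+double<double⇒< b zero (suc k) _ = s≤s z≤n
bit+double<double⇒< b0 (suc w) (suc k) (s≤s (s≤s l)) = s≤s (bit+double<double⇒< b0 w k l)
bit+double<double⇒< b1 (suc w) (suc k) (s≤s (s≤s l)) = s≤s (bit+double<double⇒< b1 w k l)

if-true : ∀ {A : Set} {c : Bool} {a b : A} → c ≡ true → (if c then a else b) ≡ a
if-true refl = refl

if-false : ∀ {A : Set} {c : Bool} {a b : A} → c ≡ false → (if c then a else b) ≡ b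
if-false refl = refl

if-∷ : ∀ {A : Set} (b : Bool) (x : A) (xs ys : List A) → (if b then x ∷ xs else x ∷ ys) ≡ x ∷ (if b then xs else ys)
if-∷ true x xs ys = refl
if-∷ false x xs ys = refl

module EvenWidthOrder (p0 h0 : ℕ) where
  P Q pm q1 q2 q3 : ℕ
  P = suc (suc (suc (suc p0)))
  pm = suc (suc (suc p0))
  Q = double (suc (suc h0))
  q1 = suc (suc (suc (double h0)))
  q2 = suc (suc (double h0))
  q3 = suc (double h0)

  -- The order: (0,0); row 0 up to column Q-3; row 1 (even columns below Q-2, then columns Q-1
  -- and Q-2, then the other odd columns); each row 2, …, P-2 with its even columns first; finally
  -- (P-1,Q-2), (0,Q-2), (0,Q-1), (P-1,Q-1) and row P-1 from left to right, ending at (P-1,Q-3).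
  r0 r1 rl : ℕ → List ℕ
  r0 y = if y ≡ᵇ 0 then 0 ∷ [] else if y ≡ᵇ q2 then 4 ∷ 1 ∷ [] else if y ≡ᵇ q1 then 4 ∷ 2 ∷ [] else 1 ∷ y ∷ []
  r1 y = if y ≡ᵇ q1 then 2 ∷ 1 ∷ [] else if y ≡ᵇ q2 then 2 ∷ 2 ∷ [] else (if lowBit y ≡ᵇ 0 then 2 ∷ 0 ∷ half y ∷ [] else 2 ∷ 3 ∷ half y ∷ [])
  rl y = if y ≡ᵇ q2 then 4 ∷ 0 ∷ [] else if y ≡ᵇ q1 then 4 ∷ 3 ∷ [] else 4 ∷ 4 ∷ y ∷ []

  opaque
    KE : ℕ → ℕ → List ℕ
    KE x y = if x ≡ᵇ 0 then r0 y else if x ≡ᵇ 1 then r1 y else if x ≡ᵇ pm then rl y else 3 ∷ x ∷ lowBit y ∷ half y ∷ []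

  open Grid P Q KE

  opaque
    unfolding KE
    K-r0 : ∀ y → 1 ≤ y → y < q2 → KE 0 y ≡ 1 ∷ y ∷ []
    K-r0 (suc y) _ lt rewrite ≡ᵇ-false {suc y} {q2} (λ e → <-irrefl e lt) | ≡ᵇ-false {suc y} {q1} (λ e → <-irrefl e (<-trans lt (n<1+n q2))) = refl
    K-Z1 : KE 0 q2 ≡ 4 ∷ 1 ∷ []
    K-Z1 rewrite ≡ᵇ-refl (double h0) = refl
    K-Z2 : KE 0 q1 ≡ 4 ∷ 2 ∷ []
    K-Z2 rewrite ≡ᵇ-false {q1} {q2} 1+n≢n | ≡ᵇ-refl (double h0) = refl
    K-Y1 : KE 1 q1 ≡ 2 ∷ 1 ∷ []
    K-Y1 rewrite ≡ᵇ-refl (double h0) = refl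
    K-Y2 : KE 1 q2 ≡ 2 ∷ 2 ∷ []
    K-Y2 rewrite ≡ᵇ-false {q2} {q1} (λ e → 1+n≢n (sym e)) | ≡ᵇ-refl (double h0) = refl
    K-r1 : ∀ b w → w ≤ h0 → KE 1 (bitValue b + double w) ≡ (if bitValue b ≡ᵇ 0 then 2 ∷ 0 ∷ w ∷ [] else 2 ∷ 3 ∷ w ∷ [])
    K-r1 b w le rewrite ≡ᵇ-false {bitValue b + double w} {q1} (λ e → <-irrefl e (<-trans (bit+double<double b (s≤s le)) (n<1+n _))) | ≡ᵇ-false {bitValue b + double w} {q2} (λ e → <-irrefl e (bit+double<double b (s≤s le))) | lowBit-bit+double b w | half-bit+double b w = refl
    K-Z0 : KE pm q2 ≡ 4 ∷ 0 ∷ []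
    K-Z0 rewrite ≡ᵇ-refl p0 | ≡ᵇ-refl (double h0) = refl
    K-Z3 : KE pm q1 ≡ 4 ∷ 3 ∷ []
    K-Z3 rewrite ≡ᵇ-refl p0 | ≡ᵇ-false {q1} {q2} 1+n≢n | ≡ᵇ-refl (double h0) = refl
    K-ZL : ∀ y → y < q2 → KE pm y ≡ 4 ∷ 4 ∷ y ∷ []
    K-ZL y lt rewrite ≡ᵇ-refl p0 | ≡ᵇ-false {y} {q2} (λ e → <-irrefl e lt) | ≡ᵇ-false {y} {q1} (λ e → <-irrefl e (<-trans lt (n<1+n q2))) = refl
    K-mid : ∀ x' y → x' ≤ p0 → KE (suc (suc x')) y ≡ 3 ∷ suc (suc x') ∷ lowBit y ∷ half y ∷ []
    K-mid x' y le rewrite ≡ᵇ-false {x'} {suc p0} (λ e → <-irrefl e (s≤s le)) = refl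

    r1t : ℕ → List ℕ
    r1t y = if lowBit y ≡ᵇ 0 then 0 ∷ half y ∷ [] else 3 ∷ half y ∷ []

    K-r1h : ∀ y → y < q2 → KE 1 y ≡ 2 ∷ r1t y
    K-r1h y lt rewrite ≡ᵇ-false {y} {q1} (λ e → <-irrefl e (<-trans lt (n<1+n q2))) | ≡ᵇ-false {y} {q2} (λ e → <-irrefl e lt) with lowBit y ≡ᵇ 0
    ... | true = refl
    ... | false = refl

    K-pmh : ∀ y → Σ (List ℕ) (λ rest → KE pm y ≡ 4 ∷ rest)
    K-pmh y rewrite ≡ᵇ-refl p0 with y ≡ᵇ q2 | y ≡ᵇ q1
    ... | true | _ = _ , refl
    ... | false | true = _ , refl
    ... | false | false = _ , refl

    r0-small : ∀ y → y < q2 → ∀ c rest → 2 ≤ c → lex< (KE 0 y) (c ∷ rest) ≡ true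
    r0-small zero lt c rest le rewrite <ᵇ-true {0} {c} (≤-trans (s≤s z≤n) le) = refl
    r0-small (suc y) lt c rest le rewrite K-r0 (suc y) (s≤s z≤n) lt | <ᵇ-true {1} {c} le = refl

    K-mid' : ∀ x' b w → x' ≤ p0 → KE (suc (suc x')) (bitValue b + double w) ≡ 3 ∷ suc (suc x') ∷ bitValue b ∷ w ∷ []
    K-mid' x' b w le = trans (K-mid x' _ le) (cong₂ (λ s t → 3 ∷ suc (suc x') ∷ s ∷ t ∷ []) (lowBit-bit+double b w) (half-bit+double b w))

    K-00 : KE 0 0 ≡ 0 ∷ []
    K-00 = refl
    K-10 : KE 1 0 ≡ 2 ∷ 0 ∷ 0 ∷ []
    K-10 = refl
    K-01 : KE 0 1 ≡ 1 ∷ 1 ∷ []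
    K-01 = refl
  lex<-next-row : ∀ x c d w w′ → lex< (3 ∷ x ∷ c ∷ w ∷ []) (3 ∷ suc x ∷ d ∷ w′ ∷ []) ≡ true
  lex<-next-row x c d w w′ = lex<-++ (3 ∷ []) {x ∷ c ∷ w ∷ []} {suc x ∷ d ∷ w′ ∷ []} (lex<-head {x} {suc x} (c ∷ w ∷ []) (d ∷ w′ ∷ []) (n<1+n x))
  even-before-odd : ∀ x w w' → lex< (3 ∷ x ∷ 0 ∷ w ∷ []) (3 ∷ x ∷ 1 ∷ w' ∷ []) ≡ true
  even-before-odd x w w' = trans (lex<-cons 3 (x ∷ 0 ∷ w ∷ []) (x ∷ 1 ∷ w' ∷ [])) (trans (lex<-cons x (0 ∷ w ∷ []) (1 ∷ w' ∷ [])) refl)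

  Minimal : ℕ → ℕ → Set
  Minimal x y = (x ≡ 0) × (y ≡ 0)

  Peels : ℕ → ℕ → Set
  Peels = PeelableAt pm q3 Minimal

  q2<Q : q2 < Q
  q2<Q = <-trans (n<1+n q2) (n<1+n q1)

  peel-A : Peels 0 0
  peel-A = star (inj₁ (later-via refl refl K-00 (K-ZL 0 (s≤s z≤n)) refl)) (inj₁ (later-via refl refl K-00 K-10 refl)) (inj₁ (later-via refl refl K-00 K-Z2 refl)) (inj₁ (later-via refl refl K-00 K-01 refl)) ,
        λ _ → inj₂ ((tt , tt , tt , tt) , (refl , refl))

  peel-R0 : ∀ y → y < q3 → Peels 0 (suc y)
  peel-R0 y lt = star (inj₁ (later-via refl refl k (K-ZL (suc y) (s≤s lt)) refl))
                  (inj₁ (later-via refl refl k (K-r1h (suc y) (s≤s lt)) refl))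
                  (inj₂ (left y lt))
                  (inj₁ right) , λ _ → inj₁ refl
    where
    k : KE 0 (suc y) ≡ 1 ∷ suc y ∷ []
    k = K-r0 (suc y) (s≤s z≤n) (s≤s lt)
    left : ∀ y → y < q3 → Later 0 y 0 (suc y)
    left zero _ = earlier-via refl refl K-01 K-00 refl
    left (suc y') lt' = earlier-via refl refl (K-r0 (suc (suc y')) (s≤s z≤n) (s≤s lt')) (K-r0 (suc y') (s≤s z≤n) (<-trans lt' (n<1+n _))) (lex<-last (1 ∷ []) {suc y'} {suc (suc y')} (n<1+n _))
    right : Later 0 (suc y) 0 (next Q (suc y))
    right with m≤n⇒m<n∨m≡n lt
    ... | inj₁ l = later-via refl (next-< (≤-trans (s≤s l) (<⇒≤ q2<Q))) k (K-r0 (suc (suc y)) (s≤s z≤n) (s≤s l)) (lex<-last (1 ∷ []) {suc y} {suc (suc y)} (n<1+n _))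
    ... | inj₂ refl = later-via refl (next-< q2<Q) k K-Z1 refl

  peel-Z1 : Peels 0 q2
  peel-Z1 = star (inj₂ (earlier-via refl refl K-Z1 K-Z0 refl)) (inj₂ (earlier-via refl refl K-Z1 K-Y2 refl)) (inj₂ (earlier-via refl refl K-Z1 (K-r0 q3 (s≤s z≤n) (n<1+n _)) refl))
             (inj₁ (later-via refl (next-< (n<1+n q1)) K-Z1 K-Z2 refl)) , λ _ → inj₁ refl

  peel-Z2 : Peels 0 q1
  peel-Z2 = star (inj₁ (later-via refl refl K-Z2 K-Z3 refl)) (inj₂ (earlier-via refl refl K-Z2 K-Y1 refl)) (inj₂ (earlier-via refl refl K-Z2 K-Z1 refl))
             (inj₂ (earlier-via refl (next-last refl) K-Z2 K-00 refl)) , λ _ → inj₁ refl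

  peel-Y1 : Peels 1 q1
  peel-Y1 = star (inj₁ (later-via refl refl K-Y1 K-Z2 refl)) (inj₁ (later-via refl refl K-Y1 (K-mid' 0 b1 (suc h0) z≤n) refl)) (inj₁ (later-via refl refl K-Y1 K-Y2 refl))
             (inj₂ (earlier-via refl (next-last refl) K-Y1 K-10 refl)) , λ _ → inj₁ refl

  peel-Y2 : Peels 1 q2
  peel-Y2 = star (inj₁ (later-via refl refl K-Y2 K-Z1 refl)) (inj₁ (later-via refl refl K-Y2 (K-mid' 0 b0 (suc h0) z≤n) refl)) (inj₁ (later-via refl refl K-Y2 (K-r1 b1 h0 ≤-refl) refl))
             (inj₂ (earlier-via refl (next-< (n<1+n q1)) K-Y2 K-Y1 refl)) , λ _ → inj₁ refl

  peel-E1 : ∀ w → w ≤ h0 → Peels 1 (double w)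
  peel-E1 w le = star (inj₂ up) (inj₁ (later-via refl refl k (K-mid' 0 b0 w z≤n) refl)) (inj₁ (left w le)) (inj₁ (later-via refl (next-< (<-trans (s≤s (bit+double<double b0 (s≤s le))) (n<1+n q1))) k (K-r1 b1 w le) refl)) , λ _ → inj₁ refl
    where
    k : KE 1 (double w) ≡ 2 ∷ 0 ∷ w ∷ []
    k = K-r1 b0 w le
    up : Later 0 (double w) 1 (double w)
    up = earlier-via refl refl k refl (r0-small (double w) (bit+double<double b0 (s≤s le)) 2 _ ≤-refl)
    left : ∀ w → w ≤ h0 → Later 1 (double w) 1 (prev Q (double w))
    left zero le' = later-via refl refl (K-r1 b0 0 le') K-Y1 refl
    left (suc w') le' = later-via refl refl (K-r1 b0 (suc w') le') (K-r1 b1 w' (≤-trans (n≤1+n _) le')) refl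

  peel-O1 : ∀ w → w ≤ h0 → Peels 1 (suc (double w))
  peel-O1 w le = star (inj₂ (earlier-via refl refl k refl (r0-small (suc (double w)) (bit+double<double b1 (s≤s le)) 2 _ ≤-refl))) (inj₁ (later-via refl refl k (K-mid' 0 b1 w z≤n) refl))
                  (inj₂ (earlier-via refl refl k (K-r1 b0 w le) refl)) (inj₂ right) , λ _ → inj₁ refl
    where
    k : KE 1 (suc (double w)) ≡ 2 ∷ 3 ∷ w ∷ []
    k = K-r1 b1 w le
    right : Later 1 (next Q (suc (double w))) 1 (suc (double w))
    right with m≤n⇒m<n∨m≡n le
    ... | inj₁ l = earlier-via refl (next-< {Q} {suc (double w)} (<-trans (bit+double<double b0 (s≤s l)) q2<Q)) k (K-r1 b0 (suc w) l) refl
    ... | inj₂ refl = earlier-via refl (next-< q2<Q) k K-Y2 refl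

  K-1h : ∀ y → y < Q → Σ (List ℕ) (λ rest → KE 1 y ≡ 2 ∷ rest)
  K-1h y lt with m≤n⇒m<n∨m≡n (s≤s⁻¹ lt)
  ... | inj₂ refl = _ , K-Y1
  ... | inj₁ l with m≤n⇒m<n∨m≡n (s≤s⁻¹ l)
  ...   | inj₂ refl = _ , K-Y2
  ...   | inj₁ l' = _ , K-r1h y l'

  peel-mid : ∀ x' b w → x' ≤ p0 → w ≤ suc h0 → Peels (suc (suc x')) (bitValue b + double w)
  peel-mid x' b0 w lx lw = star (inj₂ (up x' lx)) (inj₁ (down x' lx)) (inj₁ (left w)) (inj₁ right) , λ _ → inj₁ refl
    where
    k : KE (suc (suc x')) (double w) ≡ 3 ∷ suc (suc x') ∷ 0 ∷ w ∷ []
    k = K-mid' x' b0 w lx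
    up : ∀ x' → x' ≤ p0 → Later (suc x') (double w) (suc (suc x')) (double w)
    up zero lx' = earlier-via refl refl (K-mid' zero b0 w lx') (proj₂ (K-1h (double w) (bit+double<double b0 (s≤s lw)))) refl
    up (suc x'') lx' = earlier-via refl refl (K-mid' (suc x'') b0 w lx') (K-mid' x'' b0 w (≤-trans (n≤1+n _) lx')) (lex<-next-row (suc (suc x'')) 0 0 w w)
    down : ∀ x' → x' ≤ p0 → Later (suc (suc x')) (double w) (next P (suc (suc x'))) (double w)
    down x' lx' with m≤n⇒m<n∨m≡n lx'
    ... | inj₁ l = later-via (next-< {P} {suc (suc x')} (s≤s (s≤s (s≤s (s≤s lx'))))) refl (K-mid' x' b0 w lx') (K-mid' (suc x') b0 w l) (lex<-next-row (suc (suc x')) 0 0 w w)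
    ... | inj₂ refl = later-via (next-< {P} {suc (suc p0)} ≤-refl) refl (K-mid' p0 b0 w lx') (proj₂ (K-pmh (double w))) refl
    left : ∀ w → Later (suc (suc x')) (double w) (suc (suc x')) (prev Q (double w))
    left zero = later-via refl refl (K-mid' x' b0 0 lx) (K-mid' x' b1 (suc h0) lx) (even-before-odd (suc (suc x')) 0 (suc h0))
    left (suc w') = later-via refl refl (K-mid' x' b0 (suc w') lx) (K-mid' x' b1 w' lx) (even-before-odd (suc (suc x')) (suc w') w')
    right : Later (suc (suc x')) (double w) (suc (suc x')) (next Q (double w))
    right = later-via refl (next-< {Q} {double w} (bit+double<double b1 (s≤s lw))) k (K-mid' x' b1 w lx) (even-before-odd (suc (suc x')) w w)
  peel-mid x' b1 w lx lw = star (inj₂ (up x' lx)) (inj₁ (down x' lx)) (inj₂ left) (inj₂ right) , λ _ → inj₁ refl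
    where
    k : KE (suc (suc x')) (suc (double w)) ≡ 3 ∷ suc (suc x') ∷ 1 ∷ w ∷ []
    k = K-mid' x' b1 w lx
    up : ∀ x' → x' ≤ p0 → Later (suc x') (suc (double w)) (suc (suc x')) (suc (double w))
    up zero lx' = earlier-via refl refl (K-mid' zero b1 w lx') (proj₂ (K-1h (suc (double w)) (bit+double<double b1 (s≤s lw)))) refl
    up (suc x'') lx' = earlier-via refl refl (K-mid' (suc x'') b1 w lx') (K-mid' x'' b1 w (≤-trans (n≤1+n _) lx')) (lex<-next-row (suc (suc x'')) 1 1 w w)
    down : ∀ x' → x' ≤ p0 → Later (suc (suc x')) (suc (double w)) (next P (suc (suc x'))) (suc (double w))
    down x' lx' with m≤n⇒m<n∨m≡n lx'
    ... | inj₁ l = later-via (next-< {P} {suc (suc x')} (s≤s (s≤s (s≤s (s≤s lx'))))) refl (K-mid' x' b1 w lx') (K-mid' (suc x') b1 w l) (lex<-next-row (suc (suc x')) 1 1 w w)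
    ... | inj₂ refl = later-via (next-< {P} {suc (suc p0)} ≤-refl) refl (K-mid' p0 b1 w lx') (proj₂ (K-pmh (suc (double w)))) refl
    left : Later (suc (suc x')) (prev Q (suc (double w))) (suc (suc x')) (suc (double w))
    left = earlier-via refl refl k (K-mid' x' b0 w lx) (even-before-odd (suc (suc x')) w w)
    right : Later (suc (suc x')) (next Q (suc (double w))) (suc (suc x')) (suc (double w))
    right with m≤n⇒m<n∨m≡n lw
    ... | inj₁ l = earlier-via refl (next-< {Q} {suc (double w)} (bit+double<double b0 (s≤s l))) k (K-mid' x' b0 (suc w) lx) (even-before-odd (suc (suc x')) (suc w) w)
    ... | inj₂ refl = earlier-via refl (next-last {Q} {q1} refl) k (K-mid' x' b0 0 lx) (even-before-odd (suc (suc x')) 0 (suc h0))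

  peel-Z0 : Peels pm q2
  peel-Z0 = star (inj₂ (earlier-via refl refl K-Z0 (K-mid' p0 b0 (suc h0) ≤-refl) refl)) (inj₁ (later-via (next-last {P} {pm} refl) refl K-Z0 K-Z1 refl))
             (inj₁ (later-via refl refl K-Z0 (K-ZL q3 (n<1+n _)) refl)) (inj₁ (later-via refl (next-< (n<1+n q1)) K-Z0 K-Z3 refl)) , λ _ → inj₁ refl

  peel-Z3 : Peels pm q1
  peel-Z3 = star (inj₂ (earlier-via refl refl K-Z3 (K-mid' p0 b1 (suc h0) ≤-refl) refl)) (inj₂ (earlier-via (next-last {P} {pm} refl) refl K-Z3 K-Z2 refl))
             (inj₂ (earlier-via refl refl K-Z3 K-Z0 refl)) (inj₁ (later-via refl (next-last {Q} {q1} refl) K-Z3 (K-ZL 0 (s≤s z≤n)) refl)) , λ _ → inj₁ refl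

  peel-ZL : ∀ y → y < q2 → Peels pm y
  peel-ZL y lt with m≤n⇒m<n∨m≡n lt
  ... | inj₁ l = star (inj₂ U') (inj₂ D') (inj₂ (left y lt)) (inj₁ (later-via refl (next-< {Q} {y} (<-trans l q2<Q)) k (K-ZL (suc y) l) (lex<-last (4 ∷ 4 ∷ []) {y} {suc y} (n<1+n y)))) , λ _ → inj₁ refl
    where
    k : KE pm y ≡ 4 ∷ 4 ∷ y ∷ []
    k = K-ZL y lt
    U' : Later (prev P pm) y pm y
    U' = earlier-via refl refl k (K-mid p0 y ≤-refl) refl
    D' : Later (next P pm) y pm y
    D' = earlier-via (next-last {P} {pm} refl) refl k refl (r0-small y lt 4 _ (s≤s (s≤s z≤n)))
    left : ∀ y → y < q2 → Later pm (prev Q y) pm y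
    left zero lt' = earlier-via refl refl (K-ZL 0 lt') K-Z3 refl
    left (suc y') lt' = earlier-via refl refl (K-ZL (suc y') lt') (K-ZL y' (<-trans (n<1+n y') lt')) (lex<-last (4 ∷ 4 ∷ []) {y'} {suc y'} (n<1+n y'))
  ... | inj₂ e = star (inj₂ U') (inj₂ D') (inj₂ (left y lt)) (inj₂ (earlier-via refl (next-< {Q} {y} (subst (_< Q) (sym e) q2<Q)) k (subst (λ t → KE pm t ≡ 4 ∷ 0 ∷ []) (sym e) K-Z0) refl)) , λ n → ⊥-elim (n (refl , suc-injective e))
    where
    k : KE pm y ≡ 4 ∷ 4 ∷ y ∷ []
    k = K-ZL y lt
    U' : Later (prev P pm) y pm y
    U' = earlier-via refl refl k (K-mid p0 y ≤-refl) refl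
    D' : Later (next P pm) y pm y
    D' = earlier-via (next-last {P} {pm} refl) refl k refl (r0-small y lt 4 _ (s≤s (s≤s z≤n)))
    left : ∀ y → y < q2 → Later pm (prev Q y) pm y
    left zero lt' = earlier-via refl refl (K-ZL 0 lt') K-Z3 refl
    left (suc y') lt' = earlier-via refl refl (K-ZL (suc y') lt') (K-ZL y' (<-trans (n<1+n y') lt')) (lex<-last (4 ∷ 4 ∷ []) {y'} {suc y'} (n<1+n y'))

  below-or-last-two : ∀ y → y < Q → (y < q2) ⊎ ((y ≡ q2) ⊎ (y ≡ q1))
  below-or-last-two y (s≤s l) with m≤n⇒m<n∨m≡n l
  ... | inj₂ e = inj₂ (inj₂ e)
  ... | inj₁ (s≤s l') with m≤n⇒m<n∨m≡n l'
  ...   | inj₂ e = inj₂ (inj₁ e)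
  ...   | inj₁ l'' = inj₁ l''

  peeling-order : PeelingOrder pm q3 Minimal
  peeling-order zero zero _ _ = peel-A
  peeling-order zero (suc y) _ y< with below-or-last-two (suc y) y<
  ... | inj₁ (s≤s l) = peel-R0 y l
  ... | inj₂ (inj₁ e) = subst (Peels 0) (sym e) peel-Z1
  ... | inj₂ (inj₂ e) = subst (Peels 0) (sym e) peel-Z2
  peeling-order (suc zero) y _ y< with below-or-last-two y y<
  ... | inj₂ (inj₁ e) = subst (Peels 1) (sym e) peel-Y2
  ... | inj₂ (inj₂ e) = subst (Peels 1) (sym e) peel-Y1
  ... | inj₁ l with halve y
  ...   | b0 , w , e = subst (Peels 1) (sym e) (peel-E1 w (s≤s⁻¹ (bit+double<double⇒< b0 w (suc h0) (subst (_< q2) e l))))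
  ...   | b1 , w , e = subst (Peels 1) (sym e) (peel-O1 w (s≤s⁻¹ (bit+double<double⇒< b1 w (suc h0) (subst (_< q2) e l))))
  peeling-order (suc (suc x')) y (s≤s (s≤s (s≤s lx))) y< with m≤n⇒m<n∨m≡n lx
  ... | inj₁ (s≤s lx') with halve y
  ...   | b , w , e = subst (Peels (suc (suc x'))) (sym e) (peel-mid x' b w lx' (s≤s⁻¹ (bit+double<double⇒< b w (suc (suc h0)) (subst (_< Q) e y<))))
  peeling-order (suc (suc x')) y (s≤s (s≤s (s≤s lx))) y< | inj₂ refl with below-or-last-two y y<
  ... | inj₁ l = peel-ZL y l
  ... | inj₂ (inj₁ e) = subst (Peels pm) (sym e) peel-Z0
  ... | inj₂ (inj₂ e) = subst (Peels pm) (sym e) peel-Z3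

-- Rank of a cell inside its 2 × 2 block, from the parities of its row and column and whether the
-- block lies in the last block column; posL does the same in the last two rows.
posG : ℕ → ℕ → Bool → ℕ
posG 0 1 false = 0
posG 0 0 false = 1
posG 1 1 false = 2
posG 1 0 false = 3
posG 1 0 true = 0
posG 0 0 true = 1
posG 0 1 true = 2
posG 1 1 true = 3
posG _ _ _ = 0

posL : ℕ → ℕ → ℕ
posL 0 1 = 0
posL 0 0 = 1
posL 1 0 = 2
posL 1 1 = 3
posL _ _ = 0

module TwoMinimaOrder (a0 c0 r α : ℕ) (aligned : Bool) where
  m P mm1 n Q nm1 nb1 : ℕ
  m = suc (suc (suc (suc (double a0))))
  P = suc m
  mm1 = suc (suc (suc (double a0)))
  n = suc (suc (suc (suc (double c0))))
  Q = suc n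
  nm1 = suc (suc (suc (double c0)))
  nb1 = suc c0

  -- The order: the minimal cells (0,α) and (r,n); the rest of the cross formed by row 0 and
  -- column n (row 0 right of α, column n upwards and then downwards from r, row 0 leftwards from
  -- α, and (0,n)); (0,0) and the 2 × 2 blocks tiling rows 1, …, m-2 and columns 0, …, n-1; and the
  -- last two rows, ending at (m,n-1).  When α = n (aligned), the cells (0,0), (1,n) and (m,n) are
  -- moved into the later phases.
  xkey gm0key : List ℕ
  xkey = if aligned then 3 ∷ 3 ∷ [] else 3 ∷ 1 ∷ []
  gm0key = if aligned then 3 ∷ 5 ∷ 0 ∷ [] else 3 ∷ 0 ∷ []
  l1key l2key : List ℕ
  l1key = 3 ∷ 2 ∷ 0 ∷ 0 ∷ 4 ∷ []
  l2key = 3 ∷ 5 ∷ 1 ∷ []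

  row0 col : ℕ → List ℕ
  row0 y = if y ≡ᵇ 0 then xkey else if y <ᵇ α then 2 ∷ 3 ∷ (α ∸ y) ∷ [] else if y ≡ᵇ α then 0 ∷ [] else if y ≡ᵇ n then 2 ∷ 4 ∷ [] else 2 ∷ 0 ∷ y ∷ []
  col x = if (x ≡ᵇ 1) ∧ aligned then l1key else if (x ≡ᵇ m) ∧ aligned then l2key else if x <ᵇ r then 2 ∷ 1 ∷ (r ∸ x) ∷ [] else if x ≡ᵇ r then 1 ∷ [] else 2 ∷ 2 ∷ x ∷ []

  gridk : ℕ → ℕ → List ℕ
  gridk x y = if x ≡ᵇ m then (if y ≡ᵇ 0 then gm0key else if y ≡ᵇ nm1 then 3 ∷ 5 ∷ 5 ∷ [] else 3 ∷ 5 ∷ 3 ∷ half (y ∸ 1) ∷ posL 1 (lowBit (y ∸ 1)) ∷ [])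
              else if x ≡ᵇ mm1 then (if y ≡ᵇ 0 then 3 ∷ 5 ∷ 2 ∷ [] else if y ≡ᵇ nm1 then 3 ∷ 5 ∷ 4 ∷ [] else 3 ∷ 5 ∷ 3 ∷ half (y ∸ 1) ∷ posL 0 (lowBit (y ∸ 1)) ∷ [])
              else 3 ∷ 2 ∷ half (x ∸ 1) ∷ half y ∷ posG (lowBit (x ∸ 1)) (lowBit y) (half y ≡ᵇ nb1) ∷ []

  opaque
    K : ℕ → ℕ → List ℕ
    K x y = if x ≡ᵇ 0 then row0 y else if y ≡ᵇ n then col x else gridk x y

  open Grid P Q K

  gx : Bit → ℕ → ℕ
  gx rr k = suc (bitValue rr + double k)
  gy : Bit → ℕ → ℕ
  gy d t = bitValue d + double t

  gy<n : ∀ d t → t ≤ nb1 → gy d t < n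
  gy<n d t le = bit+double<double d (s≤s le)

  gx<mm1 : ∀ rr k → k ≤ a0 → gx rr k < mm1
  gx<mm1 rr k le = s≤s (bit+double<double rr (s≤s le))

  opaque
    unfolding K
    K-row0 : ∀ y → K 0 y ≡ row0 y
    K-row0 y = refl
    K-col : ∀ x → 1 ≤ x → K x n ≡ col x
    K-col (suc x) _ rewrite ≡ᵇ-refl (double c0) = refl
    K-grid : ∀ x y → 1 ≤ x → y < n → K x y ≡ gridk x y
    K-grid (suc x) y _ lt rewrite ≡ᵇ-false {y} {n} (λ e → <-irrefl e lt) = refl

  xkey1 : aligned ≡ false → xkey ≡ 3 ∷ 1 ∷ []
  xkey1 e = cong (λ b → if b then 3 ∷ 3 ∷ [] else 3 ∷ 1 ∷ []) e
  xkey3 : aligned ≡ true → xkey ≡ 3 ∷ 3 ∷ []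
  xkey3 e = cong (λ b → if b then 3 ∷ 3 ∷ [] else 3 ∷ 1 ∷ []) e
  gm01 : aligned ≡ false → gm0key ≡ 3 ∷ 0 ∷ []
  gm01 e = cong (λ b → if b then 3 ∷ 5 ∷ 0 ∷ [] else 3 ∷ 0 ∷ []) e
  gm03 : aligned ≡ true → gm0key ≡ 3 ∷ 5 ∷ 0 ∷ []
  gm03 e = cong (λ b → if b then 3 ∷ 5 ∷ 0 ∷ [] else 3 ∷ 0 ∷ []) e

  m≢mm1 : ¬ (m ≡ mm1)
  m≢mm1 e = <-irrefl (sym e) (n<1+n mm1)
  mm1<m : mm1 < m
  mm1<m = n<1+n mm1
  nm1<n : nm1 < n
  nm1<n = n<1+n nm1

  K-X : K 0 0 ≡ xkey
  K-X = K-row0 0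
  K-RR : ∀ y → 1 ≤ y → y < α → K 0 y ≡ 2 ∷ 3 ∷ (α ∸ y) ∷ []
  K-RR (suc y) _ lt = trans (K-row0 (suc y)) (if-true (<ᵇ-true {suc y} {α} lt))
  K-A : 1 ≤ α → K 0 α ≡ 0 ∷ []
  K-A le = trans (K-row0 α) (trans (if-false (≡ᵇ-false {α} {0} (λ e → <-irrefl (sym e) le))) (trans (if-false (<ᵇ-irrefl α)) (if-true (≡ᵇ-refl α))))
  K-RL : ∀ y → α < y → y < n → K 0 y ≡ 2 ∷ 0 ∷ y ∷ []
  K-RL y l1 l2 = trans (K-row0 y) (trans (if-false (≡ᵇ-false {y} {0} (λ e → <-irrefl (sym e) (≤-<-trans z≤n l1)))) (trans (if-false (<ᵇ-false {y} {α} (<-asym l1))) (trans (if-false (≡ᵇ-false {y} {α} (λ e → <-irrefl (sym e) l1))) (if-false (≡ᵇ-false {y} {n} (λ e → <-irrefl e l2))))))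
  K-I : α < n → K 0 n ≡ 2 ∷ 4 ∷ []
  K-I l = trans (K-row0 n) (trans (if-false (<ᵇ-false {n} {α} (<-asym l))) (trans (if-false (≡ᵇ-false {n} {α} (λ e → <-irrefl (sym e) l))) (if-true (≡ᵇ-refl n))))

  K-KU : ∀ x → 1 ≤ x → x < r → r ≤ m → ((x ≡ᵇ 1) ∧ aligned) ≡ false → K x n ≡ 2 ∷ 1 ∷ (r ∸ x) ∷ []
  K-KU x l0 l1 l2 h = trans (K-col x l0) (trans (if-false h) (trans (if-false (cong (_∧ aligned) (≡ᵇ-false {x} {m} (λ e → <-irrefl e (<-≤-trans l1 l2))))) (if-true (<ᵇ-true {x} {r} l1))))
  K-B : 1 ≤ r → ((r ≡ᵇ 1) ∧ aligned) ≡ false → ((r ≡ᵇ m) ∧ aligned) ≡ false → K r n ≡ 1 ∷ []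
  K-B l0 h1 h2 = trans (K-col r l0) (trans (if-false h1) (trans (if-false h2) (trans (if-false (<ᵇ-irrefl r)) (if-true (≡ᵇ-refl r)))))
  K-KD : ∀ x → 1 ≤ r → r < x → ((x ≡ᵇ m) ∧ aligned) ≡ false → K x n ≡ 2 ∷ 2 ∷ x ∷ []
  K-KD x l0 l1 h = trans (K-col x (≤-trans l0 (<⇒≤ l1))) (trans (if-false (cong (_∧ aligned) (≡ᵇ-false {x} {1} (λ e → <-irrefl (sym e) (≤-<-trans l0 l1))))) (trans (if-false h) (trans (if-false (<ᵇ-false {x} {r} (<-asym l1))) (if-false (≡ᵇ-false {x} {r} (λ e → <-irrefl (sym e) l1))))))
  K-L1 : aligned ≡ true → K 1 n ≡ l1key
  K-L1 e = trans (K-col 1 (s≤s z≤n)) (if-true e)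
  K-L2 : aligned ≡ true → K m n ≡ l2key
  K-L2 e = trans (K-col m (s≤s z≤n)) (trans (if-false {c = (m ≡ᵇ 1) ∧ aligned} {a = l1key} refl) (if-true (trans (cong (_∧ aligned) (≡ᵇ-refl m)) e)))

  K-G : ∀ k rr t d → k ≤ a0 → t ≤ nb1 → K (gx rr k) (gy d t) ≡ 3 ∷ 2 ∷ k ∷ t ∷ posG (bitValue rr) (bitValue d) (t ≡ᵇ nb1) ∷ []
  K-G k rr t d lk lt = trans (K-grid (gx rr k) (gy d t) (s≤s z≤n) (gy<n d t lt))
    (trans (if-false (≡ᵇ-false {gx rr k} {m} (λ e → <-irrefl e (<-trans (gx<mm1 rr k lk) mm1<m))))
    (trans (if-false (≡ᵇ-false {gx rr k} {mm1} (λ e → <-irrefl e (gx<mm1 rr k lk)))) fin))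
    where
    fin : (3 ∷ 2 ∷ half (bitValue rr + double k) ∷ half (gy d t) ∷ posG (lowBit (bitValue rr + double k)) (lowBit (gy d t)) (half (gy d t) ≡ᵇ nb1) ∷ []) ≡ 3 ∷ 2 ∷ k ∷ t ∷ posG (bitValue rr) (bitValue d) (t ≡ᵇ nb1) ∷ []
    fin rewrite half-bit+double rr k | lowBit-bit+double rr k | half-bit+double d t | lowBit-bit+double d t = refl
  K-Gm0 : K m 0 ≡ gm0key
  K-Gm0 = trans (K-grid m 0 (s≤s z≤n) (s≤s z≤n)) (trans (if-true (≡ᵇ-refl m)) refl)
  K-LS0 : K mm1 0 ≡ 3 ∷ 5 ∷ 2 ∷ []
  K-LS0 = trans (K-grid mm1 0 (s≤s z≤n) (s≤s z≤n)) (trans (if-false (≡ᵇ-false {mm1} {m} (λ e → m≢mm1 (sym e)))) (trans (if-true (≡ᵇ-refl mm1)) refl))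
  K-LE1 : K mm1 nm1 ≡ 3 ∷ 5 ∷ 4 ∷ []
  K-LE1 = trans (K-grid mm1 nm1 (s≤s z≤n) nm1<n) (trans (if-false (≡ᵇ-false {mm1} {m} (λ e → m≢mm1 (sym e)))) (trans (if-true (≡ᵇ-refl mm1)) (trans (if-false {a = 3 ∷ 5 ∷ 2 ∷ []} refl) (if-true (≡ᵇ-refl nm1)))))
  K-LE2 : K m nm1 ≡ 3 ∷ 5 ∷ 5 ∷ []
  K-LE2 = trans (K-grid m nm1 (s≤s z≤n) nm1<n) (trans (if-true (≡ᵇ-refl m)) (trans (if-false {a = gm0key} refl) (if-true (≡ᵇ-refl nm1))))

  lpy<nm1 : ∀ d t → t ≤ c0 → suc (gy d t) < nm1
  lpy<nm1 d t le = s≤s (bit+double<double d (s≤s le))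

  K-LPb : ∀ t d → t ≤ c0 → K m (suc (gy d t)) ≡ 3 ∷ 5 ∷ 3 ∷ t ∷ posL 1 (bitValue d) ∷ []
  K-LPb t d le = trans (K-grid m (suc (gy d t)) (s≤s z≤n) (<-trans (lpy<nm1 d t le) nm1<n)) (trans (if-true (≡ᵇ-refl m)) (trans (if-false {a = gm0key} refl) (trans (if-false (≡ᵇ-false {suc (gy d t)} {nm1} (λ e → <-irrefl e (lpy<nm1 d t le)))) fin)))
    where
    fin : (3 ∷ 5 ∷ 3 ∷ half (gy d t) ∷ posL 1 (lowBit (gy d t)) ∷ []) ≡ 3 ∷ 5 ∷ 3 ∷ t ∷ posL 1 (bitValue d) ∷ []
    fin rewrite half-bit+double d t | lowBit-bit+double d t = refl
  K-LPt : ∀ t d → t ≤ c0 → K mm1 (suc (gy d t)) ≡ 3 ∷ 5 ∷ 3 ∷ t ∷ posL 0 (bitValue d) ∷ []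
  K-LPt t d le = trans (K-grid mm1 (suc (gy d t)) (s≤s z≤n) (<-trans (lpy<nm1 d t le) nm1<n)) (trans (if-false (≡ᵇ-false {mm1} {m} (λ e → m≢mm1 (sym e)))) (trans (if-true (≡ᵇ-refl mm1)) (trans (if-false {a = 3 ∷ 5 ∷ 2 ∷ []} refl) (trans (if-false (≡ᵇ-false {suc (gy d t)} {nm1} (λ e → <-irrefl e (lpy<nm1 d t le)))) fin))))
    where
    fin : (3 ∷ 5 ∷ 3 ∷ half (gy d t) ∷ posL 0 (lowBit (gy d t)) ∷ []) ≡ 3 ∷ 5 ∷ 3 ∷ t ∷ posL 0 (bitValue d) ∷ []
    fin rewrite half-bit+double d t | lowBit-bit+double d t = refl

  row0-early : ∀ y → 1 ≤ y → y < n → ∀ rest → lex< (K 0 y) (3 ∷ rest) ≡ true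
  row0-early (suc y) _ lt rest = trans (cong (λ l → lex< l (3 ∷ rest)) (K-row0 (suc y))) (by-cases (suc y <ᵇ α) (suc y ≡ᵇ α) (suc y ≡ᵇ n))
    where
    by-cases : ∀ b1' b2 b3 → lex< (if b1' then 2 ∷ 3 ∷ (α ∸ suc y) ∷ [] else if b2 then 0 ∷ [] else if b3 then 2 ∷ 4 ∷ [] else 2 ∷ 0 ∷ suc y ∷ []) (3 ∷ rest) ≡ true
    by-cases true _ _ = refl
    by-cases false true _ = refl
    by-cases false false true = refl
    by-cases false false false = refl

  col-early : ∀ x → 2 ≤ x → x < m → ∀ rest → lex< (K x n) (3 ∷ rest) ≡ true
  col-early x l2 lm rest = trans (cong (λ l → lex< l (3 ∷ rest)) (K-col x (≤-trans (s≤s z≤n) l2)))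
    (trans (cong (λ l → lex< l (3 ∷ rest)) (trans (if-false (cong (_∧ aligned) (≡ᵇ-false {x} {1} (λ e → <-irrefl (sym e) l2)))) (if-false {c = (x ≡ᵇ m) ∧ aligned} {a = l2key} (cong (_∧ aligned) (≡ᵇ-false {x} {m} (λ e → <-irrefl e lm)))))) (by-cases (x <ᵇ r) (x ≡ᵇ r)))
    where
    by-cases : ∀ b1' b2 → lex< (if b1' then 2 ∷ 1 ∷ (r ∸ x) ∷ [] else if b2 then 1 ∷ [] else 2 ∷ 2 ∷ x ∷ []) (3 ∷ rest) ≡ true
    by-cases true _ = refl
    by-cases false true = refl
    by-cases false false = refl

  col1-early : aligned ≡ false → ∀ rest → lex< (K 1 n) (3 ∷ rest) ≡ true
  col1-early e rest = trans (cong (λ l → lex< l (3 ∷ rest)) (trans (K-col 1 (s≤s z≤n)) (trans (if-false {c = (1 ≡ᵇ 1) ∧ aligned} {a = l1key} e) (if-false {c = (1 ≡ᵇ m) ∧ aligned} {a = l2key} refl)))) (by-cases (1 <ᵇ r) (1 ≡ᵇ r))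
    where
    by-cases : ∀ b1' b2 → lex< (if b1' then 2 ∷ 1 ∷ (r ∸ 1) ∷ [] else if b2 then 1 ∷ [] else 2 ∷ 2 ∷ 1 ∷ []) (3 ∷ rest) ≡ true
    by-cases true _ = refl
    by-cases false true = refl
    by-cases false false = refl

  colm-early : aligned ≡ false → ∀ rest → lex< (K m n) (3 ∷ rest) ≡ true
  colm-early e rest = trans (cong (λ l → lex< l (3 ∷ rest)) (trans (K-col m (s≤s z≤n)) (trans (if-false {c = (m ≡ᵇ 1) ∧ aligned} {a = l1key} refl) (if-false {c = (m ≡ᵇ m) ∧ aligned} {a = l2key} (trans (cong (_∧ aligned) (≡ᵇ-refl m)) e))))) (by-cases (m <ᵇ r) (m ≡ᵇ r))
    where
    by-cases : ∀ b1' b2 → lex< (if b1' then 2 ∷ 1 ∷ (r ∸ m) ∷ [] else if b2 then 1 ∷ [] else 2 ∷ 2 ∷ m ∷ []) (3 ∷ rest) ≡ true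
    by-cases true _ = refl
    by-cases false true = refl
    by-cases false false = refl

  blockKey-cons : ∀ k t p1 p2 → lex< (3 ∷ 2 ∷ k ∷ t ∷ p1 ∷ []) (3 ∷ 2 ∷ k ∷ t ∷ p2 ∷ []) ≡ lex< (p1 ∷ []) (p2 ∷ [])
  blockKey-cons k t p1 p2 = trans (lex<-cons k (t ∷ p1 ∷ []) (t ∷ p2 ∷ [])) (lex<-cons t (p1 ∷ []) (p2 ∷ []))
  blockKey-<-column : ∀ k t t' p1 p2 → t < t' → lex< (3 ∷ 2 ∷ k ∷ t ∷ p1 ∷ []) (3 ∷ 2 ∷ k ∷ t' ∷ p2 ∷ []) ≡ true
  blockKey-<-column k t t' p1 p2 lt = trans (lex<-cons k (t ∷ p1 ∷ []) (t' ∷ p2 ∷ [])) (lex<-head {t} {t'} (p1 ∷ []) (p2 ∷ []) lt)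
  blockKey-<-row : ∀ k k' t t' p1 p2 → k < k' → lex< (3 ∷ 2 ∷ k ∷ t ∷ p1 ∷ []) (3 ∷ 2 ∷ k' ∷ t' ∷ p2 ∷ []) ≡ true
  blockKey-<-row k k' t t' p1 p2 lt = lex<-head {k} {k'} (t ∷ p1 ∷ []) (t' ∷ p2 ∷ []) lt

  blockKey : ℕ → ℕ → ℕ → List ℕ
  blockKey k t p = 3 ∷ 2 ∷ k ∷ t ∷ p ∷ []

  K-Gmm : ∀ k rr t d → k ≤ a0 → t < nb1 → K (gx rr k) (gy d t) ≡ blockKey k t (posG (bitValue rr) (bitValue d) false)
  K-Gmm k rr t d lk lt = trans (K-G k rr t d lk (<⇒≤ lt)) (cong (λ b → blockKey k t (posG (bitValue rr) (bitValue d) b)) (≡ᵇ-false {t} {nb1} (λ e → <-irrefl e lt)))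
  K-Gml : ∀ k rr d → k ≤ a0 → K (gx rr k) (gy d nb1) ≡ blockKey k nb1 (posG (bitValue rr) (bitValue d) true)
  K-Gml k rr d lk = trans (K-G k rr nb1 d lk ≤-refl) (cong (λ b → blockKey k nb1 (posG (bitValue rr) (bitValue d) b)) (≡ᵇ-refl nb1))

  lastT-hd : ∀ y → y < n → Σ (List ℕ) (λ rest → K mm1 y ≡ 3 ∷ 5 ∷ rest)
  lastT-hd zero _ = _ , K-LS0
  lastT-hd (suc y) lt with m≤n⇒m<n∨m≡n (s≤s⁻¹ lt)
  ... | inj₂ refl = _ , K-LE1
  ... | inj₁ l with halve y
  ...   | d , t , refl = _ , K-LPt t d (s≤s⁻¹ (bit+double<double⇒< d t (suc c0) (s≤s⁻¹ (subst (_< nm1) refl l))))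

  gm0-hd : gm0key ≡ 3 ∷ (if aligned then 5 ∷ 0 ∷ [] else 0 ∷ [])
  gm0-hd = if-∷ aligned 3 (5 ∷ 0 ∷ []) (0 ∷ [])
  xkey-hd : xkey ≡ 3 ∷ (if aligned then 3 ∷ [] else 1 ∷ [])
  xkey-hd = if-∷ aligned 3 (3 ∷ []) (1 ∷ [])

  grid-hd : ∀ x y → 1 ≤ x → y < n → Σ (List ℕ) (λ rest → K x y ≡ 3 ∷ rest)
  grid-hd x y l1 ly = proj₁ hh , trans (K-grid x y l1 ly) (proj₂ hh)
    where
    H : Bool → Bool → Bool → Bool → List ℕ
    H c1 c2 c3 c4 = if c1 then (if c3 then gm0key else if c4 then 3 ∷ 5 ∷ 5 ∷ [] else 3 ∷ 5 ∷ 3 ∷ half (y ∸ 1) ∷ posL 1 (lowBit (y ∸ 1)) ∷ [])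
              else if c2 then (if c3 then 3 ∷ 5 ∷ 2 ∷ [] else if c4 then 3 ∷ 5 ∷ 4 ∷ [] else 3 ∷ 5 ∷ 3 ∷ half (y ∸ 1) ∷ posL 0 (lowBit (y ∸ 1)) ∷ [])
              else 3 ∷ 2 ∷ half (x ∸ 1) ∷ half y ∷ posG (lowBit (x ∸ 1)) (lowBit y) (half y ≡ᵇ nb1) ∷ []
    h : ∀ c1 c2 c3 c4 → Σ (List ℕ) (λ rest → H c1 c2 c3 c4 ≡ 3 ∷ rest)
    h true _ true _ = _ , gm0-hd
    h true _ false true = _ , refl
    h true _ false false = _ , refl
    h false true true _ = _ , refl
    h false true false true = _ , refl
    h false true false false = _ , refl
    h false false _ _ = _ , refl
    hh : Σ (List ℕ) (λ rest → H (x ≡ᵇ m) (x ≡ᵇ mm1) (y ≡ᵇ 0) (y ≡ᵇ nm1) ≡ 3 ∷ rest)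
    hh = h (x ≡ᵇ m) (x ≡ᵇ mm1) (y ≡ᵇ 0) (y ≡ᵇ nm1)

  Minimal : ℕ → ℕ → Set
  Minimal x y = ((x ≡ 0) × (y ≡ α)) ⊎ ((x ≡ r) × (y ≡ n))

  Peels : ℕ → ℕ → Set
  Peels = PeelableAt m nm1 Minimal

  gx<m : ∀ rr k → k ≤ a0 → gx rr k < m
  gx<m rr k lk = <-trans (gx<mm1 rr k lk) mm1<m

  gy-pos : ∀ d t → ¬ ((t ≡ 0) × (d ≡ b0)) → 1 ≤ gy d t
  gy-pos b1 t _ = s≤s z≤n
  gy-pos b0 (suc t) _ = s≤s z≤n
  gy-pos b0 zero h = ⊥-elim (h (refl , refl))

  U-top-E : ∀ k t d → k ≤ a0 → t ≤ nb1 → ¬ ((k ≡ 0) × (t ≡ 0) × (d ≡ b0)) → Later (prev P (gx b0 k)) (gy d t) (gx b0 k) (gy d t)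
  U-top-E zero t d lk lt h = earlier-via refl refl (K-G 0 b0 t d lk lt) refl (row0-early (gy d t) (gy-pos d t (λ { (e1 , e2) → h (refl , e1 , e2) })) (gy<n d t lt) _)
  U-top-E (suc k) t d lk lt h = earlier-via refl refl (K-G (suc k) b0 t d lk lt) (K-G k b1 t d (≤-trans (n≤1+n k) lk) lt) (blockKey-<-row k (suc k) t t (posG 1 (bitValue d) (t ≡ᵇ nb1)) (posG 0 (bitValue d) (t ≡ᵇ nb1)) (n<1+n k))

  D-bot-L : ∀ k t d → k ≤ a0 → t ≤ nb1 → Later (gx b1 k) (gy d t) (next P (gx b1 k)) (gy d t)
  D-bot-L k t d lk lt with m≤n⇒m<n∨m≡n lk
  ... | inj₁ l = later-via (next-< {P} {gx b1 k} (s≤s (gx<m b1 k lk))) refl (K-G k b1 t d lk lt) (K-G (suc k) b0 t d l lt) (blockKey-<-row k (suc k) t t (posG 1 (bitValue d) (t ≡ᵇ nb1)) (posG 0 (bitValue d) (t ≡ᵇ nb1)) (n<1+n k))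
  ... | inj₂ refl = later-via (next-< {P} {gx b1 a0} (s≤s (gx<m b1 a0 lk))) refl (K-G a0 b1 t d lk lt) (proj₂ (lastT-hd (gy d t) (gy<n d t lt))) refl

  L-left-E : ∀ k rr t → k ≤ a0 → t ≤ nb1 → ¬ ((k ≡ 0) × (rr ≡ b0) × (t ≡ 0)) → Later (gx rr k) (prev Q (gy b0 t)) (gx rr k) (gy b0 t)
  L-left-E k rr zero lk lt h = earlier-via refl refl (K-G k rr 0 b0 lk lt) refl (col-early (gx rr k) (x2 k rr h) (gx<m rr k lk) _)
    where
    x2 : ∀ k rr → ¬ ((k ≡ 0) × (rr ≡ b0) × (0 ≡ 0)) → 2 ≤ gx rr k
    x2 zero b0 h' = ⊥-elim (h' (refl , refl , refl))
    x2 zero b1 _ = s≤s (s≤s z≤n)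
    x2 (suc k) b0 _ = s≤s (s≤s z≤n)
    x2 (suc k) b1 _ = s≤s (s≤s z≤n)
  L-left-E k rr (suc t) lk lt h = earlier-via refl refl (K-G k rr (suc t) b0 lk lt) (K-G k rr t b1 lk (≤-trans (n≤1+n t) lt)) (blockKey-<-column k t (suc t) (posG (bitValue rr) 1 (t ≡ᵇ nb1)) (posG (bitValue rr) 0 (suc t ≡ᵇ nb1)) (n<1+n t))

  R-right-L : ∀ k rr t → k ≤ a0 → t < nb1 → Later (gx rr k) (gy b1 t) (gx rr k) (next Q (gy b1 t))
  R-right-L k rr t lk lt = later-via refl (next-< {Q} {gy b1 t} (<-trans (gy<n b0 (suc t) lt) (n<1+n n))) (K-G k rr t b1 lk (<⇒≤ lt)) (K-G k rr (suc t) b0 lk lt) (blockKey-<-column k t (suc t) (posG (bitValue rr) 1 (t ≡ᵇ nb1)) (posG (bitValue rr) 0 (suc t ≡ᵇ nb1)) (n<1+n t))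

  col1-vs : ∀ p → lex< (K 1 n) (blockKey 0 nb1 p) ≡ true
  col1-vs p = by-cases aligned refl
    where
    by-cases : ∀ b → aligned ≡ b → lex< (K 1 n) (blockKey 0 nb1 p) ≡ true
    by-cases true e = trans (cong (λ l → lex< l (blockKey 0 nb1 p)) (K-L1 e)) refl
    by-cases false e = col1-early e _

  R-cross-E : ∀ k rr → k ≤ a0 → Later (gx rr k) (next Q (gy b1 nb1)) (gx rr k) (gy b1 nb1)
  R-cross-E zero b0 lk = earlier-via refl (next-< {Q} {gy b1 nb1} (n<1+n n)) (K-G 0 b0 nb1 b1 lk ≤-refl) refl (trans (cong (lex< (K 1 n)) (cong (λ b → blockKey 0 nb1 (posG 0 1 b)) (≡ᵇ-refl nb1))) (col1-vs _))
  R-cross-E zero b1 lk = earlier-via refl (next-< {Q} {gy b1 nb1} (n<1+n n)) (K-G 0 b1 nb1 b1 lk ≤-refl) refl (col-early 2 ≤-refl (gx<m b1 0 lk) _)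
  R-cross-E (suc k) b0 lk = earlier-via refl (next-< {Q} {gy b1 nb1} (n<1+n n)) (K-G (suc k) b0 nb1 b1 lk ≤-refl) refl (col-early (gx b0 (suc k)) (s≤s (s≤s z≤n)) (gx<m b0 (suc k) lk) _)
  R-cross-E (suc k) b1 lk = earlier-via refl (next-< {Q} {gy b1 nb1} (n<1+n n)) (K-G (suc k) b1 nb1 b1 lk ≤-refl) refl (col-early (gx b1 (suc k)) (s≤s (s≤s z≤n)) (gx<m b1 (suc k) lk) _)

  blockKey-<-rank : ∀ k t p1 p2 → lex< (p1 ∷ []) (p2 ∷ []) ≡ true → lex< (blockKey k t p1) (blockKey k t p2) ≡ true
  blockKey-<-rank k t p1 p2 h = trans (blockKey-cons k t p1 p2) h

  dP : ∀ k → k ≤ a0 → next P (gx b0 k) ≡ gx b1 k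
  dP k lk = next-< {P} {gx b0 k} (s≤s (<⇒≤ (gx<m b1 k lk)))
  dQ : ∀ t → t ≤ nb1 → next Q (gy b0 t) ≡ gy b1 t
  dQ t lt = next-< {Q} {gy b0 t} (<-trans (gy<n b1 t lt) (n<1+n n))

  peel-mmT0 : ∀ k t → k ≤ a0 → t < nb1 → ¬ ((k ≡ 0) × (t ≡ 0)) → Peels (gx b0 k) (gy b0 t)
  peel-mmT0 k t lk lt h = star (inj₂ (U-top-E k t b0 lk (<⇒≤ lt) (λ { (e1 , e2 , _) → h (e1 , e2) })))
    (inj₁ (later-via (dP k lk) refl (K-Gmm k b0 t b0 lk lt) (K-Gmm k b1 t b0 lk lt) (blockKey-<-rank k t 1 3 refl)))
    (inj₂ (L-left-E k b0 t lk (<⇒≤ lt) (λ { (e1 , _ , e3) → h (e1 , e3) })))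
    (inj₂ (earlier-via refl (dQ t (<⇒≤ lt)) (K-Gmm k b0 t b0 lk lt) (K-Gmm k b0 t b1 lk lt) (blockKey-<-rank k t 0 1 refl))) , λ _ → inj₁ refl

  peel-mmT1 : ∀ k t → k ≤ a0 → t < nb1 → Peels (gx b0 k) (gy b1 t)
  peel-mmT1 k t lk lt = star (inj₂ (U-top-E k t b1 lk (<⇒≤ lt) (λ { (_ , _ , ()) })))
    (inj₁ (later-via (dP k lk) refl (K-Gmm k b0 t b1 lk lt) (K-Gmm k b1 t b1 lk lt) (blockKey-<-rank k t 0 2 refl)))
    (inj₁ (later-via refl refl (K-Gmm k b0 t b1 lk lt) (K-Gmm k b0 t b0 lk lt) (blockKey-<-rank k t 0 1 refl)))
    (inj₁ (R-right-L k b0 t lk lt)) , λ _ → inj₁ refl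

  peel-mmB1 : ∀ k t → k ≤ a0 → t < nb1 → Peels (gx b1 k) (gy b1 t)
  peel-mmB1 k t lk lt = star (inj₂ (earlier-via refl refl (K-Gmm k b1 t b1 lk lt) (K-Gmm k b0 t b1 lk lt) (blockKey-<-rank k t 0 2 refl)))
    (inj₁ (D-bot-L k t b1 lk (<⇒≤ lt)))
    (inj₁ (later-via refl refl (K-Gmm k b1 t b1 lk lt) (K-Gmm k b1 t b0 lk lt) (blockKey-<-rank k t 2 3 refl)))
    (inj₁ (R-right-L k b1 t lk lt)) , λ _ → inj₁ refl

  peel-mmB0 : ∀ k t → k ≤ a0 → t < nb1 → Peels (gx b1 k) (gy b0 t)
  peel-mmB0 k t lk lt = star (inj₂ (earlier-via refl refl (K-Gmm k b1 t b0 lk lt) (K-Gmm k b0 t b0 lk lt) (blockKey-<-rank k t 1 3 refl)))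
    (inj₁ (D-bot-L k t b0 lk (<⇒≤ lt)))
    (inj₂ (L-left-E k b1 t lk (<⇒≤ lt) (λ { (_ , () , _) })))
    (inj₂ (earlier-via refl (dQ t (<⇒≤ lt)) (K-Gmm k b1 t b0 lk lt) (K-Gmm k b1 t b1 lk lt) (blockKey-<-rank k t 2 3 refl))) , λ _ → inj₁ refl

  peel-mlT0 : ∀ k → k ≤ a0 → Peels (gx b0 k) (gy b0 nb1)
  peel-mlT0 k lk = star (inj₂ (U-top-E k nb1 b0 lk ≤-refl (λ { (_ , () , _) })))
    (inj₂ (earlier-via (dP k lk) refl (K-Gml k b0 b0 lk) (K-Gml k b1 b0 lk) (blockKey-<-rank k nb1 0 1 refl)))
    (inj₂ (L-left-E k b0 nb1 lk ≤-refl (λ { (_ , _ , ()) })))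
    (inj₁ (later-via refl (dQ nb1 ≤-refl) (K-Gml k b0 b0 lk) (K-Gml k b0 b1 lk) (blockKey-<-rank k nb1 1 2 refl))) , λ _ → inj₁ refl

  peel-mlT1 : ∀ k → k ≤ a0 → Peels (gx b0 k) (gy b1 nb1)
  peel-mlT1 k lk = star (inj₂ (U-top-E k nb1 b1 lk ≤-refl (λ { (_ , _ , ()) })))
    (inj₁ (later-via (dP k lk) refl (K-Gml k b0 b1 lk) (K-Gml k b1 b1 lk) (blockKey-<-rank k nb1 2 3 refl)))
    (inj₂ (earlier-via refl refl (K-Gml k b0 b1 lk) (K-Gml k b0 b0 lk) (blockKey-<-rank k nb1 1 2 refl)))
    (inj₂ (R-cross-E k b0 lk)) , λ _ → inj₁ refl

  peel-mlB0 : ∀ k → k ≤ a0 → Peels (gx b1 k) (gy b0 nb1)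
  peel-mlB0 k lk = star (inj₁ (later-via refl refl (K-Gml k b1 b0 lk) (K-Gml k b0 b0 lk) (blockKey-<-rank k nb1 0 1 refl)))
    (inj₁ (D-bot-L k nb1 b0 lk ≤-refl))
    (inj₂ (L-left-E k b1 nb1 lk ≤-refl (λ { (_ , () , _) })))
    (inj₁ (later-via refl (dQ nb1 ≤-refl) (K-Gml k b1 b0 lk) (K-Gml k b1 b1 lk) (blockKey-<-rank k nb1 0 3 refl))) , λ _ → inj₁ refl

  peel-mlB1 : ∀ k → k ≤ a0 → Peels (gx b1 k) (gy b1 nb1)
  peel-mlB1 k lk = star (inj₂ (earlier-via refl refl (K-Gml k b1 b1 lk) (K-Gml k b0 b1 lk) (blockKey-<-rank k nb1 2 3 refl)))
    (inj₁ (D-bot-L k nb1 b1 lk ≤-refl))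
    (inj₂ (earlier-via refl refl (K-Gml k b1 b1 lk) (K-Gml k b1 b0 lk) (blockKey-<-rank k nb1 0 3 refl)))
    (inj₂ (R-cross-E k b1 lk)) , λ _ → inj₁ refl

  gm0-lt : ∀ c rest → lex< gm0key (3 ∷ 5 ∷ suc c ∷ rest) ≡ true
  gm0-lt c rest = by-cases aligned refl
    where
    by-cases : ∀ b → aligned ≡ b → lex< gm0key (3 ∷ 5 ∷ suc c ∷ rest) ≡ true
    by-cases true e = trans (cong (λ l → lex< l (3 ∷ 5 ∷ suc c ∷ rest)) (gm03 e)) refl
    by-cases false e = trans (cong (λ l → lex< l (3 ∷ 5 ∷ suc c ∷ rest)) (gm01 e)) refl

  dPm1 : next P mm1 ≡ m
  dPm1 = next-< {P} {mm1} (n<1+n m)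
  dPm : next P m ≡ 0
  dPm = next-last {P} {m} refl

  lastRowsKey-<-rank : ∀ t p1 p2 → lex< (p1 ∷ []) (p2 ∷ []) ≡ true → lex< (3 ∷ 5 ∷ 3 ∷ t ∷ p1 ∷ []) (3 ∷ 5 ∷ 3 ∷ t ∷ p2 ∷ []) ≡ true
  lastRowsKey-<-rank t p1 p2 h = trans (lex<-cons t (p1 ∷ []) (p2 ∷ [])) h
  lastRowsKey-<-column : ∀ t t' p1 p2 → t < t' → lex< (3 ∷ 5 ∷ 3 ∷ t ∷ p1 ∷ []) (3 ∷ 5 ∷ 3 ∷ t' ∷ p2 ∷ []) ≡ true
  lastRowsKey-<-column t t' p1 p2 lt = lex<-head {t} {t'} (p1 ∷ []) (p2 ∷ []) lt

  peel-LS0 : Peels mm1 0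
  peel-LS0 = star (inj₂ (earlier-via refl refl K-LS0 (K-Gmm a0 b1 0 b0 ≤-refl (s≤s z≤n)) refl))
              (inj₂ (earlier-via dPm1 refl K-LS0 K-Gm0 (gm0-lt 1 [])))
              (inj₂ (earlier-via refl refl K-LS0 refl (col-early mm1 (s≤s (s≤s z≤n)) mm1<m _)))
              (inj₁ (later-via refl refl K-LS0 (K-LPt 0 b0 z≤n) refl)) , λ _ → inj₁ refl

  peel-LPT0 : ∀ t → t ≤ c0 → Peels mm1 (suc (gy b0 t))
  peel-LPT0 t le = star (inj₂ (earlier-via refl refl k (K-G a0 b1 t b1 ≤-refl (≤-trans le (n≤1+n c0))) refl))
                    (inj₁ (later-via dPm1 refl k (K-LPb t b0 le) (lastRowsKey-<-rank t 1 2 refl)))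
                    (inj₂ (left t le))
                    (inj₂ (earlier-via refl (next-< {Q} {suc (gy b0 t)} (<-trans (lpy<nm1 b1 t le) (<-trans nm1<n (n<1+n n)))) k (K-LPt t b1 le) (lastRowsKey-<-rank t 0 1 refl))) , λ _ → inj₁ refl
    where
    k : K mm1 (suc (gy b0 t)) ≡ 3 ∷ 5 ∷ 3 ∷ t ∷ 1 ∷ []
    k = K-LPt t b0 le
    left : ∀ t → t ≤ c0 → Later mm1 (prev Q (suc (gy b0 t))) mm1 (suc (gy b0 t))
    left zero le' = earlier-via refl refl (K-LPt 0 b0 le') K-LS0 refl
    left (suc t') le' = earlier-via refl refl (K-LPt (suc t') b0 le') (K-LPt t' b1 (≤-trans (n≤1+n t') le')) (lastRowsKey-<-column t' (suc t') 0 1 (n<1+n t'))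

  peel-LPT1 : ∀ t → t ≤ c0 → Peels mm1 (suc (gy b1 t))
  peel-LPT1 t le = star (inj₂ (earlier-via refl refl k (K-G a0 b1 (suc t) b0 ≤-refl (s≤s le)) refl))
                    (inj₁ (later-via dPm1 refl k (K-LPb t b1 le) (lastRowsKey-<-rank t 0 3 refl)))
                    (inj₁ (later-via refl refl k (K-LPt t b0 le) (lastRowsKey-<-rank t 0 1 refl)))
                    (inj₁ right) , λ _ → inj₁ refl
    where
    k : K mm1 (suc (gy b1 t)) ≡ 3 ∷ 5 ∷ 3 ∷ t ∷ 0 ∷ []
    k = K-LPt t b1 le
    right : Later mm1 (suc (gy b1 t)) mm1 (next Q (suc (gy b1 t)))
    right with m≤n⇒m<n∨m≡n le
    ... | inj₁ l = later-via refl (next-< {Q} {suc (gy b1 t)} (<-trans (lpy<nm1 b0 (suc t) l) (<-trans nm1<n (n<1+n n)))) k (K-LPt (suc t) b0 l) (lastRowsKey-<-column t (suc t) 0 1 (n<1+n t))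
    ... | inj₂ refl = later-via refl (next-< {Q} {suc (gy b1 c0)} (<-trans nm1<n (n<1+n n))) k K-LE1 refl

  peel-LPB0 : ∀ t → t ≤ c0 → Peels m (suc (gy b0 t))
  peel-LPB0 t le = star (inj₂ (earlier-via refl refl k (K-LPt t b0 le) (lastRowsKey-<-rank t 1 2 refl)))
                    (inj₂ (earlier-via dPm refl k refl (row0-early (suc (gy b0 t)) (s≤s z≤n) (<-trans (lpy<nm1 b0 t le) nm1<n) _)))
                    (inj₂ (left t le))
                    (inj₁ (later-via refl (next-< {Q} {suc (gy b0 t)} (<-trans (lpy<nm1 b1 t le) (<-trans nm1<n (n<1+n n)))) k (K-LPb t b1 le) (lastRowsKey-<-rank t 2 3 refl))) , λ _ → inj₁ refl
    where
    k : K m (suc (gy b0 t)) ≡ 3 ∷ 5 ∷ 3 ∷ t ∷ 2 ∷ []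
    k = K-LPb t b0 le
    left : ∀ t → t ≤ c0 → Later m (prev Q (suc (gy b0 t))) m (suc (gy b0 t))
    left zero le' = earlier-via refl refl (K-LPb 0 b0 le') K-Gm0 (gm0-lt 2 (0 ∷ 2 ∷ []))
    left (suc t') le' = earlier-via refl refl (K-LPb (suc t') b0 le') (K-LPb t' b1 (≤-trans (n≤1+n t') le')) (lastRowsKey-<-column t' (suc t') 3 2 (n<1+n t'))

  peel-LPB1 : ∀ t → t ≤ c0 → Peels m (suc (gy b1 t))
  peel-LPB1 t le = star (inj₂ (earlier-via refl refl k (K-LPt t b1 le) (lastRowsKey-<-rank t 0 3 refl)))
                    (inj₂ (earlier-via dPm refl k refl (row0-early (suc (gy b1 t)) (s≤s z≤n) (<-trans (lpy<nm1 b1 t le) nm1<n) _)))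
                    (inj₂ (earlier-via refl refl k (K-LPb t b0 le) (lastRowsKey-<-rank t 2 3 refl)))
                    (inj₁ right) , λ _ → inj₁ refl
    where
    k : K m (suc (gy b1 t)) ≡ 3 ∷ 5 ∷ 3 ∷ t ∷ 3 ∷ []
    k = K-LPb t b1 le
    right : Later m (suc (gy b1 t)) m (next Q (suc (gy b1 t)))
    right with m≤n⇒m<n∨m≡n le
    ... | inj₁ l = later-via refl (next-< {Q} {suc (gy b1 t)} (<-trans (lpy<nm1 b0 (suc t) l) (<-trans nm1<n (n<1+n n)))) k (K-LPb (suc t) b0 l) (lastRowsKey-<-column t (suc t) 3 2 (n<1+n t))
    ... | inj₂ refl = later-via refl (next-< {Q} {suc (gy b1 c0)} (<-trans nm1<n (n<1+n n))) k K-LE2 refl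

  peel-LE1 : Peels mm1 nm1
  peel-LE1 = star (inj₂ (earlier-via refl refl K-LE1 (K-Gml a0 b1 b1 ≤-refl) refl))
              (inj₁ (later-via dPm1 refl K-LE1 K-LE2 refl))
              (inj₂ (earlier-via refl refl K-LE1 (K-LPt c0 b1 ≤-refl) refl))
              (inj₂ (earlier-via refl (next-< {Q} {nm1} (n<1+n n)) K-LE1 refl (col-early mm1 (s≤s (s≤s z≤n)) mm1<m _))) , λ _ → inj₁ refl

  mn-vs : lex< (K m n) (3 ∷ 5 ∷ 5 ∷ []) ≡ true
  mn-vs = by-cases aligned refl
    where
    by-cases : ∀ b → aligned ≡ b → lex< (K m n) (3 ∷ 5 ∷ 5 ∷ []) ≡ true
    by-cases true e = trans (cong (λ l → lex< l (3 ∷ 5 ∷ 5 ∷ [])) (K-L2 e)) refl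
    by-cases false e = colm-early e _

  peel-LE2 : Peels m nm1
  peel-LE2 = star (inj₂ (earlier-via refl refl K-LE2 K-LE1 refl))
              (inj₂ (earlier-via dPm refl K-LE2 refl (row0-early nm1 (s≤s z≤n) nm1<n _)))
              (inj₂ (earlier-via refl refl K-LE2 (K-LPb c0 b1 ≤-refl) refl))
              (inj₂ (earlier-via refl (next-< {Q} {nm1} (n<1+n n)) K-LE2 refl mn-vs)) , λ h → ⊥-elim (h (refl , refl))

  grid-later : ∀ x y h rest' → 1 ≤ x → y < n → h < 3 → lex< (h ∷ rest') (K x y) ≡ true
  grid-later x y h rest' l1 ly h<3 = trans (cong (lex< (h ∷ rest')) (proj₂ (grid-hd x y l1 ly))) (lex<-head {h} {3} rest' _ h<3)

  peel-RR : ∀ y → 1 ≤ y → y < α → α ≤ n → Peels 0 y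
  peel-RR y l1 ly αn = star (inj₁ (later-via refl refl k refl (grid-later m y 2 _ (s≤s z≤n) yn (s≤s (s≤s (s≤s z≤n))))))
                        (inj₁ (later-via refl refl k refl (grid-later 1 y 2 _ (s≤s z≤n) yn (s≤s (s≤s (s≤s z≤n))))))
                        (inj₁ (left y l1 ly)) (inj₂ right) , λ _ → inj₁ refl
    where
    yn : y < n
    yn = <-≤-trans ly αn
    k : K 0 y ≡ 2 ∷ 3 ∷ (α ∸ y) ∷ []
    k = K-RR y l1 ly
    left : ∀ y → 1 ≤ y → y < α → Later 0 y 0 (prev Q y)
    left (suc zero) l1' ly' = later-via refl refl (K-RR 1 l1' ly') K-X (trans (cong (lex< (2 ∷ 3 ∷ (α ∸ 1) ∷ [])) xkey-hd) refl)
    left (suc (suc y')) l1' ly' = later-via refl refl (K-RR (suc (suc y')) l1' ly') (K-RR (suc y') (s≤s z≤n) (<-trans (n<1+n _) ly'))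
      (lex<-last (2 ∷ 3 ∷ []) {α ∸ suc (suc y')} {α ∸ suc y'} (∸-monoʳ-< (n<1+n (suc y')) (<⇒≤ ly')))
    right : Later 0 (next Q y) 0 y
    right with m≤n⇒m<n∨m≡n ly
    ... | inj₁ l = earlier-via refl (next-< {Q} {y} (<-trans (<-≤-trans l αn) (n<1+n n))) k (K-RR (suc y) (s≤s z≤n) l)
      (lex<-last (2 ∷ 3 ∷ []) {α ∸ suc y} {α ∸ y} (∸-monoʳ-< (n<1+n y) (<⇒≤ l)))
    ... | inj₂ e = earlier-via refl (next-< {Q} {y} (≤-<-trans (subst (_≤ n) (sym e) αn) (n<1+n n))) k (trans (cong (K 0) e) (K-A α1')) refl
      where
      α1' : 1 ≤ α
      α1' = subst (1 ≤_) e (s≤s z≤n)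

  peel-KU : ∀ x → 1 ≤ x → x < r → r ≤ m → ((x ≡ᵇ 1) ∧ aligned) ≡ false → ((r ≡ᵇ 1) ∧ aligned) ≡ false → ((r ≡ᵇ m) ∧ aligned) ≡ false →
         Later x n (prev P x) n → Peels x n
  peel-KU (suc x) l1 lr rm h hb1 hb2 hU = star (inj₁ hU) (inj₂ down)
       (inj₁ (later-via refl refl k refl (grid-later (suc x) nm1 2 _ (s≤s z≤n) nm1<n (s≤s (s≤s (s≤s z≤n))))))
       (inj₁ (later-via refl (next-last {Q} {n} refl) k refl (grid-later (suc x) 0 2 _ (s≤s z≤n) (s≤s z≤n) (s≤s (s≤s (s≤s z≤n)))))) , λ _ → inj₁ refl
    where
    k : K (suc x) n ≡ 2 ∷ 1 ∷ (r ∸ suc x) ∷ []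
    k = K-KU (suc x) l1 lr rm h
    down : Later (next P (suc x)) n (suc x) n
    down with m≤n⇒m<n∨m≡n lr
    ... | inj₁ l = earlier-via (next-< {P} {suc x} (<-trans (<-≤-trans l rm) (n<1+n m))) refl k (K-KU (suc (suc x)) (s≤s z≤n) l rm refl)
      (lex<-last (2 ∷ 1 ∷ []) {r ∸ suc (suc x)} {r ∸ suc x} (∸-monoʳ-< (n<1+n (suc x)) (<⇒≤ l)))
    ... | inj₂ e = earlier-via (next-< {P} {suc x} (≤-<-trans (subst (_≤ m) (sym e) rm) (n<1+n m))) refl k (trans (cong (λ z → K z n) e) (K-B (≤-trans (s≤s z≤n) lr) hb1 hb2)) refl

  peel-KD : ∀ x → 1 ≤ r → r < x → x ≤ m → ((x ≡ᵇ m) ∧ aligned) ≡ false → ((r ≡ᵇ 1) ∧ aligned) ≡ false → ((r ≡ᵇ m) ∧ aligned) ≡ false →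
         Later x n (next P x) n → Peels x n
  peel-KD (suc x) r1 lr xm h hb1 hb2 hD = star (inj₂ up) (inj₁ hD)
       (inj₁ (later-via refl refl k refl (grid-later (suc x) nm1 2 _ (s≤s z≤n) nm1<n (s≤s (s≤s (s≤s z≤n))))))
       (inj₁ (later-via refl (next-last {Q} {n} refl) k refl (grid-later (suc x) 0 2 _ (s≤s z≤n) (s≤s z≤n) (s≤s (s≤s (s≤s z≤n)))))) , λ _ → inj₁ refl
    where
    k : K (suc x) n ≡ 2 ∷ 2 ∷ suc x ∷ []
    k = K-KD (suc x) r1 lr h
    up : Later (prev P (suc x)) n (suc x) n
    up with m≤n⇒m<n∨m≡n (s≤s⁻¹ lr)
    ... | inj₁ l = earlier-via refl refl k (K-KD x r1 l (cong (_∧ aligned) (≡ᵇ-false {x} {m} (λ e → <-irrefl e (<-≤-trans (n<1+n x) xm)))))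
      (lex<-last (2 ∷ 2 ∷ []) {x} {suc x} (n<1+n x))
    ... | inj₂ e = earlier-via refl refl k (trans (cong (λ z → K z n) (sym e)) (K-B r1 hb1 hb2)) refl

  gridCover : Peels 1 0 → Peels m 0 → ∀ x y → 1 ≤ x → x ≤ m → y < n → Peels x y
  gridCover g00 gm0 (suc x') y _ xm yn with halve x' | halve y
  ... | rr , k , refl | d , t , refl with m≤n⇒m<n∨m≡n (s≤s⁻¹ (bit+double<double⇒< rr k (suc (suc a0)) xm)) | m≤n⇒m<n∨m≡n (s≤s⁻¹ (bit+double<double⇒< d t (suc (suc c0)) yn))
  ...   | inj₁ (s≤s lk) | inj₁ lt = mm rr d k t lk lt
    where
    mm : ∀ rr d k t → k ≤ a0 → t < nb1 → Peels (gx rr k) (gy d t)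
    mm b0 b0 zero zero lk' lt' = g00
    mm b0 b0 (suc k) t lk' lt' = peel-mmT0 (suc k) t lk' lt' (λ { (() , _) })
    mm b0 b0 zero (suc t) lk' lt' = peel-mmT0 0 (suc t) lk' lt' (λ { (_ , ()) })
    mm b0 b1 k t lk' lt' = peel-mmT1 k t lk' lt'
    mm b1 b0 k t lk' lt' = peel-mmB0 k t lk' lt'
    mm b1 b1 k t lk' lt' = peel-mmB1 k t lk' lt'
  ...   | inj₁ (s≤s lk) | inj₂ refl = ml rr d k lk
    where
    ml : ∀ rr d k → k ≤ a0 → Peels (gx rr k) (gy d nb1)
    ml b0 b0 k lk' = peel-mlT0 k lk'
    ml b0 b1 k lk' = peel-mlT1 k lk'
    ml b1 b0 k lk' = peel-mlB0 k lk'
    ml b1 b1 k lk' = peel-mlB1 k lk'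
  ...   | inj₂ refl | _ = last rr (gy d t) yn
    where
    lastc : ∀ (top : Bool) y → y < n → Peels (if top then mm1 else m) y
    lastc true zero _ = peel-LS0
    lastc false zero _ = gm0
    lastc top (suc y') lt' with m≤n⇒m<n∨m≡n (s≤s⁻¹ lt')
    lastc true (suc y') lt' | inj₂ refl = peel-LE1
    lastc false (suc y') lt' | inj₂ refl = peel-LE2
    lastc top (suc y') lt' | inj₁ l with halve y'
    lastc true (suc y') lt' | inj₁ l | b0 , t' , refl = peel-LPT0 t' (s≤s⁻¹ (bit+double<double⇒< b0 t' (suc c0) (s≤s⁻¹ l)))
    lastc true (suc y') lt' | inj₁ l | b1 , t' , refl = peel-LPT1 t' (s≤s⁻¹ (bit+double<double⇒< b1 t' (suc c0) (s≤s⁻¹ l)))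
    lastc false (suc y') lt' | inj₁ l | b0 , t' , refl = peel-LPB0 t' (s≤s⁻¹ (bit+double<double⇒< b0 t' (suc c0) (s≤s⁻¹ l)))
    lastc false (suc y') lt' | inj₁ l | b1 , t' , refl = peel-LPB1 t' (s≤s⁻¹ (bit+double<double⇒< b1 t' (suc c0) (s≤s⁻¹ l)))
    last : ∀ rr y → y < n → Peels (gx rr (suc a0)) y
    last b0 y lt' = lastc true y lt'
    last b1 y lt' = lastc false y lt'

  module Apart (e : aligned ≡ false) (αlt : α < n) (α1 : 1 ≤ α) (r1 : 1 ≤ r) (rm : r ≤ m) where
    c1 : ∀ x → ((x ≡ᵇ 1) ∧ aligned) ≡ false
    c1 x = trans (cong ((x ≡ᵇ 1) ∧_) e) (∧-zeroʳ _)
    cm : ∀ x → ((x ≡ᵇ m) ∧ aligned) ≡ false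
    cm x = trans (cong ((x ≡ᵇ m) ∧_) e) (∧-zeroʳ _)
    kI : K 0 n ≡ 2 ∷ 4 ∷ []
    kI = K-I αlt
    kB : K r n ≡ 1 ∷ []
    kB = K-B r1 (c1 r) (cm r)

    peel-A : Peels 0 α
    peel-A = star (inj₁ (later-via refl refl (K-A α1) refl (grid-later m α 0 [] (s≤s z≤n) αlt (s≤s z≤n))))
              (inj₁ (later-via refl refl (K-A α1) refl (grid-later 1 α 0 [] (s≤s z≤n) αlt (s≤s z≤n))))
              (inj₁ (left α refl)) (inj₁ right) , λ _ → inj₂ ((tt , tt , tt , tt) , inj₁ (refl , refl))
      where
      left : ∀ z → z ≡ α → Later 0 α 0 (prev Q z)
      left zero ez = ⊥-elim (<-irrefl ez (subst (λ w → 0 < w) refl α1))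
      left (suc zero) ez = later-via refl refl (K-A α1) K-X (trans (cong (lex< (0 ∷ [])) (xkey1 e)) refl)
      left (suc (suc z)) ez = later-via refl refl (K-A α1) (K-RR (suc z) (s≤s z≤n) (subst (suc z <_) ez (n<1+n (suc z)))) refl
      right : Later 0 α 0 (next Q α)
      right with m≤n⇒m<n∨m≡n αlt
      ... | inj₁ l = later-via refl (next-< {Q} {α} (<-trans l (n<1+n n))) (K-A α1) (K-RL (suc α) (n<1+n α) l) refl
      ... | inj₂ eq = later-via refl (next-< {Q} {α} (subst (_< Q) (sym eq) (n<1+n n))) (K-A α1) (trans (cong (K 0) eq) kI) refl

    peel-RL : ∀ y → α < y → y < n → Peels 0 y
    peel-RL (suc y) l1 ln = star (inj₁ (later-via refl refl k refl (grid-later m (suc y) 2 _ (s≤s z≤n) ln (s≤s (s≤s (s≤s z≤n))))))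
                             (inj₁ (later-via refl refl k refl (grid-later 1 (suc y) 2 _ (s≤s z≤n) ln (s≤s (s≤s (s≤s z≤n))))))
                             (inj₂ left) (inj₁ right) , λ _ → inj₁ refl
      where
      k : K 0 (suc y) ≡ 2 ∷ 0 ∷ suc y ∷ []
      k = K-RL (suc y) l1 ln
      left : Later 0 y 0 (suc y)
      left with m≤n⇒m<n∨m≡n (s≤s⁻¹ l1)
      ... | inj₁ l = earlier-via refl refl k (K-RL y l (<-trans (n<1+n y) ln)) (lex<-last (2 ∷ 0 ∷ []) {y} {suc y} (n<1+n y))
      ... | inj₂ eq = earlier-via refl refl k (trans (cong (K 0) (sym eq)) (K-A α1)) refl
      right : Later 0 (suc y) 0 (next Q (suc y))
      right with m≤n⇒m<n∨m≡n ln
      ... | inj₁ l = later-via refl (next-< {Q} {suc y} (<-trans l (n<1+n n))) k (K-RL (suc (suc y)) (<-trans l1 (n<1+n (suc y))) l) (lex<-last (2 ∷ 0 ∷ []) {suc y} {suc (suc y)} (n<1+n (suc y)))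
      ... | inj₂ eq = later-via refl (next-< {Q} {suc y} (subst (_< Q) (sym eq) (n<1+n n))) k (trans (cong (K 0) eq) kI) refl

    peel-I : Peels 0 n
    peel-I = star (inj₂ up) (inj₂ down) (inj₂ left) (inj₁ (later-via refl (next-last {Q} {n} refl) kI K-X (trans (cong (lex< (2 ∷ 4 ∷ [])) (xkey1 e)) refl))) , λ _ → inj₁ refl
      where
      up : Later m n 0 n
      up with m≤n⇒m<n∨m≡n rm
      ... | inj₁ l = earlier-via refl refl kI (K-KD m r1 l (cm m)) refl
      ... | inj₂ eq = earlier-via refl refl kI (trans (cong (λ z → K z n) (sym eq)) kB) refl
      down : Later 1 n 0 n
      down with m≤n⇒m<n∨m≡n r1
      ... | inj₁ l = earlier-via (next-< {P} {0} (s≤s (s≤s z≤n))) refl kI (K-KU 1 (s≤s z≤n) l rm (c1 1)) refl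
      ... | inj₂ eq = earlier-via (next-< {P} {0} (s≤s (s≤s z≤n))) refl kI (trans (cong (λ z → K z n) eq) kB) refl
      left : Later 0 nm1 0 n
      left with m≤n⇒m<n∨m≡n (s≤s⁻¹ αlt)
      ... | inj₁ l = earlier-via refl refl kI (K-RL nm1 l nm1<n) refl
      ... | inj₂ eq = earlier-via refl refl kI (trans (cong (K 0) (sym eq)) (K-A α1)) refl

    peel-X : Peels 0 0
    peel-X = star (inj₂ (earlier-via refl refl kX (trans K-Gm0 (gm01 e)) refl))
              (inj₁ (later-via (next-< {P} {0} (s≤s (s≤s z≤n))) refl kX (K-Gmm 0 b0 0 b0 z≤n (s≤s z≤n)) refl))
              (inj₂ (earlier-via refl refl kX kI refl))
              (inj₂ right) , λ _ → inj₁ refl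
      where
      kX : K 0 0 ≡ 3 ∷ 1 ∷ []
      kX = trans K-X (xkey1 e)
      right : Later 0 (next Q 0) 0 0
      right with m≤n⇒m<n∨m≡n α1
      ... | inj₁ l = earlier-via refl (next-< {Q} {0} (s≤s (s≤s z≤n))) kX (K-RR 1 (s≤s z≤n) l) refl
      ... | inj₂ eq = earlier-via refl (next-< {Q} {0} (s≤s (s≤s z≤n))) kX (trans (cong (K 0) eq) (K-A α1)) refl

    peel-Gm0 : Peels m 0
    peel-Gm0 = star (inj₁ (later-via refl refl k K-LS0 refl)) (inj₁ (later-via dPm refl k (trans K-X (xkey1 e)) refl))
                (inj₂ (earlier-via refl refl k refl (colm-early e _))) (inj₁ (later-via refl (next-< {Q} {0} (s≤s (s≤s z≤n))) k (K-LPb 0 b0 z≤n) refl)) , λ _ → inj₁ refl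
      where
      k : K m 0 ≡ 3 ∷ 0 ∷ []
      k = trans K-Gm0 (gm01 e)

    peel-G00 : Peels 1 0
    peel-G00 = star (inj₂ (earlier-via refl refl k (trans K-X (xkey1 e)) refl))
                (inj₁ (later-via (dP 0 z≤n) refl k (K-Gmm 0 b1 0 b0 z≤n (s≤s z≤n)) refl))
                (inj₂ (earlier-via refl refl k refl (col1-early e _)))
                (inj₂ (earlier-via refl (dQ 0 z≤n) k (K-Gmm 0 b0 0 b1 z≤n (s≤s z≤n)) refl)) , λ _ → inj₁ refl
      where
      k : K 1 0 ≡ blockKey 0 0 1
      k = K-Gmm 0 b0 0 b0 z≤n (s≤s z≤n)

    hU : ∀ x → 1 ≤ x → x < r → Later x n (prev P x) n
    hU (suc zero) l1 lr = later-via refl refl (K-KU 1 l1 lr rm (c1 1)) kI refl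
    hU (suc (suc x')) l1 lr = later-via refl refl (K-KU (suc (suc x')) l1 lr rm (c1 (suc (suc x')))) (K-KU (suc x') (s≤s z≤n) (<-trans (n<1+n _) lr) rm (c1 (suc x')))
                                 (lex<-last (2 ∷ 1 ∷ []) {r ∸ suc (suc x')} {r ∸ suc x'} (∸-monoʳ-< (n<1+n (suc x')) (<⇒≤ lr)))

    peel-KU1 : ∀ x → 1 ≤ x → x < r → Peels x n
    peel-KU1 x l1 lr = peel-KU x l1 lr rm (c1 x) (c1 r) (cm r) (hU x l1 lr)

    hD : ∀ x → r < x → x ≤ m → Later x n (next P x) n
    hD x lr xm with m≤n⇒m<n∨m≡n xm
    ... | inj₁ l = later-via (next-< {P} {x} (s≤s l)) refl (K-KD x r1 lr (cm x)) (K-KD (suc x) r1 (<-trans lr (n<1+n x)) (cm (suc x))) (lex<-last (2 ∷ 2 ∷ []) {x} {suc x} (n<1+n x))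
    ... | inj₂ refl = later-via (next-last {P} {m} refl) refl (K-KD m r1 lr (cm m)) kI refl

    peel-KD1 : ∀ x → r < x → x ≤ m → Peels x n
    peel-KD1 x lr xm = peel-KD x r1 lr xm (cm x) (c1 r) (cm r) (hD x lr xm)

    peel-B : Peels r n
    peel-B = star (inj₁ (up r refl)) (inj₁ down)
              (inj₁ (later-via refl refl kB refl (grid-later r nm1 1 [] r1 nm1<n (s≤s (s≤s z≤n)))))
              (inj₁ (later-via refl (next-last {Q} {n} refl) kB refl (grid-later r 0 1 [] r1 (s≤s z≤n) (s≤s (s≤s z≤n))))) , λ _ → inj₂ ((tt , tt , tt , tt) , inj₂ (refl , refl))
      where
      up : ∀ z → z ≡ r → Later r n (prev P z) n
      up zero ez = ⊥-elim (<-irrefl ez r1)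
      up (suc zero) ez = later-via refl refl kB kI refl
      up (suc (suc z)) ez = later-via refl refl kB (K-KU (suc z) (s≤s z≤n) (subst (suc z <_) ez (n<1+n (suc z))) rm (c1 (suc z))) refl
      down : Later r n (next P r) n
      down with m≤n⇒m<n∨m≡n rm
      ... | inj₁ l = later-via (next-< {P} {r} (s≤s l)) refl kB (K-KD (suc r) r1 (n<1+n r) (cm (suc r))) refl
      ... | inj₂ eq = later-via (next-last {P} {r} (cong suc eq)) refl kB kI refl

    peeling-order : PeelingOrder m nm1 Minimal
    peeling-order zero zero _ _ = peel-X
    peeling-order zero (suc y) _ y< with m≤n⇒m<n∨m≡n (s≤s⁻¹ y<)
    ... | inj₂ eq = subst (Peels 0) (sym eq) peel-I
    ... | inj₁ yn with <-cmp (suc y) α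
    ...   | tri< a _ _ = peel-RR (suc y) (s≤s z≤n) a (<⇒≤ αlt)
    ...   | tri≈ _ b _ = subst (Peels 0) (sym b) peel-A
    ...   | tri> _ _ c = peel-RL (suc y) c yn
    peeling-order (suc x) y x< y< with m≤n⇒m<n∨m≡n (s≤s⁻¹ y<)
    ... | inj₁ yn = gridCover peel-G00 peel-Gm0 (suc x) y (s≤s z≤n) (s≤s⁻¹ x<) yn
    ... | inj₂ refl with <-cmp (suc x) r
    ...   | tri< a _ _ = peel-KU1 (suc x) (s≤s z≤n) a
    ...   | tri≈ _ b _ = subst (λ z → Peels z n) (sym b) peel-B
    ...   | tri> _ _ c = peel-KD1 (suc x) c (s≤s⁻¹ x<)

  module Aligned (e : aligned ≡ true) (eα : α ≡ n) (r2 : 2 ≤ r) (rlt : r < m) where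
    r1 : 1 ≤ r
    r1 = ≤-trans (s≤s z≤n) r2
    cr1 : ((r ≡ᵇ 1) ∧ aligned) ≡ false
    cr1 = cong (_∧ aligned) (≡ᵇ-false {r} {1} (λ eq → <-irrefl (sym eq) r2))
    crm : ((r ≡ᵇ m) ∧ aligned) ≡ false
    crm = cong (_∧ aligned) (≡ᵇ-false {r} {m} (λ eq → <-irrefl eq rlt))
    kB : K r n ≡ 1 ∷ []
    kB = K-B r1 cr1 crm
    kA : K 0 n ≡ 0 ∷ []
    kA = trans (cong (K 0) (sym eα)) (K-A (subst (1 ≤_) (sym eα) (s≤s z≤n)))
    kX : K 0 0 ≡ 3 ∷ 3 ∷ []
    kX = trans K-X (xkey3 e)
    kGm0 : K m 0 ≡ 3 ∷ 5 ∷ 0 ∷ []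
    kGm0 = trans K-Gm0 (gm03 e)
    kL1 : K 1 n ≡ l1key
    kL1 = K-L1 e
    kL2 : K m n ≡ l2key
    kL2 = K-L2 e
    k00 : K 1 0 ≡ blockKey 0 0 1
    k00 = K-Gmm 0 b0 0 b0 z≤n (s≤s z≤n)
    nα : nm1 < α
    nα = subst (nm1 <_) (sym eα) nm1<n

    peel-A : Peels 0 n
    peel-A = star (inj₁ (later-via refl refl kA kL2 refl)) (inj₁ (later-via (next-< {P} {0} (s≤s (s≤s z≤n))) refl kA kL1 refl))
              (inj₁ (later-via refl refl kA (K-RR nm1 (s≤s z≤n) nα) refl)) (inj₁ (later-via refl (next-last {Q} {n} refl) kA kX refl)) ,
              λ _ → inj₂ ((tt , tt , tt , tt) , inj₁ (refl , sym eα))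

    peel-X : Peels 0 0
    peel-X = star (inj₁ (later-via refl refl kX kGm0 refl)) (inj₂ (earlier-via (next-< {P} {0} (s≤s (s≤s z≤n))) refl kX k00 refl))
              (inj₂ (earlier-via refl refl kX kA refl)) (inj₂ (earlier-via refl (next-< {Q} {0} (s≤s (s≤s z≤n))) kX (K-RR 1 (s≤s z≤n) (≤-<-trans (s≤s z≤n) nα)) refl)) , λ _ → inj₁ refl

    peel-Gm0 : Peels m 0
    peel-Gm0 = star (inj₁ (later-via refl refl kGm0 K-LS0 refl)) (inj₂ (earlier-via dPm refl kGm0 kX refl))
                (inj₁ (later-via refl refl kGm0 kL2 refl)) (inj₁ (later-via refl (next-< {Q} {0} (s≤s (s≤s z≤n))) kGm0 (K-LPb 0 b0 z≤n) refl)) , λ _ → inj₁ refl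

    peel-G00 : Peels 1 0
    peel-G00 = star (inj₁ (later-via refl refl k00 kX refl))
                (inj₁ (later-via (dP 0 z≤n) refl k00 (K-Gmm 0 b1 0 b0 z≤n (s≤s z≤n)) refl))
                (inj₁ (later-via refl refl k00 kL1 refl))
                (inj₂ (earlier-via refl (dQ 0 z≤n) k00 (K-Gmm 0 b0 0 b1 z≤n (s≤s z≤n)) refl)) , λ _ → inj₁ refl

    peel-L1 : Peels 1 n
    peel-L1 = star (inj₂ (earlier-via refl refl kL1 kA refl)) (inj₂ down)
               (inj₁ (later-via refl refl kL1 (K-Gml 0 b0 b1 z≤n) refl))
               (inj₂ (earlier-via refl (next-last {Q} {n} refl) kL1 k00 refl)) , λ _ → inj₁ refl
      where
      down : Later (next P 1) n 1 n
      down with m≤n⇒m<n∨m≡n r2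
      ... | inj₁ l = earlier-via (next-< {P} {1} (s≤s (s≤s (s≤s z≤n)))) refl kL1 (K-KU 2 (s≤s z≤n) l (<⇒≤ rlt) refl) refl
      ... | inj₂ eq = earlier-via (next-< {P} {1} (s≤s (s≤s (s≤s z≤n)))) refl kL1 (trans (cong (λ z → K z n) eq) kB) refl

    peel-L2 : Peels m n
    peel-L2 = star (inj₂ (earlier-via refl refl kL2 refl (col-early mm1 (s≤s (s≤s z≤n)) mm1<m _)))
               (inj₂ (earlier-via dPm refl kL2 kA refl))
               (inj₁ (later-via refl refl kL2 K-LE2 refl))
               (inj₂ (earlier-via refl (next-last {Q} {n} refl) kL2 kGm0 refl)) , λ _ → inj₁ refl

    hU : ∀ x → 2 ≤ x → x < r → Later x n (prev P x) n
    hU (suc zero) (s≤s ()) lr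
    hU (suc (suc zero)) l2 lr = later-via refl refl (K-KU 2 (s≤s z≤n) lr (<⇒≤ rlt) refl) kL1 refl
    hU (suc (suc (suc x'))) l2 lr = later-via refl refl (K-KU (suc (suc (suc x'))) (s≤s z≤n) lr (<⇒≤ rlt) refl) (K-KU (suc (suc x')) (s≤s z≤n) (<-trans (n<1+n _) lr) (<⇒≤ rlt) refl)
                                 (lex<-last (2 ∷ 1 ∷ []) {r ∸ suc (suc (suc x'))} {r ∸ suc (suc x')} (∸-monoʳ-< (n<1+n (suc (suc x'))) (<⇒≤ lr)))

    peel-K1 : ∀ x → 2 ≤ x → x < r → Peels x n
    peel-K1 (suc zero) (s≤s ()) lr
    peel-K1 (suc (suc x)) l2 lr = peel-KU (suc (suc x)) (s≤s z≤n) lr (<⇒≤ rlt) refl cr1 crm (hU (suc (suc x)) l2 lr)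

    cxm : ∀ x → x < m → ((x ≡ᵇ m) ∧ aligned) ≡ false
    cxm x l = cong (_∧ aligned) (≡ᵇ-false {x} {m} (λ eq → <-irrefl eq l))

    hD : ∀ x → r < x → x < m → Later x n (next P x) n
    hD x lr xm with m≤n⇒m<n∨m≡n xm
    ... | inj₁ l = later-via (next-< {P} {x} (s≤s xm)) refl (K-KD x r1 lr (cxm x xm)) (K-KD (suc x) r1 (<-trans lr (n<1+n x)) (cxm (suc x) l)) (lex<-last (2 ∷ 2 ∷ []) {x} {suc x} (n<1+n x))
    ... | inj₂ eq = later-via (next-< {P} {x} (s≤s xm)) refl (K-KD x r1 lr (cxm x xm)) (trans (cong (λ z → K z n) eq) kL2) refl

    peel-K2 : ∀ x → r < x → x < m → Peels x n
    peel-K2 x lr xm = peel-KD x r1 lr (<⇒≤ xm) (cxm x xm) cr1 crm (hD x lr xm)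

    peel-B : Peels r n
    peel-B = star (inj₁ (up r refl)) (inj₁ down)
              (inj₁ (later-via refl refl kB refl (grid-later r nm1 1 [] r1 nm1<n (s≤s (s≤s z≤n)))))
              (inj₁ (later-via refl (next-last {Q} {n} refl) kB refl (grid-later r 0 1 [] r1 (s≤s z≤n) (s≤s (s≤s z≤n))))) , λ _ → inj₂ ((tt , tt , tt , tt) , inj₂ (refl , refl))
      where
      up : ∀ z → z ≡ r → Later r n (prev P z) n
      up zero ez = ⊥-elim (<-irrefl ez (≤-trans (s≤s z≤n) r2))
      up (suc zero) ez = ⊥-elim (<-irrefl ez r2)
      up (suc (suc zero)) ez = later-via refl refl kB kL1 refl
      up (suc (suc (suc z))) ez = later-via refl refl kB (K-KU (suc (suc z)) (s≤s z≤n) (subst (suc (suc z) <_) ez (n<1+n _)) (<⇒≤ rlt) refl) refl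
      down : Later r n (next P r) n
      down with m≤n⇒m<n∨m≡n rlt
      ... | inj₁ l = later-via (next-< {P} {r} (s≤s rlt)) refl kB (K-KD (suc r) r1 (n<1+n r) (cxm (suc r) l)) refl
      ... | inj₂ eq = later-via (next-< {P} {r} (s≤s rlt)) refl kB (trans (cong (λ z → K z n) eq) kL2) refl

    peeling-order : PeelingOrder m nm1 Minimal
    peeling-order zero zero _ _ = peel-X
    peeling-order zero (suc y) _ y< with m≤n⇒m<n∨m≡n (s≤s⁻¹ y<)
    ... | inj₂ eq = subst (Peels 0) (sym eq) peel-A
    ... | inj₁ yn = peel-RR (suc y) (s≤s z≤n) (subst (suc y <_) (sym eα) yn) (subst (_≤ n) (sym eα) ≤-refl)
    peeling-order (suc x) y x< y< with m≤n⇒m<n∨m≡n (s≤s⁻¹ y<)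
    ... | inj₁ yn = gridCover peel-G00 peel-Gm0 (suc x) y (s≤s z≤n) (s≤s⁻¹ x<) yn
    ... | inj₂ refl with m≤n⇒m<n∨m≡n (s≤s⁻¹ x<)
    ...   | inj₂ eq = subst (λ z → Peels z n) (sym eq) peel-L2
    ...   | inj₁ xm with x
    ...     | zero = peel-L1
    ...     | suc x' with <-cmp (suc (suc x')) r
    ...       | tri< a _ _ = peel-K1 (suc (suc x')) (s≤s (s≤s z≤n)) a
    ...       | tri≈ _ b _ = subst (λ z → Peels z n) (sym b) peel-B
    ...       | tri> _ _ c = peel-K2 (suc (suc x')) c xm

-- Choosing the vertices without earlier neighbours

numV≡p*q : ∀ p q → numV p q ≡ p * q
numV≡p*q p q = trans (sumV-const p q 1) (cong (p *_) (*-identityʳ q))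

Source≗Sink : ∀ {p q} (T : Subset p q) → SameSet (Source T) (Sink T)
Source≗Sink T v rewrite deg≡4 v with T v
... | true  = refl
... | false = refl

card-Source≢1 : ∀ {p q} → 4 ≤ p → 4 ≤ q → (T : Subset p q) → CondS p q T → card (Source T) ≢ 1
card-Source≢1 {p} {q} 4≤p 4≤q T (_ , unique-source) card≡1 with unique-source card≡1
... | inj₁ numV≡1 = p*q≢1 4≤p 4≤q (trans (sym (numV≡p*q p q)) numV≡1)
  where
  p*q≢1 : ∀ {m n} → 4 ≤ m → 4 ≤ n → m * n ≢ 1
  p*q≢1 (s≤s (s≤s _)) (s≤s (s≤s _)) ()
... | inj₂ source≠sink = source≠sink (Source≗Sink T)

search : ∀ {p q} (f : V p q → Bool) → (∀ v → f v ≡ false) ⊎ ∃ λ v → f v ≡ true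
search f with any? (λ i → any? (λ j → f (i , j) Bool.≟ true))
... | yes (i , j , hit) = inj₂ ((i , j) , hit)
... | no  none          = inj₁ (λ (i , j) → ¬-not (λ hit → none (i , j , hit)))

exists-outside : ∀ {p q} (S R : Subset p q) → (∀ v → R v ≡ true → S v ≡ true) → card S ≢ card R →
  ∃ λ v → S v ≡ true × R v ≡ false
exists-outside S R R⊆S card≢ with search (λ v → S v ∧ not (R v))
... | inj₂ (v , hit) = v , ∧-left hit , trans (sym (not-involutive (R v))) (cong not (∧-right hit))
... | inj₁ none      = ⊥-elim (card≢ (sumV-cong (λ v → cong ind (S≡R v))))
  where
  S≡R : ∀ v → S v ≡ R v
  S≡R v with S v in Sv | R v in Rv | none v
  ... | true  | true  | _  = refl
  ... | false | false | _  = refl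
  ... | false | true  | _  = trans (sym Sv) (R⊆S v Rv)
  ... | true  | false | ()

eqV-false⇒≢ : ∀ {p q} {u v : V p q} → eqV u v ≡ false → u ≢ v
eqV-false⇒≢ {u = u} u≠v refl with () ← trans (sym (eqV-refl u)) u≠v

exists-second : ∀ {p q} (S : Subset p q) (a : V p q) → S a ≡ true → card S ≢ 1 →
  ∃ λ b → S b ≡ true × b ≢ a
exists-second S a Sa card≢1
  with exists-outside S (λ v → eqV v a) (λ v v≡a → subst (λ w → S w ≡ true) (sym (eqV⇒≡ v≡a)) Sa)
                      (λ eq → card≢1 (trans eq (sumV-ind-eqV a)))
... | b , Sb , b≠a = b , Sb , eqV-false⇒≢ b≠a

exists-third : ∀ {p q} (S : Subset p q) (a b : V p q) → S a ≡ true → S b ≡ true → b ≢ a →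
  parity (card S) ≡ true → ∃ λ c → S c ≡ true × c ≢ a × c ≢ b
exists-third S a b Sa Sb b≢a odd with exists-outside S pair pair⊆S card≢2
  where
  pair : Subset _ _
  pair v = eqV v a ∨ eqV v b
  pair⊆S : ∀ v → pair v ≡ true → S v ≡ true
  pair⊆S v v∈pair with eqV v a in v≡a
  ... | true  = subst (λ w → S w ≡ true) (sym (eqV⇒≡ v≡a)) Sa
  ... | false = subst (λ w → S w ≡ true) (sym (eqV⇒≡ v∈pair)) Sb
  card-pair : card pair ≡ 2
  card-pair = trans (sumV-cong split) (trans (sumV-+ (λ v → ind (eqV v a)) (λ v → ind (eqV v b)))
                                             (cong₂ _+_ (sumV-ind-eqV a) (sumV-ind-eqV b)))
    where
    split : ∀ v → ind (pair v) ≡ ind (eqV v a) + ind (eqV v b)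
    split v with eqV v a in v≡a | eqV v b in v≡b
    ... | true  | true  = ⊥-elim (b≢a (trans (sym (eqV⇒≡ {u = v} {b} v≡b)) (eqV⇒≡ {u = v} {a} v≡a)))
    ... | true  | false = refl
    ... | false | true  = refl
    ... | false | false = refl
  card≢2 : card S ≢ card pair
  card≢2 eq with () ← trans (sym odd) (cong parity (trans eq card-pair))
... | c , Sc , c∉pair = c , Sc , eqV-false⇒≢ (∨-false-left c∉pair) , eqV-false⇒≢ (∨-false-right c∉pair)
  where
  ∨-false-left : ∀ {x y} → (x ∨ y) ≡ false → x ≡ false
  ∨-false-left {false} _ = refl
  ∨-false-right : ∀ {x y} → (x ∨ y) ≡ false → y ≡ false
  ∨-false-right {false} eq = eq

parity-* : ∀ m n → parity (m * n) ≡ parity m ∧ parity n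
parity-* zero    n = refl
parity-* (suc m) n = trans (parity-+ n (m * n)) (trans (cong (parity n xor_) (parity-* m n)) (by-cases (parity m) (parity n)))
  where
  by-cases : ∀ a b → b xor (a ∧ b) ≡ not a ∧ b
  by-cases true  true  = refl
  by-cases true  false = refl
  by-cases false true  = refl
  by-cases false false = refl

parity-double : ∀ k → parity (double k) ≡ false
parity-double zero    = refl
parity-double (suc k) = trans (not-involutive _) (parity-double k)

card+card-Source : ∀ {p q} (T : Subset p q) → card T + card (Source T) ≡ numV p q
card+card-Source T = trans (sym (sumV-+ (λ v → ind (T v)) (λ v → ind (not (T v))))) (sumV-cong (λ v → one (T v)))
  where
  one : ∀ b → ind b + ind (not b) ≡ 1
  one true  = refl
  one false = refl

parity-card-Source : ∀ a₀ c₀ → let p = suc (double (suc (suc a₀))) ; q = suc (double (suc (suc c₀))) in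
  (T : Subset p q) → CondP p q T → parity (card (Source T)) ≡ true
parity-card-Source a₀ c₀ T even-ET = xor-cancelʳ _ _ (parity (card T)) (begin
  parity (card (Source T)) xor parity (card T)  ≡⟨ xor-comm (parity (card (Source T))) _ ⟩
  parity (card T) xor parity (card (Source T))  ≡⟨ sym (parity-+ (card T) _) ⟩
  parity (card T + card (Source T))             ≡⟨ cong parity (trans (card+card-Source T) (numV≡p*q p q)) ⟩
  parity (p * q)                                ≡⟨ parity-* p q ⟩
  parity p ∧ parity q                           ≡⟨ cong₂ _∧_ (odd a₀) (odd c₀) ⟩
  true                                          ≡⟨ cong not (sym parity-T) ⟩
  true xor parity (card T)                      ∎)
  where
  open ≡-Reasoning
  p q : ℕ
  p = suc (double (suc (suc a₀)))
  q = suc (double (suc (suc c₀)))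
  odd : ∀ k → parity (suc (double (suc (suc k)))) ≡ true
  odd k = cong not (parity-double (suc (suc k)))
  parity-T : parity (card T) ≡ false
  parity-T = trans (cong (_xor parity (card T)) (sym parity-E))
                   (trans (sym (parity-+ (numE p q) (card T))) (Even⇒parity {numE p q + card T} even-ET))
    where
    parity-E : parity (numE p q) ≡ false
    parity-E = trans (cong parity (sumV-const p q 2))
                     (trans (parity-* p (q * 2)) (trans (cong (parity p ∧_) (trans (parity-* q 2) (∧-zeroʳ (parity q))))
                                                        (∧-zeroʳ (parity p))))

data Dir : Set where
  dN dU dR dL : Dir

move : ∀ {p q} → Dir → V p q → V p q
move dN = dnV
move dU = upV
move dR = rtV
move dL = lfV

Adj : ∀ {p q} → V p q → V p q → Set
Adj u w = Σ Dir (λ d → w ≡ move d u)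

adj? : ∀ {p q} (u w : V p q) → Adj u w ⊎ ¬ Adj u w
adj? u w with w ≟V dnV u | w ≟V upV u | w ≟V rtV u | w ≟V lfV u
... | yes e | _     | _     | _     = inj₁ (dN , e)
... | no _  | yes e | _     | _     = inj₁ (dU , e)
... | no _  | no _  | yes e | _     = inj₁ (dR , e)
... | no _  | no _  | no _  | yes e = inj₁ (dL , e)
... | no ¬N | no ¬U | no ¬R | no ¬L = inj₂ λ { (dN , e) → ¬N e ; (dU , e) → ¬U e ; (dR , e) → ¬R e ; (dL , e) → ¬L e }

module LongCycle (N′ : ℕ) {i : Fin (suc (suc (suc (suc (suc N′)))))} where

  private
    N : ℕ
    N = suc (suc (suc (suc (suc N′))))

    apart : ∀ {x y k l} → offset i x ≡ k → offset i y ≡ l → k ≢ l → x ≢ y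
    apart x↦k y↦l k≢l x≡y = k≢l (trans (sym x↦k) (trans (cong (offset i) x≡y) y↦l))

  offset-cyc-self : offset i (cyc i) ≡ 1
  offset-cyc-self = trans (offset-cyc i i) (cong (next N) (offset-self i))

  offset-cyc²-self : offset i (cyc (cyc i)) ≡ 2
  offset-cyc²-self = trans (offset-cyc i (cyc i)) (cong (next N) offset-cyc-self)

  offset-cyc⁻¹-self : offset i (cyc⁻¹ i) ≡ suc (suc (suc (suc N′)))
  offset-cyc⁻¹-self = trans (offset-cyc⁻¹ i i) (cong (prev N) (offset-self i))

  offset-cyc⁻²-self : offset i (cyc⁻¹ (cyc⁻¹ i)) ≡ suc (suc (suc N′))
  offset-cyc⁻²-self = trans (offset-cyc⁻¹ i (cyc⁻¹ i)) (cong (prev N) (offset-cyc⁻¹-self))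

  cyc≢id : cyc i ≢ i
  cyc≢id = apart offset-cyc-self (offset-self i) (λ ())

  cyc⁻¹≢id : cyc⁻¹ i ≢ i
  cyc⁻¹≢id = apart offset-cyc⁻¹-self (offset-self i) (λ ())

  cyc≢cyc⁻¹ : cyc i ≢ cyc⁻¹ i
  cyc≢cyc⁻¹ = apart offset-cyc-self offset-cyc⁻¹-self (λ ())

  cyc²≢cyc⁻¹ : cyc (cyc i) ≢ cyc⁻¹ i
  cyc²≢cyc⁻¹ = apart offset-cyc²-self offset-cyc⁻¹-self (λ ())

  cyc⁻²≢cyc : cyc⁻¹ (cyc⁻¹ i) ≢ cyc i
  cyc⁻²≢cyc = apart offset-cyc⁻²-self offset-cyc-self (λ ())

  cyc²≢id : cyc (cyc i) ≢ i
  cyc²≢id = apart offset-cyc²-self (offset-self i) (λ ())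

  cyc⁻²≢id : cyc⁻¹ (cyc⁻¹ i) ≢ i
  cyc⁻²≢id = apart offset-cyc⁻²-self (offset-self i) (λ ())

module _ {p′ q′ : ℕ} where

  private
    module P = LongCycle p′
    module Q = LongCycle q′

  no-triangle-at : ∀ {i : Fin (suc (suc (suc (suc (suc p′)))))} {j : Fin (suc (suc (suc (suc (suc q′)))))} d₁ d₂ d₃ →
    d₁ ≢ d₂ → move d₂ (i , j) ≡ move d₃ (move d₁ (i , j)) → ⊥
  no-triangle-at {i} {j} dN dN _ ne e = ne refl
  no-triangle-at {i} {j} dU dU _ ne e = ne refl
  no-triangle-at {i} {j} dR dR _ ne e = ne refl
  no-triangle-at {i} {j} dL dL _ ne e = ne refl
  no-triangle-at {i} {j} dN dU dN _ e = P.cyc²≢cyc⁻¹ {i} (sym (cong proj₁ e))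
  no-triangle-at {i} {j} dN dU dU _ e = P.cyc⁻¹≢id {i} (trans (cong proj₁ e) (cyc⁻¹-cyc i))
  no-triangle-at {i} {j} dN dU dR _ e = Q.cyc≢id {j} (sym (cong proj₂ e))
  no-triangle-at {i} {j} dN dU dL _ e = Q.cyc⁻¹≢id {j} (sym (cong proj₂ e))
  no-triangle-at {i} {j} dN dR dN _ e = P.cyc²≢id {i} (sym (cong proj₁ e))
  no-triangle-at {i} {j} dN dR dU _ e = Q.cyc≢id {j} (cong proj₂ e)
  no-triangle-at {i} {j} dN dR dR _ e = P.cyc≢id {i} (sym (cong proj₁ e))
  no-triangle-at {i} {j} dN dR dL _ e = P.cyc≢id {i} (sym (cong proj₁ e))
  no-triangle-at {i} {j} dN dL dN _ e = P.cyc²≢id {i} (sym (cong proj₁ e))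
  no-triangle-at {i} {j} dN dL dU _ e = Q.cyc⁻¹≢id {j} (cong proj₂ e)
  no-triangle-at {i} {j} dN dL dR _ e = P.cyc≢id {i} (sym (cong proj₁ e))
  no-triangle-at {i} {j} dN dL dL _ e = P.cyc≢id {i} (sym (cong proj₁ e))
  no-triangle-at {i} {j} dU dN dN _ e = P.cyc≢id {i} (trans (cong proj₁ e) (cyc-cyc⁻¹ i))
  no-triangle-at {i} {j} dU dN dU _ e = P.cyc⁻²≢cyc {i} (sym (cong proj₁ e))
  no-triangle-at {i} {j} dU dN dR _ e = Q.cyc≢id {j} (sym (cong proj₂ e))
  no-triangle-at {i} {j} dU dN dL _ e = Q.cyc⁻¹≢id {j} (sym (cong proj₂ e))
  no-triangle-at {i} {j} dU dR dN _ e = Q.cyc≢id {j} (cong proj₂ e)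
  no-triangle-at {i} {j} dU dR dU _ e = P.cyc⁻²≢id {i} (sym (cong proj₁ e))
  no-triangle-at {i} {j} dU dR dR _ e = P.cyc⁻¹≢id {i} (sym (cong proj₁ e))
  no-triangle-at {i} {j} dU dR dL _ e = P.cyc⁻¹≢id {i} (sym (cong proj₁ e))
  no-triangle-at {i} {j} dU dL dN _ e = Q.cyc⁻¹≢id {j} (cong proj₂ e)
  no-triangle-at {i} {j} dU dL dU _ e = P.cyc⁻²≢id {i} (sym (cong proj₁ e))
  no-triangle-at {i} {j} dU dL dR _ e = P.cyc⁻¹≢id {i} (sym (cong proj₁ e))
  no-triangle-at {i} {j} dU dL dL _ e = P.cyc⁻¹≢id {i} (sym (cong proj₁ e))
  no-triangle-at {i} {j} dR dN dN _ e = Q.cyc≢id {j} (sym (cong proj₂ e))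
  no-triangle-at {i} {j} dR dN dU _ e = P.cyc≢cyc⁻¹ {i} (cong proj₁ e)
  no-triangle-at {i} {j} dR dN dR _ e = P.cyc≢id {i} (cong proj₁ e)
  no-triangle-at {i} {j} dR dN dL _ e = P.cyc≢id {i} (cong proj₁ e)
  no-triangle-at {i} {j} dR dU dN _ e = P.cyc≢cyc⁻¹ {i} (sym (cong proj₁ e))
  no-triangle-at {i} {j} dR dU dU _ e = Q.cyc≢id {j} (sym (cong proj₂ e))
  no-triangle-at {i} {j} dR dU dR _ e = P.cyc⁻¹≢id {i} (cong proj₁ e)
  no-triangle-at {i} {j} dR dU dL _ e = P.cyc⁻¹≢id {i} (cong proj₁ e)
  no-triangle-at {i} {j} dR dL dN _ e = P.cyc≢id {i} (sym (cong proj₁ e))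
  no-triangle-at {i} {j} dR dL dU _ e = P.cyc⁻¹≢id {i} (sym (cong proj₁ e))
  no-triangle-at {i} {j} dR dL dR _ e = Q.cyc²≢cyc⁻¹ {j} (sym (cong proj₂ e))
  no-triangle-at {i} {j} dR dL dL _ e = Q.cyc⁻¹≢id {j} (trans (cong proj₂ e) (cyc⁻¹-cyc j))
  no-triangle-at {i} {j} dL dN dN _ e = Q.cyc⁻¹≢id {j} (sym (cong proj₂ e))
  no-triangle-at {i} {j} dL dN dU _ e = P.cyc≢cyc⁻¹ {i} (cong proj₁ e)
  no-triangle-at {i} {j} dL dN dR _ e = P.cyc≢id {i} (cong proj₁ e)
  no-triangle-at {i} {j} dL dN dL _ e = P.cyc≢id {i} (cong proj₁ e)
  no-triangle-at {i} {j} dL dU dN _ e = P.cyc≢cyc⁻¹ {i} (sym (cong proj₁ e))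
  no-triangle-at {i} {j} dL dU dU _ e = Q.cyc⁻¹≢id {j} (sym (cong proj₂ e))
  no-triangle-at {i} {j} dL dU dR _ e = P.cyc⁻¹≢id {i} (cong proj₁ e)
  no-triangle-at {i} {j} dL dU dL _ e = P.cyc⁻¹≢id {i} (cong proj₁ e)
  no-triangle-at {i} {j} dL dR dN _ e = P.cyc≢id {i} (sym (cong proj₁ e))
  no-triangle-at {i} {j} dL dR dU _ e = P.cyc⁻¹≢id {i} (sym (cong proj₁ e))
  no-triangle-at {i} {j} dL dR dR _ e = Q.cyc≢id {j} (trans (cong proj₂ e) (cyc-cyc⁻¹ j))
  no-triangle-at {i} {j} dL dR dL _ e = Q.cyc⁻²≢cyc {j} (sym (cong proj₂ e))

  triangle-free : ∀ (a b c : V (suc (suc (suc (suc (suc p′))))) (suc (suc (suc (suc (suc q′)))))) →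
    Adj a b → Adj a c → b ≢ c → ¬ Adj b c
  triangle-free (i , j) b c (d₁ , refl) (d₂ , refl) b≢c (d₃ , c≡) = no-triangle-at d₁ d₂ d₃ (λ { refl → b≢c refl }) c≡

even-columns : ∀ p₀ h₀ (T : Subset (suc (suc (suc (suc p₀)))) (double (suc (suc h₀)))) → CondP _ _ T →
  ∀ a → T a ≡ false → Result _ _ T
even-columns p₀ h₀ T even-ET a a∉T =
  Chart.orientation-from-grid T E.KE a E.peeling-order (n<1+n _) (<-trans (n<1+n _) (<-trans (n<1+n _) (n<1+n _))) minimal∉T even-ET
  where
  module E = EvenWidthOrder p₀ h₀
  minimal∉T : ∀ v → E.Minimal (offset (proj₁ a) (proj₁ v)) (offset (proj₂ a) (proj₂ v)) → T v ≡ false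
  minimal∉T v (x≡0 , y≡0) = subst (λ w → T w ≡ false) (sym (cong₂ _,_ (offset-zero _ _ x≡0) (offset-zero _ _ y≡0))) a∉T

even-rows : ∀ h₀ q₀ (T : Subset (double (suc (suc h₀))) (suc (suc (suc (suc q₀))))) → CondP _ _ T →
  ∀ a → T a ≡ false → Result _ _ T
even-rows h₀ q₀ T even-ET a a∉T =
  Chart.orientation-from-grid T (flip E.KE) a (transpose E.peeling-order) (<-trans (n<1+n _) (<-trans (n<1+n _) (n<1+n _))) (n<1+n _)
    minimal∉T even-ET
  where
  module E = EvenWidthOrder q₀ h₀
  minimal∉T : ∀ v → E.Minimal (offset (proj₂ a) (proj₂ v)) (offset (proj₁ a) (proj₁ v)) → T v ≡ false
  minimal∉T v (y≡0 , x≡0) = subst (λ w → T w ≡ false) (sym (cong₂ _,_ (offset-zero _ _ x≡0) (offset-zero _ _ y≡0))) a∉T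

module OddTorus (a₀ c₀ : ℕ) where

  m n P Q : ℕ
  m = double (suc (suc a₀))
  n = double (suc (suc c₀))
  P = suc m
  Q = suc n

  private
    module LP = LongCycle (double a₀)
    module LQ = LongCycle (double c₀)

  offset-from-cyc : ∀ {N′} (b : Fin (suc (suc (suc (suc (suc N′)))))) → offset (cyc b) b ≡ suc (suc (suc (suc N′)))
  offset-from-cyc {N′} b = trans (cong (offset (cyc b)) (sym (cyc⁻¹-cyc b))) (LongCycle.offset-cyc⁻¹-self N′ {i = cyc b})

  offset-from-cyc² : ∀ {N′} (b : Fin (suc (suc (suc (suc (suc N′)))))) → offset (cyc (cyc b)) b ≡ suc (suc (suc N′))
  offset-from-cyc² {N′} b = trans (cong (offset (cyc (cyc b))) (sym (trans (cong cyc⁻¹ (cyc⁻¹-cyc (cyc b))) (cyc⁻¹-cyc b))))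
                                  (LongCycle.offset-cyc⁻²-self N′ {i = cyc (cyc b)})

  module _ (T : Subset P Q) (even-ET : CondP P Q T) where

    different-rows-and-columns : (u w : V P Q) → T u ≡ false → T w ≡ false → proj₁ u ≢ proj₁ w →
      1 ≤ offset (cyc (proj₂ w)) (proj₂ u) → offset (cyc (proj₂ w)) (proj₂ u) < n → Result P Q T
    different-rows-and-columns (ui , uj) (wi , wj) u∉T w∉T ui≢wi 1≤α α<n =
      Chart.orientation-from-grid T O.K (ui , cyc wj) (O.Apart.peeling-order refl α<n 1≤α 1≤r r≤m) (n<1+n m) (<-trans (n<1+n _) (n<1+n n))
        minimal∉T even-ET
      where
      r α : ℕ
      r = offset ui wi
      α = offset (cyc wj) uj
      module O = TwoMinimaOrder a₀ c₀ r α false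
      1≤r : 1 ≤ r
      1≤r with r in r≡
      ... | zero  = ⊥-elim (ui≢wi (sym (offset-zero ui wi r≡)))
      ... | suc _ = s≤s z≤n
      r≤m : r ≤ m
      r≤m = s≤s⁻¹ (offset< ui wi)
      minimal∉T : ∀ v → O.Minimal (offset ui (proj₁ v)) (offset (cyc wj) (proj₂ v)) → T v ≡ false
      minimal∉T v (inj₁ (x≡0 , y≡α)) = subst (λ z → T z ≡ false) (sym (offsets-injective (ui , cyc wj) (trans x≡0 (sym (offset-self ui))) y≡α)) u∉T
      minimal∉T v (inj₂ (x≡r , y≡n)) = subst (λ z → T z ≡ false) (sym (offsets-injective (ui , cyc wj) x≡r (trans y≡n (sym (offset-from-cyc wj))))) w∉T

    same-column : (u w : V P Q) → T u ≡ false → T w ≡ false → proj₁ u ≢ proj₁ w → proj₂ u ≡ proj₂ w → ¬ Adj u w → Result P Q T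
    same-column (ui , uj) (wi , .uj) u∉T w∉T ui≢wi refl non-adj =
      Chart.orientation-from-grid T O.K (ui , cyc uj) (O.Aligned.peeling-order refl refl 2≤r r<m) (n<1+n m) (<-trans (n<1+n _) (n<1+n n))
        minimal∉T even-ET
      where
      r : ℕ
      r = offset ui wi
      module O = TwoMinimaOrder a₀ c₀ r n true
      2≤r : 2 ≤ r
      2≤r with r in r≡
      ... | zero        = ⊥-elim (ui≢wi (sym (offset-zero ui wi r≡)))
      ... | suc zero    = ⊥-elim (non-adj (dN , cong (_, uj) (offset-injective ui (trans r≡ (sym (LP.offset-cyc-self {i = ui}))))))
      ... | suc (suc _) = s≤s (s≤s z≤n)
      r<m : r < m
      r<m with m≤n⇒m<n∨m≡n (s≤s⁻¹ (offset< ui wi))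
      ... | inj₁ r<m = r<m
      ... | inj₂ r≡m = ⊥-elim (non-adj (dU , cong (_, uj) (offset-injective ui (trans r≡m (sym (LP.offset-cyc⁻¹-self {i = ui}))))))
      minimal∉T : ∀ v → O.Minimal (offset ui (proj₁ v)) (offset (cyc uj) (proj₂ v)) → T v ≡ false
      minimal∉T v (inj₁ (x≡0 , y≡n)) = subst (λ z → T z ≡ false) (sym (offsets-injective (ui , cyc uj) (trans x≡0 (sym (offset-self ui))) (trans y≡n (sym (offset-from-cyc uj))))) u∉T
      minimal∉T v (inj₂ (x≡r , y≡n)) = subst (λ z → T z ≡ false) (sym (offsets-injective (ui , cyc uj) x≡r (trans y≡n (sym (offset-from-cyc uj))))) w∉T

    same-row : (u w : V P Q) → T u ≡ false → T w ≡ false → u ≢ w → proj₁ u ≡ proj₁ w → ¬ Adj u w → Result P Q T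
    same-row (ui , uj) (.ui , wj) u∉T w∉T u≢w refl non-adj =
      Chart.orientation-from-grid T (flip O.K) (cyc ui , uj) (transpose (O.Aligned.peeling-order refl refl 2≤r r<n))
        (<-trans (n<1+n _) (n<1+n m)) (n<1+n n) minimal∉T even-ET
      where
      r : ℕ
      r = offset uj wj
      module O = TwoMinimaOrder c₀ a₀ r m true
      2≤r : 2 ≤ r
      2≤r with r in r≡
      ... | zero        = ⊥-elim (u≢w (cong (ui ,_) (sym (offset-zero uj wj r≡))))
      ... | suc zero    = ⊥-elim (non-adj (dR , cong (ui ,_) (offset-injective uj (trans r≡ (sym (LQ.offset-cyc-self {i = uj}))))))
      ... | suc (suc _) = s≤s (s≤s z≤n)
      r<n : r < n
      r<n with m≤n⇒m<n∨m≡n (s≤s⁻¹ (offset< uj wj))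
      ... | inj₁ r<n = r<n
      ... | inj₂ r≡n = ⊥-elim (non-adj (dL , cong (ui ,_) (offset-injective uj (trans r≡n (sym (LQ.offset-cyc⁻¹-self {i = uj}))))))
      minimal∉T : ∀ v → O.Minimal (offset uj (proj₂ v)) (offset (cyc ui) (proj₁ v)) → T v ≡ false
      minimal∉T v (inj₁ (y≡0 , x≡m)) = subst (λ z → T z ≡ false) (sym (offsets-injective (cyc ui , uj) (trans x≡m (sym (offset-from-cyc ui))) (trans y≡0 (sym (offset-self uj))))) u∉T
      minimal∉T v (inj₂ (y≡r , x≡m)) = subst (λ z → T z ≡ false) (sym (offsets-injective (cyc ui , uj) (trans x≡m (sym (offset-from-cyc ui))) y≡r)) w∉T

    non-adjacent : (u w : V P Q) → T u ≡ false → T w ≡ false → u ≢ w → ¬ Adj u w → Result P Q T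
    non-adjacent (ui , uj) (wi , wj) u∉T w∉T u≢w non-adj with ui ≟F wi
    ... | yes ui≡wi = same-row (ui , uj) (wi , wj) u∉T w∉T u≢w ui≡wi non-adj
    ... | no  ui≢wi with offset (cyc wj) uj in α≡
    ...   | zero = different-rows-and-columns (wi , wj) (ui , uj) w∉T u∉T (λ eq → ui≢wi (sym eq))
                     (subst (1 ≤_) (sym α′≡) (s≤s z≤n)) (subst (_< n) (sym α′≡) (n<1+n _))
      where
      α′≡ : offset (cyc uj) wj ≡ suc (suc (suc (double c₀)))
      α′≡ = trans (cong (λ z → offset (cyc z) wj) (offset-zero (cyc wj) uj α≡)) (offset-from-cyc² wj)
    ...   | suc α′ with m≤n⇒m<n∨m≡n (s≤s⁻¹ (subst (_< Q) α≡ (offset< (cyc wj) uj)))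
    ...     | inj₁ α<n = different-rows-and-columns (ui , uj) (wi , wj) u∉T w∉T ui≢wi
                           (subst (1 ≤_) (sym α≡) (s≤s z≤n)) (subst (_< n) (sym α≡) α<n)
    ...     | inj₂ α≡n = same-column (ui , uj) (wi , wj) u∉T w∉T ui≢wi
                           (offset-injective (cyc wj) (trans α≡ (trans α≡n (sym (offset-from-cyc wj))))) non-adj

source⇒∉ : ∀ {p q} (T : Subset p q) v → Source T v ≡ true → T v ≡ false
source⇒∉ T v src with T v
... | false = refl

non-adjacent-pair : ∀ {p′ q′} (a b c : V (suc (suc (suc (suc (suc p′))))) (suc (suc (suc (suc (suc q′)))))) →
  b ≢ a → c ≢ a → c ≢ b → ∃ λ u → ∃ λ w → (u ≡ a ⊎ u ≡ b) × (w ≡ b ⊎ w ≡ c) × u ≢ w × ¬ Adj u w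
non-adjacent-pair a b c b≢a c≢a c≢b with adj? a b | adj? a c
... | inj₂ ¬ab | _        = a , b , inj₁ refl , inj₁ refl , (λ eq → b≢a (sym eq)) , ¬ab
... | inj₁ ab  | inj₂ ¬ac = a , c , inj₁ refl , inj₂ refl , (λ eq → c≢a (sym eq)) , ¬ac
... | inj₁ ab  | inj₁ ac  = b , c , inj₂ refl , inj₂ refl , (λ eq → c≢b (sym eq)) , triangle-free a b c ab ac (λ eq → c≢b (sym eq))

module _ (a₀ c₀ : ℕ) where

  open OddTorus a₀ c₀ using (P; Q; non-adjacent)

  odd-torus : (T : Subset P Q) → CondP P Q T → card (Source T) ≢ 1 → ∀ a → T a ≡ false → Result P Q T
  odd-torus T even-ET card≢1 a a∉T = from-second (exists-second (Source T) a (cong not a∉T) card≢1)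
    where
    from-second : (∃ λ b → Source T b ≡ true × b ≢ a) → Result P Q T
    from-second (b , b-src , b≢a) =
      from-third (exists-third (Source T) a b (cong not a∉T) b-src b≢a (parity-card-Source a₀ c₀ T even-ET))
      where
      from-third : (∃ λ c → Source T c ≡ true × c ≢ a × c ≢ b) → Result P Q T
      from-third (c , c-src , c≢a , c≢b) = from-pair (non-adjacent-pair a b c b≢a c≢a c≢b)
        where
        from-pair : (∃ λ u → ∃ λ w → (u ≡ a ⊎ u ≡ b) × (w ≡ b ⊎ w ≡ c) × u ≢ w × ¬ Adj u w) → Result P Q T
        from-pair (u , w , inj₁ refl , inj₁ refl , u≢w , ¬adj) = non-adjacent T even-ET u w a∉T (source⇒∉ T b b-src) u≢w ¬adj
        from-pair (u , w , inj₁ refl , inj₂ refl , u≢w , ¬adj) = non-adjacent T even-ET u w a∉T (source⇒∉ T c c-src) u≢w ¬adj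
        from-pair (u , w , inj₂ refl , inj₁ refl , u≢w , ¬adj) = non-adjacent T even-ET u w (source⇒∉ T b b-src) (source⇒∉ T b b-src) u≢w ¬adj
        from-pair (u , w , inj₂ refl , inj₂ refl , u≢w , ¬adj) = non-adjacent T even-ET u w (source⇒∉ T b b-src) (source⇒∉ T c c-src) u≢w ¬adj

torus-orientation : ∀ p q → 4 ≤ p → 4 ≤ q → (T : Subset p q) → CondP p q T → card (Source T) ≢ 1 →
  ∀ a → T a ≡ false → Result p q T
torus-orientation (suc (suc (suc (suc p₀)))) (suc (suc (suc (suc q₀)))) (s≤s (s≤s (s≤s (s≤s _)))) (s≤s (s≤s (s≤s (s≤s _))))
  T even-ET card≢1 a a∉T
  with halve p₀ | halve q₀
... | _             | b0 , h′ , refl = even-columns p₀ h′ T even-ET a a∉T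
... | b0 , h , refl | b1 , h′ , refl = even-rows h (suc (double h′)) T even-ET a a∉T
... | b1 , h , refl | b1 , h′ , refl = odd-torus h h′ T even-ET card≢1 a a∉T

lemma13 : (p q : ℕ) → 4 ≤ p → 4 ≤ q → (T : Subset p q) →
    CondP p q T → CondS p q T → CondSbar p q T →
    ∃ λ (o : Orientation p q) → TOdd o T × Acyclic o
lemma13 p q 4≤p 4≤q T even-ET cond-S _ =
  torus-orientation p q 4≤p 4≤q T even-ET (card-Source≢1 4≤p 4≤q T cond-S) a (source⇒∉ T a a-src)
  where
  a : V p q
  a = proj₁ (proj₁ cond-S)
  a-src : Source T a ≡ true
  a-src = proj₂ (proj₁ cond-S)
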